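{- Let $q$ be an odd prime power and let $\gamma,\delta\in\mathbb{F}_{q^2}$ with $\gamma\neq 0$. Then the polynomial $$f(x)=(x^q-x+\delta)^{q+2}+\gamma x$$ is a permutation polynomial of $\mathbb{F}_{q^2}$ if and only if one of the following holds: (i) $\gamma\in\mathbb{F}_q^*$, $3\mid q$ and $\left(\mathrm{Tr}_q^{q^2}(\delta)\right)^2-\mathrm{Tr}_q^{q^2}(\gamma)$ is a square in $\mathbb{F}_q$; (ii) $\gamma\in\mathbb{F}_q^*$, $q\equiv 2\pmod 3$ and $\left(\mathrm{Tr}_q^{q^2}(\delta)\right)^2=\mathrm{Tr}_q^{q^2}(\gamma)$; (iii) $\gamma\in\mathbb{F}_{q^2}^*\setminus\mathbb{F}_q$ and $\mathrm{Tr}_q^{q^2}(\delta)=\mathrm{Tr}_q^{q^2}(\gamma)=0$; (iv) $\gamma\in\mathbb{F}_{q^2}^*\setminus\mathbb{F}_q$, $\mathrm{Tr}_q^{q^2}(\delta)=0$, $\mathrm{Tr}_q^{q^2}(\gamma)\neq 0$, $3\mid q$ and $-\mathrm{N}_q^{q^2}(\gamma)/\mathrm{Tr}_q^{q^2}(\gamma)$ is a square in $\mathbb{F}_q$; (v) $\gamma\in\mathbb{F}_{q^2}^*\setminus\mathbb{F}_q$, $\mathrm{Tr}_q^{q^2}(\delta)\neq 0$, $\mathrm{Tr}_q^{q^2}(\gamma)\neq0$, $q\equiv 2\pmod 3$ and $$\left(\mathrm{Tr}_q^{q^2}(\delta)\,\mathrm{Tr}_q^{q^2}(\gamma)\ri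ght)^2=\mathrm{N}_q^{q^2}(\gamma)\left(\left(\mathrm{Tr}_q^{q^2}(\delta)\right)^2+3\,\mathrm{Tr}_q^{q^2}(\gamma)\right).$$
   Context: A polynomial over a finite field $\mathbb{F}$ is a permutation polynomial of $\mathbb{F}$ if the map it induces on $\mathbb{F}$ is a bijection. For $x\in\mathbb{F}_{q^2}$, $\mathrm{Tr}_q^{q^2}(x)=x+x^q$ and $\mathrm{N}_q^{q^2}(x)=x^{q+1}$, both lying in $\mathbb{F}_q$. -}

module Defs where

open import Level using (Level; _⊔_) renaming (suc to lsuc)
open import Data.Nat as ℕ using (ℕ; _%_; _≤_)
open import Data.Nat.Primality using (Prime)
open import Data.Fin using (Fin)
open import Data.Product using (Σ; ∃; _×_; _,_)
open import Data.Sum using (_⊎_)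
open import Relation.Nullary using (¬_)
open import Relation.Binary.PropositionalEquality using (_≡_)
import Relation.Binary.PropositionalEquality as P
open import Algebra.Bundles using (CommutativeRing; Semiring)
import Algebra.Definitions.RawSemiring as RS
open import Function.Definitions using (Bijective)
open import Function.Bundles using (Bijection)

record Field (c ℓ : Level) : Set (lsuc (c ⊔ ℓ)) where
  field
    commutativeRing : CommutativeRing c ℓ
  open CommutativeRing commutativeRing public
  open RS (Semiring.rawSemiring semiring) public using (_^_)
  field
    _⁻¹       : Carrier → Carrier
    0≉1       : ¬ (0# ≈ 1#)
    ⁻¹-inverse : ∀ x → ¬ (x ≈ 0#) → x * (x ⁻¹) ≈ 1#

OddPrimePower : ℕ → Set
OddPrimePower q = Σ ℕ λ p → Σ ℕ λ k → Prime p × 1 ≤ k × q ≡ p ℕ.^ k × q % 2 ≡ 1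

module FieldNotions {c ℓ : Level} (K : Field c ℓ) where
  open Field K

  HasSize : ℕ → Set (c ⊔ ℓ)
  HasSize n = Bijection (P.setoid (Fin n)) setoid

  InSubfield : ℕ → Carrier → Set ℓ
  InSubfield q x = x ^ q ≈ x

  Tr : ℕ → Carrier → Carrier
  Tr q x = x + x ^ q

  Nm : ℕ → Carrier → Carrier
  Nm q x = x ^ (q ℕ.+ 1)

  IsSquareIn : ℕ → Carrier → Set (c ⊔ ℓ)
  IsSquareIn q a = ∃ λ y → InSubfield q y × (y * y ≈ a)

  IsPermutation : (Carrier → Carrier) → Set (c ⊔ ℓ)
  IsPermutation f = Bijective _≈_ _≈_ f

  three : Carrier
  three = 1# + 1# + 1#

{-# OPTIONS --safe #-}
module Submission where

-- K = 𝔽 ⊕ ε𝔽, where 𝔽 = 𝔽_q is the fixed field of the Frobenius σ x = x ^ q and σ ε = - ε.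
-- Putting x = w - (ε r + a - δ) / 2 with r, w ∈ 𝔽 and a = Tr δ / 2 turns x ^ q - x + δ into ε r + a, and then
-- f x = c₀ + U r w + ε V r w with U, V ∈ 𝔽 affine in w. Writing γ = g₁ + ε g₂, the combination g₂ U - g₁ V
-- eliminates w, so f permutes K exactly when the cubic r ↦ g₂ U - g₁ V is injective on 𝔽, i.e. when its
-- divided difference Q(r, s) has no zero with r ≠ s. The classical analysis of cubics over 𝔽_q (degenerate;
-- characteristic 3; otherwise completing the cube, where x ↦ x³ is bijective on 𝔽 iff q ≡ 2 (mod 3))
-- yields conditions (i)–(v). The square-class facts about 𝔽 used there come from a pigeonhole count.

open import Defs
open import Level using (Level; _⊔_)
open import Algebra.Bundles using (CommutativeRing; CommutativeMonoid; Semiring)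
open import Data.Nat as ℕ using (ℕ; zero; suc; z≤n; s≤s; _%_)
import Data.Nat.Properties as ℕ
open import Data.Nat.Combinatorics using (_C_; nCk+nC[k+1]≡[n+1]C[k+1]; nCn≡1)
open import Data.Nat.DivMod using (m≡m%n+[m/n]*n; m%n<n; _/_)
open import Data.Nat.Divisibility as ℕ using (_∣_; divides)
open import Data.Nat.Primality using (Prime; prime?; euclidsLemma; prime⇒irreducible; ¬prime[0]; ¬prime[1])
open import Data.Nat.Solver using (module +-*-Solver)
open import Data.Integer as ℤ using (ℤ; +_; -[1+_])
import Data.Integer.Properties as ℤ
open import Data.Fin as Fin using (Fin)
import Data.Fin.Properties as Fin
import Data.Fin.Permutation as Permutation
open import Data.List using (List; []; _∷_; length; replicate)
import Data.List.Properties as List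
open import Data.Maybe using (Maybe; just; nothing)
open import Data.Maybe.Properties using (just-injective)
open import Data.Bool using (Bool; true; false; not; T)
open import Data.Bool.Properties using (not-injective)
open import Data.Unit using (tt)
open import Data.Product using (∃; _×_; _,_; proj₁; proj₂)
open import Data.Sum using (_⊎_; inj₁; inj₂; [_,_]′; reduce)
open import Data.Sum.Properties using (inj₁-injective; inj₂-injective)
open import Data.Empty using (⊥; ⊥-elim)
open import Function.Base using (_∘_)
open import Function.Bundles using (Bijection; Equivalence; _⇔_; mk⇔)
open import Function.Definitions using (Injective)
import Function.Properties.Equivalence as ⇔
open import Relation.Nullary using (¬_; ¬?; Dec; yes; no; contradiction)
open import Relation.Nullary.Decidable using (toWitness; decidable-stable)
open import Relation.Binary.PropositionalEquality as ≡ using (_≡_)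
import Algebra.Solver.Ring.AlmostCommutativeRing as ACR
import Algebra.Properties.CommutativeMonoid.Sum as Sum

module IntegerCoefficientSolver {c ℓ} (R : CommutativeRing c ℓ) where
  open CommutativeRing R
  open import Algebra.Properties.Ring ring using (-‿involutive; -‿anti-homo-+; -0#≈0#; -‿+-comm; -‿distribˡ-*; -‿distribʳ-*)
  -- With the tail-call optimised multiplication, 1 · 1# reduces to 1#, so con (+ 1) denotes 1# on the nose.
  open import Algebra.Properties.Semiring.Mult.TCOptimised semiring using (×-homo-+; ×1-homo-*) renaming (_×_ to _·_)
  open import Relation.Binary.Reasoning.Setoid setoid

  fromℤ : ℤ → Carrier
  fromℤ (+ n) = n · 1#
  fromℤ -[1+ n ] = - (suc n · 1#)

  fromℤ-neg : ∀ i → fromℤ (ℤ.- i) ≈ - fromℤ i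
  fromℤ-neg (+ zero) = sym -0#≈0#
  fromℤ-neg (+ suc n) = refl
  fromℤ-neg -[1+ n ] = sym (-‿involutive _)

  private
    x≈[x+y]-y : ∀ x y → x ≈ (x + y) - y
    x≈[x+y]-y x y = begin
      x             ≈⟨ sym (+-identityʳ x) ⟩
      x + 0#        ≈⟨ +-congˡ (sym (-‿inverseʳ y)) ⟩
      x + (y - y)   ≈⟨ sym (+-assoc x y (- y)) ⟩
      (x + y) - y   ∎

    ×1-homo-∸ : ∀ {m n} → n ℕ.≤ m → (m ℕ.∸ n) · 1# ≈ m · 1# - n · 1#
    ×1-homo-∸ {m} {n} n≤m = begin
      (m ℕ.∸ n) · 1#                      ≈⟨ x≈[x+y]-y _ (n · 1#) ⟩
      ((m ℕ.∸ n) · 1# + n · 1#) - n · 1#  ≈⟨ +-congʳ (sym (×-homo-+ 1# (m ℕ.∸ n) n)) ⟩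
      ((m ℕ.∸ n) ℕ.+ n) · 1# - n · 1#     ≡⟨ ≡.cong (λ k → k · 1# - n · 1#) (ℕ.m∸n+n≡m n≤m) ⟩
      m · 1# - n · 1#                     ∎

  fromℤ-⊖ : ∀ m n → fromℤ (m ℤ.⊖ n) ≈ m · 1# - n · 1#
  fromℤ-⊖ m n with ℕ.≤-<-connex n m
  ... | inj₁ n≤m = trans (reflexive (≡.cong fromℤ (ℤ.⊖-≥ n≤m))) (×1-homo-∸ n≤m)
  ... | inj₂ m<n = begin
    fromℤ (m ℤ.⊖ n)                ≡⟨ ≡.cong fromℤ (ℤ.⊖-< m<n) ⟩
    fromℤ (ℤ.- (+ (n ℕ.∸ m)))      ≈⟨ fromℤ-neg (+ (n ℕ.∸ m)) ⟩
    - ((n ℕ.∸ m) · 1#)             ≈⟨ -‿cong (×1-homo-∸ (ℕ.<⇒≤ m<n)) ⟩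
    - (n · 1# - m · 1#)            ≈⟨ -‿anti-homo-+ (n · 1#) (- (m · 1#)) ⟩
    - - (m · 1#) - n · 1#          ≈⟨ +-congʳ (-‿involutive _) ⟩
    m · 1# - n · 1#                ∎

  fromℤ-+ : ∀ i j → fromℤ (i ℤ.+ j) ≈ fromℤ i + fromℤ j
  fromℤ-+ (+ m) (+ n) = ×-homo-+ 1# m n
  fromℤ-+ (+ m) -[1+ n ] = fromℤ-⊖ m (suc n)
  fromℤ-+ -[1+ m ] (+ n) = trans (fromℤ-⊖ n (suc m)) (+-comm _ _)
  fromℤ-+ -[1+ m ] -[1+ n ] = begin
    - (suc (suc (m ℕ.+ n)) · 1#)      ≡⟨ ≡.cong (λ k → - (k · 1#)) (≡.sym (ℕ.+-suc (suc m) n)) ⟩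
    - ((suc m ℕ.+ suc n) · 1#)        ≈⟨ -‿cong (×-homo-+ 1# (suc m) (suc n)) ⟩
    - (suc m · 1# + suc n · 1#)       ≈⟨ sym (-‿+-comm _ _) ⟩
    - (suc m · 1#) + - (suc n · 1#)   ∎

  private
    fromℤ-*-+ : ∀ m n → fromℤ (+ m ℤ.* + n) ≈ fromℤ (+ m) * fromℤ (+ n)
    fromℤ-*-+ m n = trans (reflexive (≡.cong fromℤ (≡.sym (ℤ.pos-* m n)))) (×1-homo-* m n)

  fromℤ-* : ∀ i j → fromℤ (i ℤ.* j) ≈ fromℤ i * fromℤ j
  fromℤ-* (+ m) (+ n) = fromℤ-*-+ m n
  fromℤ-* (+ m) -[1+ n ] = begin
    fromℤ (+ m ℤ.* ℤ.- (+ suc n))      ≡⟨ ≡.cong fromℤ (≡.sym (ℤ.neg-distribʳ-* (+ m) (+ suc n))) ⟩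
    fromℤ (ℤ.- (+ m ℤ.* + suc n))      ≈⟨ fromℤ-neg (+ m ℤ.* + suc n) ⟩
    - fromℤ (+ m ℤ.* + suc n)          ≈⟨ -‿cong (fromℤ-*-+ m (suc n)) ⟩
    - (fromℤ (+ m) * fromℤ (+ suc n))  ≈⟨ -‿distribʳ-* _ _ ⟩
    fromℤ (+ m) * fromℤ -[1+ n ]       ∎
  fromℤ-* -[1+ m ] (+ n) = begin
    fromℤ (ℤ.- (+ suc m) ℤ.* + n)      ≡⟨ ≡.cong fromℤ (≡.sym (ℤ.neg-distribˡ-* (+ suc m) (+ n))) ⟩
    fromℤ (ℤ.- (+ suc m ℤ.* + n))      ≈⟨ fromℤ-neg (+ suc m ℤ.* + n) ⟩
    - fromℤ (+ suc m ℤ.* + n)          ≈⟨ -‿cong (fromℤ-*-+ (suc m) n) ⟩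
    - (fromℤ (+ suc m) * fromℤ (+ n))  ≈⟨ -‿distribˡ-* _ _ ⟩
    fromℤ -[1+ m ] * fromℤ (+ n)       ∎
  fromℤ-* -[1+ m ] -[1+ n ] = begin
    fromℤ (+ suc m ℤ.* + suc n)              ≈⟨ fromℤ-*-+ (suc m) (suc n) ⟩
    fromℤ (+ suc m) * fromℤ (+ suc n)        ≈⟨ sym (-‿involutive _) ⟩
    - - (fromℤ (+ suc m) * fromℤ (+ suc n))  ≈⟨ -‿cong (-‿distribˡ-* _ _) ⟩
    - (fromℤ -[1+ m ] * fromℤ (+ suc n))     ≈⟨ -‿distribʳ-* _ _ ⟩
    fromℤ -[1+ m ] * fromℤ -[1+ n ]          ∎

  fromℤ-morphism : ℤ.+-*-rawRing ACR.-Raw-AlmostCommutative⟶ ACR.fromCommutativeRing R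
  fromℤ-morphism = record
    { ⟦_⟧ = fromℤ ; +-homo = fromℤ-+ ; *-homo = fromℤ-* ; -‿homo = fromℤ-neg
    ; 0-homo = refl ; 1-homo = refl }

  fromℤ-≟ : ∀ i j → Maybe (fromℤ i ≈ fromℤ j)
  fromℤ-≟ i j with i ℤ.≟ j
  ... | yes ≡.refl = just refl
  ... | no _ = nothing

  open import Algebra.Solver.Ring ℤ.+-*-rawRing (ACR.fromCommutativeRing R) fromℤ-morphism fromℤ-≟ public
    using (solve; _:=_; _:+_; _:*_; _:-_; :-_; _:^_; con; Polynomial)

[1+k]*[1+n]C[1+k]≡[1+n]*nCk : ∀ n k → suc k ℕ.* (suc n C suc k) ≡ suc n ℕ.* (n C k)
[1+k]*[1+n]C[1+k]≡[1+n]*nCk zero zero = ≡.refl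
[1+k]*[1+n]C[1+k]≡[1+n]*nCk zero (suc k) = ℕ.*-zeroʳ (suc (suc k))
[1+k]*[1+n]C[1+k]≡[1+n]*nCk (suc n) k = begin
  suc k ℕ.* (suc (suc n) C suc k)                       ≡⟨ ≡.cong (suc k ℕ.*_) (≡.sym (nCk+nC[k+1]≡[n+1]C[k+1] (suc n) k)) ⟩
  suc k ℕ.* (suc n C k ℕ.+ suc n C suc k)               ≡⟨ ℕ.*-distribˡ-+ (suc k) (suc n C k) _ ⟩
  suc k ℕ.* (suc n C k) ℕ.+ suc k ℕ.* (suc n C suc k)   ≡⟨ ≡.cong (suc k ℕ.* (suc n C k) ℕ.+_) ([1+k]*[1+n]C[1+k]≡[1+n]*nCk n k) ⟩
  suc k ℕ.* (suc n C k) ℕ.+ suc n ℕ.* (n C k)           ≡⟨ absorb k ⟩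
  suc (suc n) ℕ.* (suc n C k)                           ∎
  where
  open ≡.≡-Reasoning
  absorb : ∀ k → suc k ℕ.* (suc n C k) ℕ.+ suc n ℕ.* (n C k) ≡ suc (suc n) ℕ.* (suc n C k)
  absorb zero = ≡.refl
  absorb (suc k) = begin
    suc (suc k) ℕ.* A ℕ.+ suc n ℕ.* (n C suc k)              ≡⟨ ℕ.+-assoc A (suc k ℕ.* A) _ ⟩
    A ℕ.+ (suc k ℕ.* A ℕ.+ suc n ℕ.* (n C suc k))            ≡⟨ ≡.cong (λ z → A ℕ.+ (z ℕ.+ suc n ℕ.* (n C suc k))) ([1+k]*[1+n]C[1+k]≡[1+n]*nCk n k) ⟩
    A ℕ.+ (suc n ℕ.* (n C k) ℕ.+ suc n ℕ.* (n C suc k))      ≡⟨ ≡.cong (A ℕ.+_) (≡.sym (ℕ.*-distribˡ-+ (suc n) (n C k) (n C suc k))) ⟩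
    A ℕ.+ suc n ℕ.* (n C k ℕ.+ n C suc k)                    ≡⟨ ≡.cong (λ z → A ℕ.+ suc n ℕ.* z) (nCk+nC[k+1]≡[n+1]C[k+1] n k) ⟩
    suc (suc n) ℕ.* A                                        ∎
    where A = suc n C suc k

p∣pCk : ∀ {p k} → Prime p → 0 ℕ.< k → k ℕ.< p → p ∣ p C k
p∣pCk {suc n} {suc k} p-prime _ k<p
  with euclidsLemma (suc k) (suc n C suc k) p-prime
         (divides (n C k) (≡.trans ([1+k]*[1+n]C[1+k]≡[1+n]*nCk n k) (ℕ.*-comm (suc n) (n C k))))
... | inj₁ p∣1+k = contradiction (ℕ.∣⇒≤ p∣1+k) (ℕ.<⇒≱ k<p)
... | inj₂ p∣pCk = p∣pCk

3∣p^k⇒p≡3 : ∀ {p} → Prime p → ∀ k → 3 ∣ p ℕ.^ k → p ≡ 3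
3∣p^k⇒p≡3 p-prime zero 3∣1 = contradiction (ℕ.∣⇒≤ 3∣1) (ℕ.<⇒≱ (s≤s (s≤s z≤n)))
3∣p^k⇒p≡3 {p} p-prime (suc k) 3∣p^[1+k] with euclidsLemma p (p ℕ.^ k) (toWitness {a? = prime? 3} tt) 3∣p^[1+k]
... | inj₂ 3∣p^k = 3∣p^k⇒p≡3 p-prime k 3∣p^k
... | inj₁ 3∣p with prime⇒irreducible p-prime 3∣p
...   | inj₁ ()
...   | inj₂ 3≡p = ≡.sym 3≡p

2≤p^k : ∀ {p} k → Prime p → 1 ℕ.≤ k → 2 ℕ.≤ p ℕ.^ k
2≤p^k {0} _ 0-prime _ = contradiction 0-prime ¬prime[0]
2≤p^k {1} _ 1-prime _ = contradiction 1-prime ¬prime[1]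
2≤p^k {suc (suc p)} (suc k) _ _ = ℕ.≤-trans (s≤s (s≤s z≤n)) (ℕ.m≤m*n (suc (suc p)) (suc (suc p) ℕ.^ k) {{ℕ.m^n≢0 (suc (suc p)) k}})

[2+3t]+[1+3t]≡3[2t+1] : ∀ t → (2 ℕ.+ t ℕ.* 3) ℕ.+ (1 ℕ.+ t ℕ.* 3) ≡ 3 ℕ.* (2 ℕ.* t ℕ.+ 1)
[2+3t]+[1+3t]≡3[2t+1] = solve 1 (λ t → (con 2 :+ t :* con 3) :+ (con 1 :+ t :* con 3) := con 3 :* (con 2 :* t :+ con 1)) ≡.refl
  where open +-*-Solver

[1+3t]²≡1+3[t[2+3t]] : ∀ t → (1 ℕ.+ t ℕ.* 3) ℕ.* (1 ℕ.+ t ℕ.* 3) ≡ 1 ℕ.+ 3 ℕ.* (t ℕ.* (2 ℕ.+ t ℕ.* 3))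
[1+3t]²≡1+3[t[2+3t]] = solve 1 (λ t → (con 1 :+ t :* con 3) :* (con 1 :+ t :* con 3) := con 1 :+ con 3 :* (t :* (con 2 :+ t :* con 3))) ≡.refl
  where open +-*-Solver

q%3≡2⇒3∤q : ∀ {q} → q % 3 ≡ 2 → ¬ 3 ∣ q
q%3≡2⇒3∤q {q} q%3≡2 3∣q = contradiction (≡.trans (≡.sym q%3≡2) (ℕ.n∣m⇒m%n≡0 q 3 3∣q)) λ ()

module FreshmansDream {c ℓ} (R : CommutativeRing c ℓ) {p} (p-prime : Prime p) where
  open CommutativeRing R
  open import Algebra.Properties.Semiring.Mult semiring using (×-assoc-*; ×-assocˡ; ×-congʳ) renaming (_×_ to _·_)
  open import Algebra.Definitions.RawSemiring (Semiring.rawSemiring semiring) using (_^_)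
  open import Algebra.Properties.Semiring.Exp semiring using (^-assocʳ; ^-congˡ)
  open import Algebra.Properties.CommutativeSemiring.Binomial commutativeSemiring using (theorem; binomialTerm)
  open import Algebra.Properties.CommutativeMonoid.Sum +-commutativeMonoid using (sum; sum-init-last; sum-cong-≋; sum-replicate-zero)
  open import Relation.Binary.Reasoning.Setoid setoid

  module _ (p·1≈0 : p · 1# ≈ 0#) where

    p∣m⇒m·x≈0 : ∀ {m} x → p ∣ m → m · x ≈ 0#
    p∣m⇒m·x≈0 x (divides d ≡.refl) = begin
      (d ℕ.* p) · x   ≈⟨ sym (×-assocˡ x d p) ⟩
      d · (p · x)     ≈⟨ ×-congʳ d (×-congʳ p (sym (*-identityˡ x))) ⟩
      d · (p · (1# * x)) ≈⟨ ×-congʳ d (sym (×-assoc-* p 1# x)) ⟩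
      d · ((p · 1#) * x) ≈⟨ ×-congʳ d (trans (*-congʳ p·1≈0) (zeroˡ x)) ⟩
      d · 0#          ≈⟨ d·0≈0 d ⟩
      0#              ∎
      where
      d·0≈0 : ∀ d → d · 0# ≈ 0#
      d·0≈0 zero = refl
      d·0≈0 (suc d) = trans (+-identityˡ _) (d·0≈0 d)

    freshmans-dream : ∀ x y → (x + y) ^ p ≈ x ^ p + y ^ p
    freshmans-dream x y = expand ≡.refl
      where
      expand : ∀ {m} → m ≡ p → (x + y) ^ m ≈ x ^ m + y ^ m
      expand {zero} 0≡p = contradiction (≡.subst Prime (≡.sym 0≡p) p-prime) ¬prime[0]
      expand {suc n} m≡p = begin
        (x + y) ^ suc n                          ≈⟨ theorem (suc n) x y ⟩
        t Fin.zero + sum (λ i → t (Fin.suc i))   ≈⟨ +-congˡ (sum-init-last (λ i → t (Fin.suc i))) ⟩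
        t Fin.zero + (sum (λ i → t (Fin.suc (Fin.inject₁ i))) + t (Fin.fromℕ (suc n)))
          ≈⟨ +-cong (trans (+-identityʳ _) (*-identityˡ _)) (+-congʳ (trans (sum-cong-≋ inner≈0) (sum-replicate-zero n))) ⟩
        y ^ suc n + (0# + t (Fin.fromℕ (suc n))) ≈⟨ +-comm _ _ ⟩
        (0# + t (Fin.fromℕ (suc n))) + y ^ suc n ≈⟨ +-congʳ (trans (+-identityˡ _) last≈) ⟩
        x ^ suc n + y ^ suc n                    ∎
        where
        t = binomialTerm x y (suc n)
        inner≈0 : ∀ i → t (Fin.suc (Fin.inject₁ i)) ≈ 0#
        inner≈0 i = p∣m⇒m·x≈0 _ (≡.subst (_∣ (suc n C suc (Fin.toℕ (Fin.inject₁ i)))) m≡p (p∣pCk (≡.subst Prime (≡.sym m≡p) p-prime) (s≤s z≤n)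
                      (s≤s (≡.subst (ℕ._< n) (≡.sym (Fin.toℕ-inject₁ i)) (Fin.toℕ<n i)))))
        top-term : ∀ m j → j ≡ m → (m C j) · (x ^ j * y ^ (m ℕ.∸ j)) ≈ x ^ m
        top-term m .m ≡.refl rewrite nCn≡1 m | ℕ.n∸n≡0 m = trans (+-identityʳ _) (*-identityʳ _)
        last≈ : t (Fin.fromℕ (suc n)) ≈ x ^ suc n
        last≈ = top-term (suc n) _ (Fin.toℕ-fromℕ (suc n))

    freshmans-dream-^ : ∀ j x y → (x + y) ^ (p ℕ.^ j) ≈ x ^ (p ℕ.^ j) + y ^ (p ℕ.^ j)
    freshmans-dream-^ zero x y = trans (*-identityʳ _) (sym (+-cong (*-identityʳ x) (*-identityʳ y)))
    freshmans-dream-^ (suc j) x y = begin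
      (x + y) ^ (p ℕ.* p ℕ.^ j)                       ≈⟨ sym (^-assocʳ (x + y) p (p ℕ.^ j)) ⟩
      ((x + y) ^ p) ^ (p ℕ.^ j)                       ≈⟨ ^-congˡ (p ℕ.^ j) (freshmans-dream x y) ⟩
      (x ^ p + y ^ p) ^ (p ℕ.^ j)                     ≈⟨ freshmans-dream-^ j (x ^ p) (y ^ p) ⟩
      (x ^ p) ^ (p ℕ.^ j) + (y ^ p) ^ (p ℕ.^ j)       ≈⟨ +-cong (^-assocʳ x p (p ℕ.^ j)) (^-assocʳ y p (p ℕ.^ j)) ⟩
      x ^ (p ℕ.* p ℕ.^ j) + y ^ (p ℕ.* p ℕ.^ j)       ∎

module FieldProperties {c ℓ} (K : Field c ℓ) where
  open Field K
  open IntegerCoefficientSolver commutativeRing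
  open import Relation.Binary.Reasoning.Setoid setoid

  1≉0 : ¬ 1# ≈ 0#
  1≉0 1≈0 = 0≉1 (sym 1≈0)

  ⁻¹-inverseˡ : ∀ x → ¬ x ≈ 0# → x ⁻¹ * x ≈ 1#
  ⁻¹-inverseˡ x x≉0 = trans (*-comm _ _) (⁻¹-inverse x x≉0)

  x-y≈0⇒x≈y : ∀ {x y} → x - y ≈ 0# → x ≈ y
  x-y≈0⇒x≈y {x} {y} x-y≈0 = begin
    x               ≈⟨ solve 2 (λ x y → x := (x :- y) :+ y) refl x y ⟩
    (x - y) + y     ≈⟨ +-congʳ x-y≈0 ⟩
    0# + y          ≈⟨ +-identityˡ y ⟩
    y               ∎

  x≈y⇒x-y≈0 : ∀ {x y} → x ≈ y → x - y ≈ 0#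
  x≈y⇒x-y≈0 {x} {y} x≈y = trans (+-congʳ x≈y) (-‿inverseʳ y)

  x*y≈0⇒y≈0 : ∀ {x y} → ¬ x ≈ 0# → x * y ≈ 0# → y ≈ 0#
  x*y≈0⇒y≈0 {x} {y} x≉0 xy≈0 = begin
    y                ≈⟨ sym (*-identityˡ y) ⟩
    1# * y           ≈⟨ *-congʳ (sym (⁻¹-inverseˡ x x≉0)) ⟩
    (x ⁻¹ * x) * y   ≈⟨ *-assoc _ _ _ ⟩
    x ⁻¹ * (x * y)   ≈⟨ *-congˡ xy≈0 ⟩
    x ⁻¹ * 0#        ≈⟨ zeroʳ _ ⟩
    0#               ∎

  x*y≈0⇒x≈0 : ∀ {x y} → ¬ y ≈ 0# → x * y ≈ 0# → x ≈ 0#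
  x*y≈0⇒x≈0 y≉0 xy≈0 = x*y≈0⇒y≈0 y≉0 (trans (*-comm _ _) xy≈0)

  x≉0∧y≉0⇒x*y≉0 : ∀ {x y} → ¬ x ≈ 0# → ¬ y ≈ 0# → ¬ x * y ≈ 0#
  x≉0∧y≉0⇒x*y≉0 x≉0 y≉0 xy≈0 = y≉0 (x*y≈0⇒y≈0 x≉0 xy≈0)

  *-cancelˡ : ∀ {x y z} → ¬ x ≈ 0# → x * y ≈ x * z → y ≈ z
  *-cancelˡ {x} {y} {z} x≉0 xy≈xz = x-y≈0⇒x≈y (x*y≈0⇒y≈0 x≉0 (begin
    x * (y - z)     ≈⟨ solve 3 (λ x y z → x :* (y :- z) := x :* y :- x :* z) refl x y z ⟩
    x * y - x * z   ≈⟨ x≈y⇒x-y≈0 xy≈xz ⟩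
    0#              ∎))

  1^n≈1 : ∀ n → 1# ^ n ≈ 1#
  1^n≈1 zero = refl
  1^n≈1 (suc n) = trans (*-identityˡ _) (1^n≈1 n)

  x^n≉0 : ∀ {x} n → ¬ x ≈ 0# → ¬ x ^ n ≈ 0#
  x^n≉0 zero _ = 1≉0
  x^n≉0 (suc n) x≉0 = x≉0∧y≉0⇒x*y≉0 x≉0 (x^n≉0 n x≉0)

  x⁻¹≉0 : ∀ {x} → ¬ x ≈ 0# → ¬ x ⁻¹ ≈ 0#
  x⁻¹≉0 {x} x≉0 x⁻¹≈0 = 1≉0 (trans (sym (⁻¹-inverse x x≉0)) (trans (*-congˡ x⁻¹≈0) (zeroʳ x)))

  ⁻¹-unique : ∀ {x y} → x * y ≈ 1# → y ≈ x ⁻¹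
  ⁻¹-unique {x} {y} xy≈1 = *-cancelˡ x≉0 (trans xy≈1 (sym (⁻¹-inverse x x≉0)))
    where
    x≉0 : ¬ x ≈ 0#
    x≉0 x≈0 = 1≉0 (trans (sym xy≈1) (trans (*-congʳ x≈0) (zeroˡ y)))

  ⁻¹-cong : ∀ {x y} → ¬ x ≈ 0# → x ≈ y → x ⁻¹ ≈ y ⁻¹
  ⁻¹-cong {x} x≉0 x≈y = ⁻¹-unique (trans (*-congʳ (sym x≈y)) (⁻¹-inverse x x≉0))

  ⁻¹-distrib-* : ∀ {x y} → ¬ x ≈ 0# → ¬ y ≈ 0# → (x * y) ⁻¹ ≈ x ⁻¹ * y ⁻¹
  ⁻¹-distrib-* {x} {y} x≉0 y≉0 = sym (⁻¹-unique (begin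
    (x * y) * (x ⁻¹ * y ⁻¹)      ≈⟨ solve 4 (λ x y x′ y′ → (x :* y) :* (x′ :* y′) := (x :* x′) :* (y :* y′)) refl x y (x ⁻¹) (y ⁻¹) ⟩
    (x * x ⁻¹) * (y * y ⁻¹)      ≈⟨ *-cong (⁻¹-inverse x x≉0) (⁻¹-inverse y y≉0) ⟩
    1# * 1#                      ≈⟨ *-identityˡ 1# ⟩
    1#                           ∎))

  x*[y*x⁻¹]≈y : ∀ {x} → ¬ x ≈ 0# → ∀ y → x * (y * x ⁻¹) ≈ y
  x*[y*x⁻¹]≈y {x} x≉0 y = begin
    x * (y * x ⁻¹)   ≈⟨ solve 3 (λ x y x′ → x :* (y :* x′) := y :* (x :* x′)) refl x y (x ⁻¹) ⟩
    y * (x * x ⁻¹)   ≈⟨ *-congˡ (⁻¹-inverse x x≉0) ⟩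
    y * 1#           ≈⟨ *-identityʳ y ⟩
    y                ∎

Fin-injective⇒surjective : ∀ {n} (g : Fin n → Fin n) → (∀ {i j} → g i ≡ g j → i ≡ j) → ∀ k → ∃ λ i → g i ≡ k
Fin-injective⇒surjective {zero} g _ ()
Fin-injective⇒surjective {suc n} g g-injective k with Fin.any? (λ i → g i Fin.≟ k)
... | yes hit = hit
... | no missed = ⊥-elim (ℕ.1+n≰n (Fin.injective⇒≤ {f = g′} g′-injective))
  where
  g′ : Fin (suc n) → Fin n
  g′ i = Fin.punchOut {i = k} {j = g i} (λ k≡gi → missed (i , ≡.sym k≡gi))
  g′-injective : ∀ {i j} → g′ i ≡ g′ j → i ≡ j
  g′-injective {i} {j} = g-injective ∘ Fin.punchOut-injective (λ k≡gi → missed (i , ≡.sym k≡gi)) (λ k≡gj → missed (j , ≡.sym k≡gj))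

module FiniteField {c ℓ} (K : Field c ℓ) {N : ℕ} (size : FieldNotions.HasSize K N) where
  open Field K
  open FieldProperties K
  open IntegerCoefficientSolver commutativeRing
  open import Algebra.Properties.Semiring.Mult semiring using () renaming (_×_ to _·_)
  open import Function.Definitions using (Congruent; Injective; Surjective)
  open import Relation.Binary.Reasoning.Setoid setoid
  open Bijection size using () renaming (to to enum; injective to enum-injective; surjective to enum-surjective)
  private
    module ∑ = Sum +-commutativeMonoid
    module ∏ = Sum *-commutativeMonoid

  index : Carrier → Fin N
  index x = proj₁ (enum-surjective x)

  enum-index : ∀ x → enum (index x) ≈ x
  enum-index x = proj₂ (enum-surjective x) ≡.refl

  index-injective : ∀ {x y} → index x ≡ index y → x ≈ y
  index-injective {x} {y} i≡j = trans (sym (enum-index x)) (trans (reflexive (≡.cong enum i≡j)) (enum-index y))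

  index-cong : ∀ {x y} → x ≈ y → index x ≡ index y
  index-cong {x} {y} x≈y = enum-injective (trans (enum-index x) (trans x≈y (sym (enum-index y))))

  index-enum : ∀ i → index (enum i) ≡ i
  index-enum i = enum-injective (enum-index (enum i))

  infix 4 _≟_
  _≟_ : ∀ x y → Dec (x ≈ y)
  x ≟ y with index x Fin.≟ index y
  ... | yes i≡j = yes (index-injective i≡j)
  ... | no i≢j = no (λ x≈y → i≢j (index-cong x≈y))

  x*y≈0⇒x≈0⊎y≈0 : ∀ {x y} → x * y ≈ 0# → x ≈ 0# ⊎ y ≈ 0#
  x*y≈0⇒x≈0⊎y≈0 {x} xy≈0 with x ≟ 0#
  ... | yes x≈0 = inj₁ x≈0
  ... | no x≉0 = inj₂ (x*y≈0⇒y≈0 x≉0 xy≈0)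

  x^n≈0⇒x≈0 : ∀ n {x} → x ^ n ≈ 0# → x ≈ 0#
  x^n≈0⇒x≈0 n {x} x^n≈0 with x ≟ 0#
  ... | yes x≈0 = x≈0
  ... | no x≉0 = contradiction x^n≈0 (x^n≉0 n x≉0)

  x*x≈0⇒x≈0 : ∀ {x} → x * x ≈ 0# → x ≈ 0#
  x*x≈0⇒x≈0 x²≈0 = reduce (x*y≈0⇒x≈0⊎y≈0 x²≈0)

  injective⇒surjective : ∀ f → Congruent _≈_ _≈_ f → Injective _≈_ _≈_ f → Surjective _≈_ _≈_ f
  injective⇒surjective f f-cong f-injective y = enum i , λ z≈enum-i → trans (f-cong z≈enum-i) (begin
      f (enum i)               ≈⟨ sym (enum-index _) ⟩
      enum (index (f (enum i))) ≡⟨ ≡.cong enum gi≡index-y ⟩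
      enum (index y)           ≈⟨ enum-index y ⟩
      y                        ∎)
    where
    g : Fin N → Fin N
    g i = index (f (enum i))
    hit = Fin-injective⇒surjective g (λ gi≡gj → enum-injective (f-injective (index-injective gi≡gj))) (index y)
    i = proj₁ hit
    gi≡index-y = proj₂ hit

  module _ {a l} (M : CommutativeMonoid a l) where
    open CommutativeMonoid M using () renaming (_≈_ to _≈ᴹ_; Carrier to A)
    open Sum M using (sum; sum-permute; sum-cong-≋)

    sum-reindex : (t : Carrier → A) → Congruent _≈_ _≈ᴹ_ t →
                  (g g⁻¹ : Carrier → Carrier) → Congruent _≈_ _≈_ g → Congruent _≈_ _≈_ g⁻¹ →
                  (∀ x → g (g⁻¹ x) ≈ x) → (∀ x → g⁻¹ (g x) ≈ x) →
                  sum (λ i → t (enum i)) ≈ᴹ sum (λ i → t (g (enum i)))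
    sum-reindex t t-cong g g⁻¹ g-cong g⁻¹-cong g∘g⁻¹ g⁻¹∘g = CommutativeMonoid.trans M
        (sum-permute (λ i → t (enum i)) (Permutation.permutation π π⁻¹ ππ⁻¹ π⁻¹π))
        (sum-cong-≋ (λ i → t-cong (enum-index (g (enum i)))))
      where
      π π⁻¹ : Fin N → Fin N
      π i = index (g (enum i))
      π⁻¹ i = index (g⁻¹ (enum i))
      ππ⁻¹ : ∀ i → π (π⁻¹ i) ≡ i
      ππ⁻¹ i = ≡.trans (index-cong (trans (g-cong (enum-index _)) (g∘g⁻¹ (enum i)))) (index-enum i)
      π⁻¹π : ∀ i → π⁻¹ (π i) ≡ i
      π⁻¹π i = ≡.trans (index-cong (trans (g⁻¹-cong (enum-index _)) (g⁻¹∘g (enum i)))) (index-enum i)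

  N·x≈0 : ∀ x → N · x ≈ 0#
  N·x≈0 x = begin
      N · x              ≈⟨ solve 2 (λ a s → a := (a :+ s) :- s) refl (N · x) S ⟩
      (N · x + S) - S    ≈⟨ +-congʳ (sym S≈N·x+S) ⟩
      S - S              ≈⟨ -‿inverseʳ S ⟩
      0#                 ∎
    where
    S = ∑.sum enum
    S≈N·x+S : S ≈ N · x + S
    S≈N·x+S = begin
      S                           ≈⟨ sum-reindex +-commutativeMonoid (λ y → y) (λ y≈z → y≈z) (λ y → x + y) (λ y → - x + y) +-congˡ +-congˡ
                                       (λ y → solve 2 (λ x y → x :+ (:- x :+ y) := y) refl x y)
                                       (λ y → solve 2 (λ x y → :- x :+ (x :+ y) := y) refl x y) ⟩
      ∑.sum (λ i → x + enum i)    ≈⟨ ∑.∑-distrib-+ {N} (λ _ → x) enum ⟩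
      ∑.sum {N} (λ _ → x) + S     ≈⟨ +-congʳ (∑.sum-replicate N) ⟩
      N · x + S                   ∎

  ∏-nonzero : ∀ {n} (t : Fin n → Carrier) → (∀ i → ¬ t i ≈ 0#) → ¬ ∏.sum t ≈ 0#
  ∏-nonzero {zero} t _ = 1≉0
  ∏-nonzero {suc n} t t≉0 = x≉0∧y≉0⇒x*y≉0 (t≉0 Fin.zero) (∏-nonzero (λ i → t (Fin.suc i)) (λ i → t≉0 (Fin.suc i)))

  ifZero : Carrier → Carrier → Carrier → Carrier
  ifZero y a b with y ≟ 0#
  ... | yes _ = a
  ... | no _ = b

  ∏-single : ∀ {n} (t : Fin n → Carrier) i → (∀ j → ¬ j ≡ i → t j ≈ 1#) → ∏.sum t ≈ t i
  ∏-single {suc n} t i t≈1 = begin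
    ∏.sum t                                  ≈⟨ ∏.sum-remove {i = i} t ⟩
    t i * ∏.sum (λ k → t (Fin.punchIn i k))  ≈⟨ *-congˡ (trans (∏.sum-cong-≋ (λ k → t≈1 _ (Fin.punchInᵢ≢i i k))) (∏.sum-replicate-zero n)) ⟩
    t i * 1#                                 ≈⟨ *-identityʳ _ ⟩
    t i                                      ∎

  ∏-ifZero-x-1≈x : ∀ x → ∏.sum (λ i → ifZero (enum i) x 1#) ≈ x
  ∏-ifZero-x-1≈x x = trans (∏-single (λ i → ifZero (enum i) x 1#) (index 0#) away-from-0) at-0
    where
    at-0 : ifZero (enum (index 0#)) x 1# ≈ x
    at-0 with enum (index 0#) ≟ 0#
    ... | yes _ = refl
    ... | no ≉0 = contradiction (enum-index 0#) ≉0
    away-from-0 : ∀ j → ¬ j ≡ index 0# → ifZero (enum j) x 1# ≈ 1#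
    away-from-0 j j≢ with enum j ≟ 0#
    ... | yes ≈0 = contradiction (≡.trans (≡.sym (index-enum j)) (index-cong ≈0)) j≢
    ... | no _ = refl

  nonzero-part : Carrier → Carrier
  nonzero-part y = ifZero y 1# y

  nonzero-part≉0 : ∀ y → ¬ nonzero-part y ≈ 0#
  nonzero-part≉0 y with y ≟ 0#
  ... | yes _ = 1≉0
  ... | no y≉0 = y≉0

  nonzero-part-cong : ∀ {y z} → y ≈ z → nonzero-part y ≈ nonzero-part z
  nonzero-part-cong {y} {z} y≈z with y ≟ 0# | z ≟ 0#
  ... | yes _ | yes _ = refl
  ... | yes y≈0 | no z≉0 = contradiction (trans (sym y≈z) y≈0) z≉0
  ... | no y≉0 | yes z≈0 = contradiction (trans y≈z z≈0) y≉0
  ... | no _ | no _ = y≈z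

  nonzero-part-* : ∀ {x} → ¬ x ≈ 0# → ∀ y → nonzero-part (x * y) ≈ ifZero y 1# x * nonzero-part y
  nonzero-part-* {x} x≉0 y with y ≟ 0# | x * y ≟ 0#
  ... | yes _ | yes _ = sym (*-identityˡ 1#)
  ... | yes y≈0 | no xy≉0 = contradiction (trans (*-congˡ y≈0) (zeroʳ x)) xy≉0
  ... | no y≉0 | yes xy≈0 = contradiction xy≈0 (x≉0∧y≉0⇒x*y≉0 x≉0 y≉0)
  ... | no _ | no _ = refl

  -- y ↦ x * y permutes K and multiplies the nonzero part of each y ≉ 0 by x, so these factors multiply to 1.
  ∏-ifZero-1-x≈1 : ∀ {x} → ¬ x ≈ 0# → ∏.sum (λ i → ifZero (enum i) 1# x) ≈ 1#
  ∏-ifZero-1-x≈1 {x} x≉0 = *-cancelˡ (∏-nonzero (λ i → nonzero-part (enum i)) (λ i → nonzero-part≉0 (enum i))) (begin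
      P * A      ≈⟨ *-comm P A ⟩
      A * P      ≈⟨ P≈A*P ⟨
      P          ≈⟨ *-identityʳ P ⟨
      P * 1#     ∎)
    where
    P = ∏.sum (λ i → nonzero-part (enum i))
    A = ∏.sum (λ i → ifZero (enum i) 1# x)
    P≈A*P : P ≈ A * P
    P≈A*P = begin
      P                                                          ≈⟨ sum-reindex *-commutativeMonoid nonzero-part nonzero-part-cong (λ y → x * y) (λ y → x ⁻¹ * y) *-congˡ *-congˡ
                                                                      (λ y → trans (sym (*-assoc _ _ _)) (trans (*-congʳ (⁻¹-inverse x x≉0)) (*-identityˡ y)))
                                                                      (λ y → trans (sym (*-assoc _ _ _)) (trans (*-congʳ (⁻¹-inverseˡ x x≉0)) (*-identityˡ y))) ⟩
      ∏.sum (λ i → nonzero-part (x * enum i))                    ≈⟨ ∏.sum-cong-≋ {N} (λ i → nonzero-part-* x≉0 (enum i)) ⟩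
      ∏.sum (λ i → ifZero (enum i) 1# x * nonzero-part (enum i)) ≈⟨ ∏.∑-distrib-+ {N} (λ i → ifZero (enum i) 1# x) (λ i → nonzero-part (enum i)) ⟩
      A * P                                                      ∎

  x^N≈x : ∀ x → x ^ N ≈ x
  x^N≈x x with x ≟ 0#
  x^N≈x x | yes x≈0 = trans (0^N≈0 (index x)) (sym x≈0)
    where
    0^N≈0 : ∀ {n} → Fin n → x ^ n ≈ 0#
    0^N≈0 {suc n} _ = trans (*-congʳ x≈0) (zeroˡ _)
  x^N≈x x | no x≉0 = begin
    x ^ N                                                          ≈⟨ sym (∏.sum-replicate N) ⟩
    ∏.sum {N} (λ _ → x)                                            ≈⟨ ∏.sum-cong-≋ {N} (λ i → split (enum i)) ⟩
    ∏.sum (λ i → ifZero (enum i) 1# x * ifZero (enum i) x 1#)      ≈⟨ ∏.∑-distrib-+ {N} (λ i → ifZero (enum i) 1# x) (λ i → ifZero (enum i) x 1#) ⟩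
    ∏.sum (λ i → ifZero (enum i) 1# x) * ∏.sum (λ i → ifZero (enum i) x 1#) ≈⟨ *-cong (∏-ifZero-1-x≈1 x≉0) (∏-ifZero-x-1≈x x) ⟩
    1# * x                                                         ≈⟨ *-identityˡ x ⟩
    x                                                              ∎
    where
    split : ∀ y → x ≈ ifZero y 1# x * ifZero y x 1#
    split y with y ≟ 0#
    ... | yes _ = sym (*-identityˡ x)
    ... | no _ = sym (*-identityʳ x)

  -- monic (c₀ ∷ c₁ ∷ … ∷ c₍d₋₁₎ ∷ []) x = c₀ + x (c₁ + x (… + x (c₍d₋₁₎ + x))), a monic polynomial of degree d.
  monic : List Carrier → Carrier → Carrier
  monic [] x = 1#
  monic (c ∷ cs) x = c + x * monic cs x

  monic-quotient : List Carrier → Carrier → List Carrier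
  monic-quotient [] a = []
  monic-quotient (c ∷ []) a = []
  monic-quotient (c ∷ c′ ∷ cs) a = monic (c′ ∷ cs) a ∷ monic-quotient (c′ ∷ cs) a

  length-monic-quotient : ∀ c cs a → length (monic-quotient (c ∷ cs) a) ≡ length cs
  length-monic-quotient c [] a = ≡.refl
  length-monic-quotient c (c′ ∷ cs) a = ≡.cong suc (length-monic-quotient c′ cs a)

  monic-division : ∀ c cs a x → monic (c ∷ cs) x ≈ (x - a) * monic (monic-quotient (c ∷ cs) a) x + monic (c ∷ cs) a
  monic-division c [] a x = solve 3 (λ c x a → c :+ x :* con (+ 1) := (x :- a) :* con (+ 1) :+ (c :+ a :* con (+ 1))) refl c x a
  monic-division c (c′ ∷ cs) a x = begin
      c + x * p x                          ≈⟨ +-congˡ (*-congˡ (monic-division c′ cs a x)) ⟩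
      c + x * ((x - a) * q + p a)
        ≈⟨ solve 5 (λ c x a q pa → c :+ x :* ((x :- a) :* q :+ pa) := (x :- a) :* (pa :+ x :* q) :+ (c :+ a :* pa)) refl c x a q (p a) ⟩
      (x - a) * (p a + x * q) + (c + a * p a) ∎
    where
    p = monic (c′ ∷ cs)
    q = monic (monic-quotient (c′ ∷ cs) a) x

  monic-roots≤degree : ∀ m cs (r : Fin m → Carrier) → (∀ {i j} → r i ≈ r j → i ≡ j) →
                       (∀ i → monic cs (r i) ≈ 0#) → m ℕ.≤ length cs
  monic-roots≤degree zero cs r _ _ = z≤n
  monic-roots≤degree (suc m) [] r _ roots = contradiction (roots Fin.zero) 1≉0
  monic-roots≤degree (suc m) (c ∷ cs) r r-injective roots = s≤s (≡.subst (m ℕ.≤_) (length-monic-quotient c cs a)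
      (monic-roots≤degree m (monic-quotient (c ∷ cs) a) (λ i → r (Fin.suc i)) (λ ri≈rj → Fin.suc-injective (r-injective ri≈rj)) quotient-roots))
    where
    a = r Fin.zero
    quotient-roots : ∀ i → monic (monic-quotient (c ∷ cs) a) (r (Fin.suc i)) ≈ 0#
    quotient-roots i = x*y≈0⇒y≈0 (λ d≈0 → Fin.0≢1+n (≡.sym (r-injective (x-y≈0⇒x≈y d≈0)))) (begin
      (r (Fin.suc i) - a) * monic (monic-quotient (c ∷ cs) a) (r (Fin.suc i))              ≈⟨ sym (+-identityʳ _) ⟩
      (r (Fin.suc i) - a) * monic (monic-quotient (c ∷ cs) a) (r (Fin.suc i)) + 0#         ≈⟨ +-congˡ (sym (roots Fin.zero)) ⟩
      (r (Fin.suc i) - a) * monic (monic-quotient (c ∷ cs) a) (r (Fin.suc i)) + monic (c ∷ cs) a ≈⟨ sym (monic-division c cs a (r (Fin.suc i))) ⟩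
      monic (c ∷ cs) (r (Fin.suc i))                                                     ≈⟨ roots (Fin.suc i) ⟩
      0#                                                                                 ∎)

  x^d≉x-somewhere : ∀ d → 2 ℕ.≤ d → d ℕ.< N → ∃ λ x → ¬ x ^ d ≈ x
  x^d≉x-somewhere (suc (suc e)) (s≤s (s≤s _)) d<N with Fin.any? (λ i → ¬? (enum i ^ suc (suc e) ≟ enum i))
  ... | yes (i , moved) = enum i , moved
  ... | no none-moved = contradiction (monic-roots≤degree N cs enum enum-injective (λ i → trans (x^d-x (enum i)) (x≈y⇒x-y≈0 (fixed i))))
                          (ℕ.<⇒≱ (≡.subst (ℕ._< N) (≡.cong (suc ∘ suc) (≡.sym (List.length-replicate e))) d<N))
    where
    fixed : ∀ i → enum i ^ suc (suc e) ≈ enum i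
    fixed i = decidable-stable (enum i ^ suc (suc e) ≟ enum i) (λ moved → none-moved (i , moved))
    cs = 0# ∷ - 1# ∷ replicate e 0#
    monic-zeros : ∀ e x → monic (replicate e 0#) x ≈ x ^ e
    monic-zeros zero x = refl
    monic-zeros (suc e) x = trans (+-identityˡ _) (*-congˡ (monic-zeros e x))
    x^d-x : ∀ x → monic cs x ≈ x ^ suc (suc e) - x
    x^d-x x = trans (+-congˡ (*-congˡ (+-congˡ (*-congˡ (monic-zeros e x)))))
                    (solve 2 (λ x y → con (+ 0) :+ x :* (:- con (+ 1) :+ x :* y) := x :* (x :* y) :- x) refl x (x ^ e))

  infix 4 _≋_
  _≋_ : Carrier × Bool → Carrier × Bool → Set ℓ
  (x , b) ≋ (y , b′) = x ≈ y × b ≡ b′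

  -- Injective A, B : P → P × Bool with disjoint images missing s would give 2|P| + 1 ≤ 2|P|. To avoid counting P,
  -- slot extends A and B by x ↦ (x , true) and x ↦ (x , false) outside P and injects N + N + 1 slots into Carrier × Bool.
  module _ {p} {P : Carrier → Set p} (P? : ∀ x → Dec (P x)) (P-resp-≈ : ∀ {x y} → x ≈ y → P x → P y)
           (A B : Carrier → Carrier × Bool) (s : Carrier × Bool)
           (A-into-P : ∀ {x} → P x → P (proj₁ (A x))) (B-into-P : ∀ {x} → P x → P (proj₁ (B x))) (s-in-P : P (proj₁ s))
           (A-injective : ∀ {x y} → P x → P y → A x ≋ A y → x ≈ y) (B-injective : ∀ {x y} → P x → P y → B x ≋ B y → x ≈ y)
           (A≉B : ∀ {x y} → P x → P y → ¬ A x ≋ B y) (A≉s : ∀ {x} → P x → ¬ A x ≋ s) (B≉s : ∀ {x} → P x → ¬ B x ≋ s) where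

    private
      Slot : Set
      Slot = Maybe (Fin N ⊎ Fin N)

      slot : Slot → Carrier × Bool
      slot nothing = s
      slot (just (inj₁ i)) with P? (enum i)
      ... | yes _ = A (enum i)
      ... | no _ = enum i , true
      slot (just (inj₂ i)) with P? (enum i)
      ... | yes _ = B (enum i)
      ... | no _ = enum i , false

      ≋-sym : ∀ {u v} → u ≋ v → v ≋ u
      ≋-sym (x≈y , b≡b′) = sym x≈y , ≡.sym b≡b′

      outside : ∀ {x y b b′} → ¬ P x → P y → ¬ (x , b) ≋ (y , b′)
      outside x∉P y∈P (x≈y , _) = x∉P (P-resp-≈ (sym x≈y) y∈P)

      slot-injective : ∀ u v → slot u ≋ slot v → u ≡ v
      slot-injective nothing nothing _ = ≡.refl
      slot-injective nothing (just (inj₁ j)) eq with P? (enum j)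
      ... | yes j∈P = contradiction (≋-sym eq) (A≉s j∈P)
      ... | no j∉P = contradiction (≋-sym eq) (outside j∉P s-in-P)
      slot-injective nothing (just (inj₂ j)) eq with P? (enum j)
      ... | yes j∈P = contradiction (≋-sym eq) (B≉s j∈P)
      ... | no j∉P = contradiction (≋-sym eq) (outside j∉P s-in-P)
      slot-injective (just (inj₁ i)) nothing eq with P? (enum i)
      ... | yes i∈P = contradiction eq (A≉s i∈P)
      ... | no i∉P = contradiction eq (outside i∉P s-in-P)
      slot-injective (just (inj₂ i)) nothing eq with P? (enum i)
      ... | yes i∈P = contradiction eq (B≉s i∈P)
      ... | no i∉P = contradiction eq (outside i∉P s-in-P)
      slot-injective (just (inj₁ i)) (just (inj₁ j)) eq with P? (enum i) | P? (enum j)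
      ... | yes i∈P | yes j∈P = ≡.cong (just ∘ inj₁) (enum-injective (A-injective i∈P j∈P eq))
      ... | yes i∈P | no j∉P = contradiction (≋-sym eq) (outside j∉P (A-into-P i∈P))
      ... | no i∉P | yes j∈P = contradiction eq (outside i∉P (A-into-P j∈P))
      ... | no _ | no _ = ≡.cong (just ∘ inj₁) (enum-injective (proj₁ eq))
      slot-injective (just (inj₂ i)) (just (inj₂ j)) eq with P? (enum i) | P? (enum j)
      ... | yes i∈P | yes j∈P = ≡.cong (just ∘ inj₂) (enum-injective (B-injective i∈P j∈P eq))
      ... | yes i∈P | no j∉P = contradiction (≋-sym eq) (outside j∉P (B-into-P i∈P))
      ... | no i∉P | yes j∈P = contradiction eq (outside i∉P (B-into-P j∈P))
      ... | no _ | no _ = ≡.cong (just ∘ inj₂) (enum-injective (proj₁ eq))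
      slot-injective (just (inj₁ i)) (just (inj₂ j)) eq with P? (enum i) | P? (enum j)
      ... | yes i∈P | yes j∈P = contradiction eq (A≉B i∈P j∈P)
      ... | yes i∈P | no j∉P = contradiction (≋-sym eq) (outside j∉P (A-into-P i∈P))
      ... | no i∉P | yes j∈P = contradiction eq (outside i∉P (B-into-P j∈P))
      ... | no _ | no _ = contradiction (proj₂ eq) λ ()
      slot-injective (just (inj₂ i)) (just (inj₁ j)) eq with P? (enum i) | P? (enum j)
      ... | yes i∈P | yes j∈P = contradiction (≋-sym eq) (A≉B j∈P i∈P)
      ... | yes i∈P | no j∉P = contradiction (≋-sym eq) (outside j∉P (B-into-P i∈P))
      ... | no i∉P | yes j∈P = contradiction eq (outside i∉P (A-into-P j∈P))
      ... | no _ | no _ = contradiction (proj₂ eq) λ ()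

      tagged : Carrier × Bool → Fin N ⊎ Fin N
      tagged (x , true) = inj₁ (index x)
      tagged (x , false) = inj₂ (index x)

      tagged-injective : ∀ u v → tagged u ≡ tagged v → u ≋ v
      tagged-injective (x , true) (y , true) eq = index-injective (inj₁-injective eq) , ≡.refl
      tagged-injective (x , false) (y , false) eq = index-injective (inj₂-injective eq) , ≡.refl
      tagged-injective (x , true) (y , false) ()
      tagged-injective (x , false) (y , true) ()

      join-injective : ∀ u v → Fin.join N N u ≡ Fin.join N N v → u ≡ v
      join-injective u v eq = ≡.trans (≡.sym (Fin.splitAt-join N N u)) (≡.trans (≡.cong (Fin.splitAt N) eq) (Fin.splitAt-join N N v))

      decode : Fin (suc (N ℕ.+ N)) → Slot
      decode Fin.zero = nothing
      decode (Fin.suc i) = just (Fin.splitAt N i)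

      decode-injective : ∀ i j → decode i ≡ decode j → i ≡ j
      decode-injective Fin.zero Fin.zero _ = ≡.refl
      decode-injective (Fin.suc i) (Fin.suc j) eq = ≡.cong Fin.suc (≡.trans (≡.sym (Fin.join-splitAt N N i)) (≡.trans (≡.cong (Fin.join N N) (just-injective eq)) (Fin.join-splitAt N N j)))

    pigeonhole-P×Bool : ⊥
    pigeonhole-P×Bool = ℕ.1+n≰n (Fin.injective⇒≤ {f = λ i → Fin.join N N (tagged (slot (decode i)))}
      (λ {i} {j} eq → decode-injective i j (slot-injective _ _ (tagged-injective _ _ (join-injective _ _ eq)))))

  any? : ∀ {p} {P : Carrier → Set p} → (∀ x → Dec (P x)) → (∀ {x y} → x ≈ y → P x → P y) → Dec (∃ P)
  any? P? P-resp-≈ with Fin.any? (λ i → P? (enum i))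
  ... | yes (i , P[enum-i]) = yes (enum i , P[enum-i])
  ... | no none = no (λ (x , Px) → none (index x , P-resp-≈ (sym (enum-index x)) Px))

module Frobenius {c ℓ} (q : ℕ) (q-odd-prime-power : OddPrimePower q) (K : Field c ℓ) (size : FieldNotions.HasSize K (q ℕ.* q)) where
  open Field K
  open FieldNotions K
  open FieldProperties K public
  open FiniteField K size public
  open IntegerCoefficientSolver commutativeRing
  open import Algebra.Properties.Semiring.Mult semiring using (×1-homo-*; ×-homo-+) renaming (_×_ to _·_)
  open import Algebra.Properties.Semiring.Exp semiring using (^-assocʳ; ^-congˡ)
  open import Algebra.Properties.CommutativeSemiring.Exp commutativeSemiring using (^-distrib-*)
  open import Relation.Binary.Reasoning.Setoid setoid

  private
    p k : ℕ
    p = proj₁ q-odd-prime-power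
    k = proj₁ (proj₂ q-odd-prime-power)

    p-prime : Prime p
    p-prime = proj₁ (proj₂ (proj₂ q-odd-prime-power))

    1≤k : 1 ℕ.≤ k
    1≤k = proj₁ (proj₂ (proj₂ (proj₂ q-odd-prime-power)))

    q≡p^k : q ≡ p ℕ.^ k
    q≡p^k = proj₁ (proj₂ (proj₂ (proj₂ (proj₂ q-odd-prime-power))))

    q%2≡1 : q % 2 ≡ 1
    q%2≡1 = proj₂ (proj₂ (proj₂ (proj₂ (proj₂ q-odd-prime-power))))

    m^j·1≈[m·1]^j : ∀ m j → (m ℕ.^ j) · 1# ≈ (m · 1#) ^ j
    m^j·1≈[m·1]^j m zero = +-identityʳ 1#
    m^j·1≈[m·1]^j m (suc j) = trans (×1-homo-* m (m ℕ.^ j)) (*-congˡ (m^j·1≈[m·1]^j m j))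

    p·1≈0 : p · 1# ≈ 0#
    p·1≈0 = x^n≈0⇒x≈0 k (x*x≈0⇒x≈0 p^k·p^k≈0)
      where
      p^k·p^k≈0 : (p · 1#) ^ k * (p · 1#) ^ k ≈ 0#
      p^k·p^k≈0 = begin
        (p · 1#) ^ k * (p · 1#) ^ k          ≈⟨ sym (*-cong (m^j·1≈[m·1]^j p k) (m^j·1≈[m·1]^j p k)) ⟩
        (p ℕ.^ k) · 1# * (p ℕ.^ k) · 1#      ≈⟨ sym (×1-homo-* (p ℕ.^ k) (p ℕ.^ k)) ⟩
        (p ℕ.^ k ℕ.* p ℕ.^ k) · 1#           ≡⟨ ≡.cong (λ m → (m ℕ.* m) · 1#) (≡.sym q≡p^k) ⟩
        (q ℕ.* q) · 1#                       ≈⟨ N·x≈0 1# ⟩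
        0#                                   ∎

    q·1≈0 : q · 1# ≈ 0#
    q·1≈0 = begin
      q · 1#               ≡⟨ ≡.cong (_· 1#) q≡p^k ⟩
      (p ℕ.^ k) · 1#       ≈⟨ m^j·1≈[m·1]^j p k ⟩
      (p · 1#) ^ k         ≈⟨ ^-congˡ k p·1≈0 ⟩
      0# ^ k               ≈⟨ 0^k≈0 k 1≤k ⟩
      0#                   ∎
      where
      0^k≈0 : ∀ j → 1 ℕ.≤ j → 0# ^ j ≈ 0#
      0^k≈0 (suc j) _ = zeroˡ _

  2≤q : 2 ℕ.≤ q
  2≤q = ≡.subst (2 ℕ.≤_) (≡.sym q≡p^k) (2≤p^k k p-prime 1≤k)

  q<q*q : q ℕ.< q ℕ.* q
  q<q*q = ℕ.m<m*n q q {{ℕ.≢-nonZero (λ q≡0 → contradiction (≡.subst (2 ℕ.≤_) q≡0 2≤q) λ ())}} 2≤q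

  σ : Carrier → Carrier
  σ x = x ^ q

  σ-cong : ∀ {x y} → x ≈ y → σ x ≈ σ y
  σ-cong = ^-congˡ q

  σ-homo-+ : ∀ x y → σ (x + y) ≈ σ x + σ y
  σ-homo-+ x y = ≡.subst (λ m → (x + y) ^ m ≈ x ^ m + y ^ m) (≡.sym q≡p^k)
                   (FreshmansDream.freshmans-dream-^ commutativeRing p-prime p·1≈0 k x y)

  σ-homo-* : ∀ x y → σ (x * y) ≈ σ x * σ y
  σ-homo-* x y = ^-distrib-* x y q

  σ-involutive : ∀ x → σ (σ x) ≈ x
  σ-involutive x = trans (^-assocʳ x q q) (x^N≈x x)

  σ-homo-0 : σ 0# ≈ 0#
  σ-homo-0 = begin
    σ 0#                   ≈⟨ solve 1 (λ s → s := (s :+ s) :- s) refl (σ 0#) ⟩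
    (σ 0# + σ 0#) - σ 0#   ≈⟨ +-congʳ (trans (σ-cong (sym (+-identityʳ 0#))) (σ-homo-+ 0# 0#)) ⟨
    σ 0# - σ 0#            ≈⟨ -‿inverseʳ _ ⟩
    0#                     ∎

  σ-homo-1 : σ 1# ≈ 1#
  σ-homo-1 = 1^n≈1 q

  σ-homo-neg : ∀ x → σ (- x) ≈ - σ x
  σ-homo-neg x = begin
    σ (- x)                  ≈⟨ solve 2 (λ a b → a := (a :+ b) :- b) refl (σ (- x)) (σ x) ⟩
    (σ (- x) + σ x) - σ x    ≈⟨ +-congʳ (sym (σ-homo-+ (- x) x)) ⟩
    σ (- x + x) - σ x        ≈⟨ +-congʳ (trans (σ-cong (-‿inverseˡ x)) σ-homo-0) ⟩
    0# - σ x                 ≈⟨ +-identityˡ _ ⟩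
    - σ x                    ∎

  σ-homo-sub : ∀ x y → σ (x - y) ≈ σ x - σ y
  σ-homo-sub x y = trans (σ-homo-+ x (- y)) (+-congˡ (σ-homo-neg y))

  σ-homo-⁻¹ : ∀ x → ¬ x ≈ 0# → σ (x ⁻¹) ≈ (σ x) ⁻¹
  σ-homo-⁻¹ x x≉0 = ⁻¹-unique (trans (sym (σ-homo-* x (x ⁻¹))) (trans (σ-cong (⁻¹-inverse x x≉0)) σ-homo-1))

  two : Carrier
  two = 1# + 1#

  private
    d·1≈0⇒[q%d]·1≈0 : ∀ d .{{_ : ℕ.NonZero d}} → d · 1# ≈ 0# → (q % d) · 1# ≈ 0#
    d·1≈0⇒[q%d]·1≈0 d d·1≈0 = begin
      (q % d) · 1#                             ≈⟨ +-identityʳ _ ⟨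
      (q % d) · 1# + 0#                        ≈⟨ +-congˡ (trans (*-congˡ d·1≈0) (zeroʳ _)) ⟨
      (q % d) · 1# + ((q / d) · 1#) * (d · 1#) ≈⟨ +-congˡ (×1-homo-* (q / d) d) ⟨
      (q % d) · 1# + (q / d ℕ.* d) · 1#        ≈⟨ ×-homo-+ 1# (q % d) (q / d ℕ.* d) ⟨
      (q % d ℕ.+ q / d ℕ.* d) · 1#             ≡⟨ ≡.cong (_· 1#) (m≡m%n+[m/n]*n q d) ⟨
      q · 1#                                   ≈⟨ q·1≈0 ⟩
      0#                                       ∎

  two≉0 : ¬ two ≈ 0#
  two≉0 two≈0 = 1≉0 (begin
    1#              ≈⟨ +-identityʳ 1# ⟨
    1 · 1#          ≡⟨ ≡.cong (_· 1#) q%2≡1 ⟨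
    (q % 2) · 1#    ≈⟨ d·1≈0⇒[q%d]·1≈0 2 (trans (+-congˡ (+-identityʳ 1#)) two≈0) ⟩
    0#              ∎)

  private
    3·1≈three : 3 · 1# ≈ three
    3·1≈three = solve 0 (con (+ 1) :+ (con (+ 1) :+ (con (+ 1) :+ con (+ 0))) := con (+ 1) :+ con (+ 1) :+ con (+ 1)) refl

  3∣q⇒three≈0 : 3 ∣ q → three ≈ 0#
  3∣q⇒three≈0 3∣q = begin
    three      ≈⟨ 3·1≈three ⟨
    3 · 1#     ≡⟨ ≡.cong (_· 1#) (3∣p^k⇒p≡3 p-prime k (≡.subst (3 ∣_) q≡p^k 3∣q)) ⟨
    p · 1#     ≈⟨ p·1≈0 ⟩
    0#         ∎

  three≈0⇒3∣q : three ≈ 0# → 3 ∣ q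
  three≈0⇒3∣q three≈0 = by-remainder (q % 3) ≡.refl (m%n<n q 3)
    where
    [q%3]·1≈0 = d·1≈0⇒[q%d]·1≈0 3 (trans 3·1≈three three≈0)
    by-remainder : ∀ r → q % 3 ≡ r → r ℕ.< 3 → 3 ∣ q
    by-remainder 0 q%3≡0 _ = ℕ.m%n≡0⇒n∣m q 3 q%3≡0
    by-remainder 1 q%3≡1 _ = contradiction (trans (sym (+-identityʳ 1#)) (trans (reflexive (≡.cong (_· 1#) (≡.sym q%3≡1))) [q%3]·1≈0)) 1≉0
    by-remainder 2 q%3≡2 _ = contradiction (trans (+-congˡ (sym (+-identityʳ 1#))) (trans (reflexive (≡.cong (_· 1#) (≡.sym q%3≡2))) [q%3]·1≈0)) two≉0
    by-remainder (suc (suc (suc _))) _ (s≤s (s≤s (s≤s ())))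

module Subfield {c ℓ} (q : ℕ) (q-odd-prime-power : OddPrimePower q) (K : Field c ℓ) (size : FieldNotions.HasSize K (q ℕ.* q)) where
  open Field K
  open FieldNotions K
  open Frobenius q q-odd-prime-power K size public
  open IntegerCoefficientSolver commutativeRing
  open import Algebra.Properties.Ring ring using (-‿distribˡ-*)
  open import Relation.Binary.Reasoning.Setoid setoid

  𝔽 : Carrier → Set ℓ
  𝔽 = InSubfield q

  𝔽? : ∀ x → Dec (𝔽 x)
  𝔽? x = σ x ≟ x

  𝔽-resp-≈ : ∀ {x y} → x ≈ y → 𝔽 x → 𝔽 y
  𝔽-resp-≈ x≈y 𝔽x = trans (σ-cong (sym x≈y)) (trans 𝔽x x≈y)

  𝔽-0 : 𝔽 0#
  𝔽-0 = σ-homo-0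

  𝔽-1 : 𝔽 1#
  𝔽-1 = σ-homo-1

  𝔽-+ : ∀ {x y} → 𝔽 x → 𝔽 y → 𝔽 (x + y)
  𝔽-+ {x} {y} 𝔽x 𝔽y = trans (σ-homo-+ x y) (+-cong 𝔽x 𝔽y)

  𝔽-* : ∀ {x y} → 𝔽 x → 𝔽 y → 𝔽 (x * y)
  𝔽-* {x} {y} 𝔽x 𝔽y = trans (σ-homo-* x y) (*-cong 𝔽x 𝔽y)

  𝔽-neg : ∀ {x} → 𝔽 x → 𝔽 (- x)
  𝔽-neg {x} 𝔽x = trans (σ-homo-neg x) (-‿cong 𝔽x)

  𝔽-sub : ∀ {x y} → 𝔽 x → 𝔽 y → 𝔽 (x - y)
  𝔽-sub 𝔽x 𝔽y = 𝔽-+ 𝔽x (𝔽-neg 𝔽y)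

  𝔽-⁻¹ : ∀ {x} → 𝔽 x → ¬ x ≈ 0# → 𝔽 (x ⁻¹)
  𝔽-⁻¹ {x} 𝔽x x≉0 = trans (σ-homo-⁻¹ x x≉0) (⁻¹-cong (λ σx≈0 → x≉0 (trans (sym 𝔽x) σx≈0)) 𝔽x)

  𝔽-two : 𝔽 two
  𝔽-two = 𝔽-+ 𝔽-1 𝔽-1

  𝔽-three : 𝔽 three
  𝔽-three = 𝔽-+ 𝔽-two 𝔽-1

  ½ : Carrier
  ½ = two ⁻¹

  𝔽-½ : 𝔽 ½
  𝔽-½ = 𝔽-⁻¹ 𝔽-two two≉0

  ½≉0 : ¬ ½ ≈ 0#
  ½≉0 = x⁻¹≉0 two≉0

  two*½≈1 : two * ½ ≈ 1#
  two*½≈1 = ⁻¹-inverse two two≉0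

  ½+½≈1 : ½ + ½ ≈ 1#
  ½+½≈1 = trans (solve 1 (λ h → h :+ h := (con (+ 1) :+ con (+ 1)) :* h) refl ½) two*½≈1

  -- Lets the ring solver, which knows nothing of ½, prove identities that hold only because ½ + ½ = 1.
  ≈-by-½+½≈1 : ∀ {x y} e → x ≈ y + (½ + ½ - 1#) * e → x ≈ y
  ≈-by-½+½≈1 {x} {y} e x≈y+0*e = trans x≈y+0*e (trans (+-congˡ (trans (*-congʳ (x≈y⇒x-y≈0 ½+½≈1)) (zeroˡ e))) (+-identityʳ y))

  x+x≈0⇒x≈0 : ∀ {x} → x + x ≈ 0# → x ≈ 0#
  x+x≈0⇒x≈0 {x} x+x≈0 = x*y≈0⇒y≈0 two≉0 (trans (solve 1 (λ x → (con (+ 1) :+ con (+ 1)) :* x := x :+ x) refl x) x+x≈0)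

  private
    ξ : Carrier
    ξ = proj₁ (x^d≉x-somewhere q 2≤q q<q*q)

    σξ≉ξ : ¬ σ ξ ≈ ξ
    σξ≉ξ = proj₂ (x^d≉x-somewhere q 2≤q q<q*q)

  opaque
    ε : Carrier
    ε = σ ξ - ξ

    ε≉0 : ¬ ε ≈ 0#
    ε≉0 ε≈0 = σξ≉ξ (x-y≈0⇒x≈y ε≈0)

    σε≈-ε : σ ε ≈ - ε
    σε≈-ε = begin
      σ (σ ξ - ξ)        ≈⟨ σ-homo-sub (σ ξ) ξ ⟩
      σ (σ ξ) - σ ξ      ≈⟨ +-congʳ (σ-involutive ξ) ⟩
      ξ - σ ξ            ≈⟨ solve 2 (λ x y → x :- y := :- (y :- x)) refl ξ (σ ξ) ⟩
      - (σ ξ - ξ)        ∎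

  ε∉𝔽 : ¬ 𝔽 ε
  ε∉𝔽 𝔽ε = ε≉0 (x+x≈0⇒x≈0 (trans (+-congʳ (sym 𝔽ε)) (trans (+-congʳ σε≈-ε) (-‿inverseˡ ε))))

  ε² : Carrier
  ε² = ε * ε

  ε²≉0 : ¬ ε² ≈ 0#
  ε²≉0 = x≉0∧y≉0⇒x*y≉0 ε≉0 ε≉0

  𝔽-ε² : 𝔽 ε²
  𝔽-ε² = trans (σ-homo-* ε ε) (trans (*-cong σε≈-ε σε≈-ε) (solve 1 (λ e → (:- e) :* (:- e) := e :* e) refl ε))

  ε⁻² : Carrier
  ε⁻² = ε² ⁻¹

  𝔽-ε⁻² : 𝔽 ε⁻²
  𝔽-ε⁻² = 𝔽-⁻¹ 𝔽-ε² ε²≉0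

  ε²*ε⁻²≈1 : ε² * ε⁻² ≈ 1#
  ε²*ε⁻²≈1 = ⁻¹-inverse ε² ε²≉0

  ε²-nonsquare : ¬ IsSquareIn q ε²
  ε²-nonsquare (y , 𝔽y , y*y≈ε²) = [ (λ y-ε≈0 → ε∉𝔽 (𝔽-resp-≈ (x-y≈0⇒x≈y y-ε≈0) 𝔽y))
                             , (λ y+ε≈0 → ε∉𝔽 (𝔽-resp-≈ (-y≈ε y+ε≈0) (𝔽-neg 𝔽y))) ]′
                             (x*y≈0⇒x≈0⊎y≈0 (trans (solve 2 (λ y e → (y :- e) :* (y :+ e) := y :* y :- e :* e) refl y ε) (x≈y⇒x-y≈0 y*y≈ε²)))
    where
    -y≈ε : y + ε ≈ 0# → - y ≈ ε
    -y≈ε y+ε≈0 = begin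
      - y               ≈⟨ +-identityˡ _ ⟨
      0# - y            ≈⟨ +-congʳ y+ε≈0 ⟨
      (y + ε) - y       ≈⟨ solve 2 (λ y e → (y :+ e) :- y := e) refl y ε ⟩
      ε                 ∎

  𝔽-Tr : ∀ x → 𝔽 (Tr q x)
  𝔽-Tr x = trans (σ-homo-+ x (σ x)) (trans (+-congˡ (σ-involutive x)) (+-comm _ _))

  re im : Carrier → Carrier
  re x = ½ * (x + σ x)
  im x = ½ * (x - σ x) * ε * ε⁻²

  𝔽-re : ∀ x → 𝔽 (re x)
  𝔽-re x = begin
    σ (½ * (x + σ x))        ≈⟨ σ-homo-* ½ _ ⟩
    σ ½ * σ (x + σ x)        ≈⟨ *-cong 𝔽-½ (σ-homo-+ x (σ x)) ⟩
    ½ * (σ x + σ (σ x))      ≈⟨ *-congˡ (trans (+-congˡ (σ-involutive x)) (+-comm _ _)) ⟩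
    ½ * (x + σ x)            ∎

  𝔽-im : ∀ x → 𝔽 (im x)
  𝔽-im x = begin
    σ (½ * (x - σ x) * ε * ε⁻²)                ≈⟨ trans (σ-homo-* _ ε⁻²) (*-congʳ (trans (σ-homo-* _ ε) (*-congʳ (σ-homo-* ½ _)))) ⟩
    σ ½ * σ (x - σ x) * σ ε * σ ε⁻²            ≈⟨ *-cong (*-cong (*-cong 𝔽-½ (trans (σ-homo-sub x (σ x)) (+-congˡ (-‿cong (σ-involutive x))))) σε≈-ε) 𝔽-ε⁻² ⟩
    ½ * (σ x - x) * (- ε) * ε⁻²                ≈⟨ solve 5 (λ h x s e m → h :* (s :- x) :* (:- e) :* m := h :* (x :- s) :* e :* m) refl ½ x (σ x) ε ε⁻² ⟩
    ½ * (x - σ x) * ε * ε⁻²                    ∎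

  re+ε*im≈x : ∀ x → re x + ε * im x ≈ x
  re+ε*im≈x x = begin
    re x + ε * im x
      ≈⟨ solve 5 (λ h x s e m → h :* (x :+ s) :+ e :* (h :* (x :- s) :* e :* m) := h :* (x :+ s) :+ h :* (x :- s) :* ((e :* e) :* m)) refl ½ x (σ x) ε ε⁻² ⟩
    ½ * (x + σ x) + ½ * (x - σ x) * (ε² * ε⁻²)   ≈⟨ +-congˡ (*-congˡ ε²*ε⁻²≈1) ⟩
    ½ * (x + σ x) + ½ * (x - σ x) * 1#         ≈⟨ solve 3 (λ h x s → h :* (x :+ s) :+ h :* (x :- s) :* con (+ 1) := (h :+ h) :* x) refl ½ x (σ x) ⟩
    (½ + ½) * x                                 ≈⟨ *-congʳ ½+½≈1 ⟩
    1# * x                                      ≈⟨ *-identityˡ x ⟩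
    x                                           ∎

  σ[a+εb]≈a-εb : ∀ {a b} → 𝔽 a → 𝔽 b → σ (a + ε * b) ≈ a - ε * b
  σ[a+εb]≈a-εb {a} {b} 𝔽a 𝔽b = begin
    σ (a + ε * b)      ≈⟨ σ-homo-+ a _ ⟩
    σ a + σ (ε * b)    ≈⟨ +-cong 𝔽a (σ-homo-* ε b) ⟩
    a + σ ε * σ b      ≈⟨ +-congˡ (*-cong σε≈-ε 𝔽b) ⟩
    a + - ε * b        ≈⟨ +-congˡ (sym (-‿distribˡ-* ε b)) ⟩
    a - ε * b          ∎

  coordinates-unique : ∀ {a b a′ b′} → 𝔽 a → 𝔽 b → 𝔽 a′ → 𝔽 b′ → a + ε * b ≈ a′ + ε * b′ → a ≈ a′ × b ≈ b′
  coordinates-unique {a} {b} {a′} {b′} 𝔽a 𝔽b 𝔽a′ 𝔽b′ eq = x-y≈0⇒x≈y (trans a-a′≈ε*d (trans (*-congˡ d≈0) (zeroʳ ε))) , sym (x-y≈0⇒x≈y d≈0)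
    where
    d = b′ - b
    a-a′≈ε*d : a - a′ ≈ ε * d
    a-a′≈ε*d = begin
      a - a′                         ≈⟨ solve 4 (λ a a′ b e → a :- a′ := (a :+ e :* b) :- (a′ :+ e :* b)) refl a a′ b ε ⟩
      (a + ε * b) - (a′ + ε * b)     ≈⟨ +-congʳ eq ⟩
      (a′ + ε * b′) - (a′ + ε * b)   ≈⟨ solve 4 (λ a′ b b′ e → (a′ :+ e :* b′) :- (a′ :+ e :* b) := e :* (b′ :- b)) refl a′ b b′ ε ⟩
      ε * d                          ∎
    ε*d≈-ε*d : ε * d ≈ - (ε * d)
    ε*d≈-ε*d = begin
      ε * d             ≈⟨ a-a′≈ε*d ⟨
      a - a′            ≈⟨ 𝔽-sub 𝔽a 𝔽a′ ⟨
      σ (a - a′)        ≈⟨ σ-cong a-a′≈ε*d ⟩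
      σ (ε * d)         ≈⟨ σ-homo-* ε d ⟩
      σ ε * σ d         ≈⟨ *-cong σε≈-ε (𝔽-sub 𝔽b′ 𝔽b) ⟩
      - ε * d           ≈⟨ -‿distribˡ-* ε d ⟨
      - (ε * d)         ∎
    d≈0 : d ≈ 0#
    d≈0 = x*y≈0⇒y≈0 ε≉0 (x+x≈0⇒x≈0 (trans (+-congˡ ε*d≈-ε*d) (-‿inverseʳ _)))

module Squares {c ℓ} (q : ℕ) (q-odd-prime-power : OddPrimePower q) (K : Field c ℓ) (size : FieldNotions.HasSize K (q ℕ.* q)) where
  open Field K
  open FieldNotions K
  open Subfield q q-odd-prime-power K size public
  open IntegerCoefficientSolver commutativeRing
  open import Algebra.Properties.Ring ring using (-‿involutive; -0#≈0#; -‿injective)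
  open import Relation.Nullary.Decidable using (_×-dec_)
  open import Relation.Binary.Reasoning.Setoid setoid

  -- sign x ≢ sign (- x) for x ≉ 0: only one of them comes first in the enumeration of K.
  sign : Carrier → Bool
  sign x = Fin.toℕ (index x) ℕ.≤ᵇ Fin.toℕ (index (- x))

  private
    ≤ᵇ-flip : ∀ m n → ¬ m ≡ n → ¬ (m ℕ.≤ᵇ n) ≡ (n ℕ.≤ᵇ m)
    ≤ᵇ-flip m n m≢n eq with m ℕ.≤ᵇ n in m≤ᵇn | n ℕ.≤ᵇ m in n≤ᵇm
    ... | true | true = m≢n (ℕ.≤-antisym (ℕ.≤ᵇ⇒≤ m n (≡.subst T (≡.sym m≤ᵇn) _)) (ℕ.≤ᵇ⇒≤ n m (≡.subst T (≡.sym n≤ᵇm) _)))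
    ... | false | false = ℕ.<-asym (ℕ.≰⇒> {n} {m} (λ n≤m → ≡.subst T n≤ᵇm (ℕ.≤⇒≤ᵇ n≤m))) (ℕ.≰⇒> {m} {n} (λ m≤n → ≡.subst T m≤ᵇn (ℕ.≤⇒≤ᵇ m≤n)))

  sign-0 : ∀ {x} → x ≈ 0# → sign x ≡ true
  sign-0 {x} x≈0 = T⇒≡true (≡.subst (λ i → T (Fin.toℕ (index x) ℕ.≤ᵇ Fin.toℕ i)) (index-cong x≈-x) (ℕ.≤⇒≤ᵇ (ℕ.≤-refl {Fin.toℕ (index x)})))
    where
    T⇒≡true : ∀ {b} → T b → b ≡ true
    T⇒≡true {true} _ = ≡.refl
    x≈-x : x ≈ - x
    x≈-x = trans x≈0 (sym (trans (-‿cong x≈0) -0#≈0#))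

  sign-neg : ∀ {x} → ¬ x ≈ 0# → ¬ sign (- x) ≡ sign x
  sign-neg {x} x≉0 eq = ≤ᵇ-flip (Fin.toℕ (index x)) (Fin.toℕ (index (- x))) index-x≢index-[-x]
    (≡.trans (≡.sym eq) (≡.cong (λ i → Fin.toℕ (index (- x)) ℕ.≤ᵇ Fin.toℕ i) (index-cong (-‿involutive x))))
    where
    index-x≢index-[-x] : ¬ Fin.toℕ (index x) ≡ Fin.toℕ (index (- x))
    index-x≢index-[-x] eq′ = x≉0 (x+x≈0⇒x≈0 (trans (+-congˡ (index-injective (Fin.toℕ-injective eq′))) (-‿inverseʳ x)))

  sign-cong : ∀ {x y} → x ≈ y → sign x ≡ sign y
  sign-cong x≈y = ≡.cong₂ (λ i j → Fin.toℕ i ℕ.≤ᵇ Fin.toℕ j) (index-cong x≈y) (index-cong (-‿cong x≈y))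

  square-sign-injective : ∀ x y → x * x ≈ y * y → sign x ≡ sign y → x ≈ y
  square-sign-injective x y x²≈y² sign-x≡sign-y =
    [ x-y≈0⇒x≈y , x+y≈0⇒x≈y ]′ (x*y≈0⇒x≈0⊎y≈0 (trans (solve 2 (λ x y → (x :- y) :* (x :+ y) := x :* x :- y :* y) refl x y) (x≈y⇒x-y≈0 x²≈y²)))
    where
    x+y≈0⇒y≈-x : x + y ≈ 0# → y ≈ - x
    x+y≈0⇒y≈-x x+y≈0 = trans (solve 2 (λ x y → y := (x :+ y) :- x) refl x y) (trans (+-congʳ x+y≈0) (+-identityˡ _))
    x+y≈0⇒x≈y : x + y ≈ 0# → x ≈ y
    x+y≈0⇒x≈y x+y≈0 with x ≟ 0#
    ... | yes x≈0 = trans x≈0 (sym (trans (x+y≈0⇒y≈-x x+y≈0) (trans (-‿cong x≈0) -0#≈0#)))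
    ... | no x≉0 = contradiction (≡.trans (sign-cong (sym (x+y≈0⇒y≈-x x+y≈0))) (≡.sym sign-x≡sign-y)) (sign-neg x≉0)

  -- Otherwise the values (α², sign α), (b - aβ², sign β) and (b , false) would be 2|𝔽| + 1 distinct pairs.
  sum-of-squares : ∀ {a b} → 𝔽 a → 𝔽 b → ¬ a ≈ 0# → ∃ λ α → 𝔽 α × ∃ λ β → 𝔽 β × α * α + a * (β * β) ≈ b
  sum-of-squares {a} {b} 𝔽a 𝔽b a≉0 = decidable-stable (any? Solution? Solution-resp-≈) no-solution-impossible
    where
    Solution : Carrier → Set (c ⊔ ℓ)
    Solution α = 𝔽 α × ∃ λ β → 𝔽 β × α * α + a * (β * β) ≈ b
    Solution? : ∀ α → Dec (Solution α)
    Solution? α = 𝔽? α ×-dec any? (λ β → 𝔽? β ×-dec (α * α + a * (β * β) ≟ b))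
                                 (λ β≈β′ (𝔽β , eq) → 𝔽-resp-≈ β≈β′ 𝔽β , trans (+-congˡ (*-congˡ (*-cong (sym β≈β′) (sym β≈β′)))) eq)
    Solution-resp-≈ : ∀ {α α′} → α ≈ α′ → Solution α → Solution α′
    Solution-resp-≈ α≈α′ (𝔽α , β , 𝔽β , eq) = 𝔽-resp-≈ α≈α′ 𝔽α , β , 𝔽β , trans (+-congʳ (*-cong (sym α≈α′) (sym α≈α′))) eq
    b-a*x≈b-a*y⇒x≈y : ∀ {x y} → b - a * x ≈ b - a * y → x ≈ y
    b-a*x≈b-a*y⇒x≈y {x} {y} eq = *-cancelˡ a≉0 (-‿injective (begin
      - (a * x)              ≈⟨ solve 2 (λ b z → :- z := (b :- z) :- b) refl b (a * x) ⟩
      (b - a * x) - b        ≈⟨ +-congʳ eq ⟩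
      (b - a * y) - b        ≈⟨ solve 2 (λ b z → (b :- z) :- b := :- z) refl b (a * y) ⟩
      - (a * y)              ∎))
    no-solution-impossible : ¬ ¬ ∃ Solution
    no-solution-impossible none = pigeonhole-P×Bool 𝔽? 𝔽-resp-≈
      (λ α → α * α , sign α) (λ β → b - a * (β * β) , sign β) (b , false)
      (λ 𝔽α → 𝔽-* 𝔽α 𝔽α) (λ 𝔽β → 𝔽-sub 𝔽b (𝔽-* 𝔽a (𝔽-* 𝔽β 𝔽β))) 𝔽b
      (λ _ _ (α²≈α′² , s≡s′) → square-sign-injective _ _ α²≈α′² s≡s′)
      (λ _ _ (eq , s≡s′) → square-sign-injective _ _ (b-a*x≈b-a*y⇒x≈y eq) s≡s′)
      (λ {α} {β} 𝔽α 𝔽β (α²≈b-aβ² , _) → none (α , 𝔽α , β , 𝔽β , trans (+-congʳ α²≈b-aβ²) (solve 2 (λ b z → (b :- z) :+ z := b) refl b (a * (β * β)))))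
      (λ {α} 𝔽α (α²≈b , _) → none (α , 𝔽α , 0# , 𝔽-0 , trans (solve 2 (λ x a → x :+ a :* (con (+ 0) :* con (+ 0)) := x) refl (α * α) a) α²≈b))
      (λ {β} 𝔽β (b-aβ²≈b , sign≡false) → contradiction (≡.trans (≡.sym (sign-0 (β≈0 b-aβ²≈b))) sign≡false) λ ())
      where
      β≈0 : ∀ {β} → b - a * (β * β) ≈ b → β ≈ 0#
      β≈0 {β} eq = x*x≈0⇒x≈0 (b-a*x≈b-a*y⇒x≈y (trans eq (solve 2 (λ b a → b := b :- a :* con (+ 0)) refl b a)))

  NonzeroSquare : Carrier → Set (c ⊔ ℓ)
  NonzeroSquare w = ∃ λ d → 𝔽 d × ¬ d ≈ 0# × d * d ≈ w

  private
    [x/y]²*y²≈x² : ∀ x {y} → ¬ y ≈ 0# → (x * y ⁻¹) * (x * y ⁻¹) * (y * y) ≈ x * x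
    [x/y]²*y²≈x² x {y} y≉0 = begin
      (x * y ⁻¹) * (x * y ⁻¹) * (y * y)        ≈⟨ solve 3 (λ x y y′ → (x :* y′) :* (x :* y′) :* (y :* y) := x :* x :* ((y :* y′) :* (y :* y′))) refl x y (y ⁻¹) ⟩
      x * x * ((y * y ⁻¹) * (y * y ⁻¹))        ≈⟨ *-congˡ (trans (*-cong (⁻¹-inverse y y≉0) (⁻¹-inverse y y≉0)) (*-identityˡ 1#)) ⟩
      x * x * 1#                               ≈⟨ *-identityʳ _ ⟩
      x * x                                    ∎

    x²≈z*y²⇒square : ∀ {x y z} → 𝔽 x → 𝔽 y → ¬ y ≈ 0# → x * x ≈ z * (y * y) → IsSquareIn q z
    x²≈z*y²⇒square {x} {y} {z} 𝔽x 𝔽y y≉0 x²≈zy² = x * y ⁻¹ , 𝔽-* 𝔽x (𝔽-⁻¹ 𝔽y y≉0) , *-cancelˡ (x≉0∧y≉0⇒x*y≉0 y≉0 y≉0) (begin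
      (y * y) * ((x * y ⁻¹) * (x * y ⁻¹))   ≈⟨ *-comm _ _ ⟩
      (x * y ⁻¹) * (x * y ⁻¹) * (y * y)     ≈⟨ [x/y]²*y²≈x² x y≉0 ⟩
      x * x                                 ≈⟨ x²≈zy² ⟩
      z * (y * y)                           ≈⟨ *-comm _ _ ⟩
      (y * y) * z                           ∎)

    z*y²≈ε²⇒y≉0 : ∀ {y z} → z * (y * y) ≈ ε² → ¬ y ≈ 0#
    z*y²≈ε²⇒y≉0 {y} {z} zy²≈ε² y≈0 = ε²≉0 (trans (sym zy²≈ε²) (trans (*-congˡ (trans (*-congʳ y≈0) (zeroˡ y))) (zeroʳ z)))

    z*y²≈ε²⇒y⁻²≈z*ε⁻² : ∀ {y z} → z * (y * y) ≈ ε² → y ⁻¹ * y ⁻¹ ≈ z * ε⁻²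
    z*y²≈ε²⇒y⁻²≈z*ε⁻² {y} {z} zy²≈ε² = *-cancelˡ (x≉0∧y≉0⇒x*y≉0 y≉0 y≉0) (begin
      (y * y) * (y ⁻¹ * y ⁻¹)      ≈⟨ solve 2 (λ x y → (x :* x) :* (y :* y) := (x :* y) :* (x :* y)) refl y (y ⁻¹) ⟩
      (y * y ⁻¹) * (y * y ⁻¹)      ≈⟨ trans (*-cong (⁻¹-inverse y y≉0) (⁻¹-inverse y y≉0)) (*-identityˡ 1#) ⟩
      1#                           ≈⟨ ε²*ε⁻²≈1 ⟨
      ε² * ε⁻²                     ≈⟨ *-congʳ zy²≈ε² ⟨
      (z * (y * y)) * ε⁻²          ≈⟨ solve 3 (λ z y m → (z :* y) :* m := y :* (z :* m)) refl z (y * y) ε⁻² ⟩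
      (y * y) * (z * ε⁻²)          ∎)
      where y≉0 = z*y²≈ε²⇒y≉0 zy²≈ε²

  nonzeroSquare[z*ε⁻²]⇒nonsquare : ∀ {z} → NonzeroSquare (z * ε⁻²) → ¬ IsSquareIn q z
  nonzeroSquare[z*ε⁻²]⇒nonsquare {z} (d , 𝔽d , d≉0 , d²≈zε⁻²) (y , 𝔽y , y²≈z) = ε²-nonsquare (x²≈z*y²⇒square 𝔽y 𝔽d d≉0 y²≈ε²d²)
    where
    y²≈ε²d² : y * y ≈ ε² * (d * d)
    y²≈ε²d² = begin
      y * y                    ≈⟨ y²≈z ⟩
      z                        ≈⟨ *-identityˡ z ⟨
      1# * z                   ≈⟨ *-congʳ ε²*ε⁻²≈1 ⟨
      (ε² * ε⁻²) * z           ≈⟨ solve 3 (λ n m z → (n :* m) :* z := n :* (z :* m)) refl ε² ε⁻² z ⟩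
      ε² * (z * ε⁻²)           ≈⟨ *-congˡ d²≈zε⁻² ⟨
      ε² * (d * d)             ∎

  -- Otherwise the values (α², sign α), (zβ², not (sign β)) and (ε² , true) would be 2|𝔽| + 1 distinct pairs.
  nonsquare⇒nonzeroSquare[z*ε⁻²] : ∀ {z} → 𝔽 z → ¬ IsSquareIn q z → NonzeroSquare (z * ε⁻²)
  nonsquare⇒nonzeroSquare[z*ε⁻²] {z} 𝔽z nonsquare = decidable-stable (any? Root? Root-resp-≈) no-root-impossible
    where
    Root : Carrier → Set ℓ
    Root d = 𝔽 d × ¬ d ≈ 0# × d * d ≈ z * ε⁻²
    Root? : ∀ d → Dec (Root d)
    Root? d = 𝔽? d ×-dec ¬? (d ≟ 0#) ×-dec (d * d ≟ z * ε⁻²)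
    Root-resp-≈ : ∀ {d d′} → d ≈ d′ → Root d → Root d′
    Root-resp-≈ d≈d′ (𝔽d , d≉0 , eq) = 𝔽-resp-≈ d≈d′ 𝔽d , (λ d′≈0 → d≉0 (trans d≈d′ d′≈0)) , trans (*-cong (sym d≈d′) (sym d≈d′)) eq
    z≉0 : ¬ z ≈ 0#
    z≉0 z≈0 = nonsquare (0# , 𝔽-0 , trans (zeroˡ 0#) (sym z≈0))
    A≉B : ∀ {α β} → 𝔽 α → 𝔽 β → ¬ (α * α , sign α) ≋ (z * (β * β) , not (sign β))
    A≉B {α} {β} 𝔽α 𝔽β (α²≈zβ² , sα≡not-sβ) with β ≟ 0#
    ... | no β≉0 = nonsquare (x²≈z*y²⇒square 𝔽α 𝔽β β≉0 α²≈zβ²)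
    ... | yes β≈0 = contradiction (≡.trans (≡.sym (sign-0 α≈0)) (≡.trans sα≡not-sβ (≡.cong not (sign-0 β≈0)))) λ ()
      where α≈0 = x*x≈0⇒x≈0 (trans α²≈zβ² (trans (*-congˡ (trans (*-congʳ β≈0) (zeroˡ β))) (zeroʳ z)))
    no-root-impossible : ¬ ¬ ∃ Root
    no-root-impossible none = pigeonhole-P×Bool 𝔽? 𝔽-resp-≈
      (λ α → α * α , sign α) (λ β → z * (β * β) , not (sign β)) (ε² , true)
      (λ 𝔽α → 𝔽-* 𝔽α 𝔽α) (λ 𝔽β → 𝔽-* 𝔽z (𝔽-* 𝔽β 𝔽β)) 𝔽-ε²
      (λ _ _ (α²≈α′² , s≡s′) → square-sign-injective _ _ α²≈α′² s≡s′)
      (λ _ _ (zβ²≈zβ′² , s≡s′) → square-sign-injective _ _ (*-cancelˡ z≉0 zβ²≈zβ′²) (not-injective s≡s′))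
      A≉B
      (λ {α} 𝔽α (α²≈ε² , _) → ε²-nonsquare (α , 𝔽α , α²≈ε²))
      (λ {β} 𝔽β (zβ²≈ε² , _) → none (β ⁻¹ , 𝔽-⁻¹ 𝔽β (z*y²≈ε²⇒y≉0 zβ²≈ε²) , x⁻¹≉0 (z*y²≈ε²⇒y≉0 zβ²≈ε²) , z*y²≈ε²⇒y⁻²≈z*ε⁻² zβ²≈ε²))

  square⇔¬nonzeroSquare[z*ε⁻²] : ∀ {z} → 𝔽 z → IsSquareIn q z ⇔ (¬ NonzeroSquare (z * ε⁻²))
  square⇔¬nonzeroSquare[z*ε⁻²] {z} 𝔽z = mk⇔
    (λ square nonzeroSquare → nonzeroSquare[z*ε⁻²]⇒nonsquare nonzeroSquare square)
    (λ ¬nonzeroSquare → decidable-stable (any? (λ y → 𝔽? y ×-dec (y * y ≟ z)) square-resp-≈)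
                          (λ nonsquare → ¬nonzeroSquare (nonsquare⇒nonzeroSquare[z*ε⁻²] 𝔽z nonsquare)))
    where
    square-resp-≈ : ∀ {y y′} → y ≈ y′ → 𝔽 y × y * y ≈ z → 𝔽 y′ × y′ * y′ ≈ z
    square-resp-≈ y≈y′ (𝔽y , eq) = 𝔽-resp-≈ y≈y′ 𝔽y , trans (*-cong (sym y≈y′) (sym y≈y′)) eq

module Cubes {c ℓ} (q : ℕ) (q-odd-prime-power : OddPrimePower q) (K : Field c ℓ) (size : FieldNotions.HasSize K (q ℕ.* q)) where
  open Field K
  open FieldNotions K
  open Subfield q q-odd-prime-power K size
  open IntegerCoefficientSolver commutativeRing
  open import Algebra.Properties.Semiring.Exp semiring using (^-assocʳ; ^-congˡ; ^-homo-*)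
  open import Relation.Binary.Reasoning.Setoid setoid

  private
    x^3≈x*x*x : ∀ x → x ^ 3 ≈ x * x * x
    x^3≈x*x*x x = solve 1 (λ x → x :^ 3 := x :* x :* x) refl x

  -- For q = 3t + 2 the exponent 2q - 1 = 3(2t + 1) fixes 𝔽, so u ↦ u³ has an inverse on 𝔽.
  cube-injective : q % 3 ≡ 2 → ∀ {u v} → 𝔽 u → 𝔽 v → u * u * u ≈ v * v * v → u ≈ v
  cube-injective q%3≡2 {u} {v} 𝔽u 𝔽v u³≈v³ = begin
      u                         ≈⟨ fixed 𝔽u ⟨
      u ^ (q ℕ.+ q′)            ≡⟨ ≡.cong (u ^_) 2q-1≡3j ⟩
      u ^ (3 ℕ.* j)             ≈⟨ ^-assocʳ u 3 j ⟨
      (u ^ 3) ^ j               ≈⟨ ^-congˡ j (trans (x^3≈x*x*x u) (trans u³≈v³ (sym (x^3≈x*x*x v)))) ⟩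
      (v ^ 3) ^ j               ≈⟨ ^-assocʳ v 3 j ⟩
      v ^ (3 ℕ.* j)             ≡⟨ ≡.cong (v ^_) 2q-1≡3j ⟨
      v ^ (q ℕ.+ q′)            ≈⟨ fixed 𝔽v ⟩
      v                         ∎
    where
    t = q / 3
    q′ = 1 ℕ.+ t ℕ.* 3
    j = 2 ℕ.* t ℕ.+ 1
    q≡2+3t : q ≡ 2 ℕ.+ t ℕ.* 3
    q≡2+3t = ≡.trans (m≡m%n+[m/n]*n q 3) (≡.cong (ℕ._+ t ℕ.* 3) q%3≡2)
    2q-1≡3j : q ℕ.+ q′ ≡ 3 ℕ.* j
    2q-1≡3j = ≡.trans (≡.cong (ℕ._+ q′) q≡2+3t) ([2+3t]+[1+3t]≡3[2t+1] t)
    fixed : ∀ {x} → 𝔽 x → x ^ (q ℕ.+ q′) ≈ x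
    fixed {x} 𝔽x = begin
      x ^ (q ℕ.+ q′)       ≈⟨ ^-homo-* x q q′ ⟩
      x ^ q * x ^ q′       ≈⟨ *-congʳ 𝔽x ⟩
      x * x ^ q′           ≡⟨ ≡.cong (x ^_) (≡.sym q≡2+3t) ⟩
      x ^ q                ≈⟨ 𝔽x ⟩
      x                    ∎

  -- A point x with x ^ (M + 1) ≉ x exists since M + 1 < q², and ω = x ^ M then has ω³ = x ^ (q²-1) = 1.
  nontrivial-cube-root-of-unity : ∀ M → 1 ℕ.≤ M → q ℕ.* q ≡ 1 ℕ.+ 3 ℕ.* M → ∃ λ ω → ¬ ω ≈ 1# × ω * ω * ω ≈ 1#
  nontrivial-cube-root-of-unity M 1≤M q*q≡1+3M = x ^ M , ω≉1 , ω³≈1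
    where
    moved = x^d≉x-somewhere (suc M) (s≤s 1≤M) (≡.subst (suc M ℕ.<_) (≡.sym q*q≡1+3M) (s≤s (ℕ.+-mono-≤ {1} 1≤M (ℕ.m≤m+n M _))))
    x = proj₁ moved
    x≉0 : ¬ x ≈ 0#
    x≉0 x≈0 = proj₂ moved (trans (*-congʳ x≈0) (trans (zeroˡ _) (sym x≈0)))
    ω≉1 : ¬ x ^ M ≈ 1#
    ω≉1 ω≈1 = proj₂ moved (trans (*-congˡ ω≈1) (*-identityʳ x))
    ω³≈1 : x ^ M * x ^ M * x ^ M ≈ 1#
    ω³≈1 = *-cancelˡ x≉0 (begin
      x * (x ^ M * x ^ M * x ^ M)  ≈⟨ *-congˡ (sym (x^3≈x*x*x (x ^ M))) ⟩
      x * (x ^ M) ^ 3              ≈⟨ *-congˡ (^-assocʳ x M 3) ⟩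
      x * x ^ (M ℕ.* 3)            ≡⟨ ≡.cong (λ e → x * x ^ e) (ℕ.*-comm M 3) ⟩
      x * x ^ (3 ℕ.* M)            ≡⟨ ≡.cong (x ^_) q*q≡1+3M ⟨
      x ^ (q ℕ.* q)                ≈⟨ x^N≈x x ⟩
      x                            ≈⟨ *-identityʳ x ⟨
      x * 1#                       ∎)

  primitive-cube-root : q % 3 ≡ 1 → ∃ λ ω → 𝔽 ω × ¬ ω ≈ 1# × ω * ω + ω + 1# ≈ 0#
  primitive-cube-root q%3≡1 = ω , 𝔽ω , ω≉1 , ω²+ω+1≈0
    where
    t = q / 3
    q≡1+3t : q ≡ 1 ℕ.+ t ℕ.* 3
    q≡1+3t = ≡.trans (m≡m%n+[m/n]*n q 3) (≡.cong (ℕ._+ t ℕ.* 3) q%3≡1)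
    1≤t : 1 ℕ.≤ t
    1≤t with t | q≡1+3t
    ... | zero | q≡1 = contradiction (≡.subst (2 ℕ.≤_) q≡1 2≤q) λ { (s≤s ()) }
    ... | suc _ | _ = s≤s z≤n
    root = nontrivial-cube-root-of-unity (t ℕ.* (2 ℕ.+ t ℕ.* 3)) (ℕ.≤-trans 1≤t (ℕ.m≤m*n t (2 ℕ.+ t ℕ.* 3)))
             (≡.trans (≡.cong₂ ℕ._*_ q≡1+3t q≡1+3t) ([1+3t]²≡1+3[t[2+3t]] t))
    ω = proj₁ root
    ω≉1 = proj₁ (proj₂ root)
    ω³≈1 = proj₂ (proj₂ root)
    𝔽ω : 𝔽 ω
    𝔽ω = ≡.subst (λ e → ω ^ e ≈ ω) (≡.sym q≡1+3t) (begin
      ω * ω ^ (t ℕ.* 3)      ≡⟨ ≡.cong (λ e → ω * ω ^ e) (ℕ.*-comm t 3) ⟩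
      ω * ω ^ (3 ℕ.* t)      ≈⟨ *-congˡ (^-assocʳ ω 3 t) ⟨
      ω * (ω ^ 3) ^ t        ≈⟨ *-congˡ (^-congˡ t (trans (x^3≈x*x*x ω) ω³≈1)) ⟩
      ω * 1# ^ t             ≈⟨ *-congˡ (1^n≈1 t) ⟩
      ω * 1#                 ≈⟨ *-identityʳ ω ⟩
      ω                      ∎)
    ω²+ω+1≈0 : ω * ω + ω + 1# ≈ 0#
    ω²+ω+1≈0 = x*y≈0⇒y≈0 (λ ω-1≈0 → ω≉1 (x-y≈0⇒x≈y ω-1≈0)) (begin
      (ω - 1#) * (ω * ω + ω + 1#)   ≈⟨ solve 1 (λ w → (w :- con (+ 1)) :* (w :* w :+ w :+ con (+ 1)) := w :* w :* w :- con (+ 1)) refl ω ⟩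
      ω * ω * ω - 1#               ≈⟨ x≈y⇒x-y≈0 ω³≈1 ⟩
      0#                           ∎)

module CubicCriteria {c ℓ} (q : ℕ) (q-odd-prime-power : OddPrimePower q) (K : Field c ℓ) (size : FieldNotions.HasSize K (q ℕ.* q)) where
  open Field K
  open FieldNotions K
  open Squares q q-odd-prime-power K size public
  open Cubes q q-odd-prime-power K size public
  open IntegerCoefficientSolver commutativeRing
  open import Algebra.Properties.Group +-group using () renaming (∙-cancelʳ to +-cancelʳ)
  open import Relation.Binary.Reasoning.Setoid setoid

  W : Carrier → Carrier → Carrier
  W r s = r * r + r * s + s * s

  W-cong : ∀ {r s r′ s′} → r ≈ r′ → s ≈ s′ → W r s ≈ W r′ s′
  W-cong r≈r′ s≈s′ = +-cong (+-cong (*-cong r≈r′ r≈r′) (*-cong r≈r′ s≈s′)) (*-cong s≈s′ s≈s′)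

  -- Q c₃ c₂ c₁ r s is the divided difference (P r - P s) / (r - s) of P x = c₃ x³ + c₂ x² + c₁ x,
  -- so OffDiagonalNonzero c₃ c₂ c₁ says that P is injective on 𝔽.
  Q : Carrier → Carrier → Carrier → Carrier → Carrier → Carrier
  Q c₃ c₂ c₁ r s = c₃ * W r s + c₂ * (r + s) + c₁

  OffDiagonalNonzero : Carrier → Carrier → Carrier → Set (c ⊔ ℓ)
  OffDiagonalNonzero c₃ c₂ c₁ = ∀ {r s} → 𝔽 r → 𝔽 s → Q c₃ c₂ c₁ r s ≈ 0# → r ≈ s

  record SumAndDifference (t : Carrier) : Set (c ⊔ ℓ) where
    field
      r s : Carrier
      𝔽r : 𝔽 r
      𝔽s : 𝔽 s
      r+s≈t : r + s ≈ t
      r-s≈1 : r - s ≈ 1#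

    r≉s : ¬ r ≈ s
    r≉s r≈s = 1≉0 (trans (sym r-s≈1) (x≈y⇒x-y≈0 r≈s))

  difference-1-and-sum : ∀ {t} → 𝔽 t → SumAndDifference t
  difference-1-and-sum {t} 𝔽t = record
    { r = ½ * (t + 1#)
    ; s = ½ * (t - 1#)
    ; 𝔽r = 𝔽-* 𝔽-½ (𝔽-+ 𝔽t 𝔽-1)
    ; 𝔽s = 𝔽-* 𝔽-½ (𝔽-sub 𝔽t 𝔽-1)
    ; r+s≈t = trans (solve 2 (λ h t → h :* (t :+ con (+ 1)) :+ h :* (t :- con (+ 1)) := (h :+ h) :* t) refl ½ t) (trans (*-congʳ ½+½≈1) (*-identityˡ t))
    ; r-s≈1 = trans (solve 2 (λ h t → h :* (t :+ con (+ 1)) :- h :* (t :- con (+ 1)) := h :+ h) refl ½ t) ½+½≈1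
    }

  private
    c₃≈0⇒Q≈ : ∀ {c₃ c₂ c₁} → c₃ ≈ 0# → ∀ r s → Q c₃ c₂ c₁ r s ≈ c₂ * (r + s) + c₁
    c₃≈0⇒Q≈ {c₃} {c₂} {c₁} c₃≈0 r s = begin
      c₃ * W r s + c₂ * (r + s) + c₁   ≈⟨ +-congʳ (+-congʳ (trans (*-congʳ c₃≈0) (zeroˡ _))) ⟩
      0# + c₂ * (r + s) + c₁           ≈⟨ +-congʳ (+-identityˡ _) ⟩
      c₂ * (r + s) + c₁                ∎

  degenerate-criterion : ∀ {c₃ c₂ c₁} → c₃ ≈ 0# → 𝔽 c₂ → 𝔽 c₁ →
                         OffDiagonalNonzero c₃ c₂ c₁ ⇔ (c₂ ≈ 0# × ¬ c₁ ≈ 0#)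
  degenerate-criterion {c₃} {c₂} {c₁} c₃≈0 𝔽c₂ 𝔽c₁ = mk⇔ necessary sufficient
    where
    c₂≈0 : OffDiagonalNonzero c₃ c₂ c₁ → c₂ ≈ 0#
    c₂≈0 nonvanishing with c₂ ≟ 0#
    ... | yes c₂≈0 = c₂≈0
    ... | no c₂≉0 = ⊥-elim (r≉s (nonvanishing 𝔽r 𝔽s Q≈0))
      where
      open SumAndDifference (difference-1-and-sum (𝔽-neg (𝔽-* 𝔽c₁ (𝔽-⁻¹ 𝔽c₂ c₂≉0))))
      Q≈0 : Q c₃ c₂ c₁ r s ≈ 0#
      Q≈0 = begin
        Q c₃ c₂ c₁ r s                  ≈⟨ c₃≈0⇒Q≈ c₃≈0 r s ⟩
        c₂ * (r + s) + c₁               ≈⟨ +-congʳ (*-congˡ r+s≈t) ⟩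
        c₂ * - (c₁ * c₂ ⁻¹) + c₁        ≈⟨ solve 3 (λ c₂ c₁ i → c₂ :* (:- (c₁ :* i)) :+ c₁ := c₁ :- c₂ :* (c₁ :* i)) refl c₂ c₁ (c₂ ⁻¹) ⟩
        c₁ - c₂ * (c₁ * c₂ ⁻¹)          ≈⟨ +-congˡ (-‿cong (x*[y*x⁻¹]≈y c₂≉0 c₁)) ⟩
        c₁ - c₁                     ≈⟨ -‿inverseʳ c₁ ⟩
        0#                          ∎
    c₁≉0 : OffDiagonalNonzero c₃ c₂ c₁ → ¬ c₁ ≈ 0#
    c₁≉0 nonvanishing c₁≈0 = 1≉0 (sym (nonvanishing 𝔽-0 𝔽-1 (begin
      Q c₃ c₂ c₁ 0# 1#                ≈⟨ c₃≈0⇒Q≈ c₃≈0 0# 1# ⟩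
      c₂ * (0# + 1#) + c₁             ≈⟨ +-cong (trans (*-congʳ (c₂≈0 nonvanishing)) (zeroˡ _)) c₁≈0 ⟩
      0# + 0#                     ≈⟨ +-identityʳ 0# ⟩
      0#                          ∎)))
    necessary : OffDiagonalNonzero c₃ c₂ c₁ → c₂ ≈ 0# × ¬ c₁ ≈ 0#
    necessary nonvanishing = c₂≈0 nonvanishing , c₁≉0 nonvanishing
    sufficient : c₂ ≈ 0# × ¬ c₁ ≈ 0# → OffDiagonalNonzero c₃ c₂ c₁
    sufficient (c₂≈0 , c₁≉0) {r} {s} _ _ Q≈0 = contradiction (begin
      c₁                  ≈⟨ +-identityˡ c₁ ⟨
      0# + c₁                 ≈⟨ +-congʳ (trans (*-congʳ c₂≈0) (zeroˡ _)) ⟨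
      c₂ * (r + s) + c₁           ≈⟨ c₃≈0⇒Q≈ c₃≈0 r s ⟨
      Q c₃ c₂ c₁ r s          ≈⟨ Q≈0 ⟩
      0#                  ∎) c₁≉0

  three≈0⇒W≈[r-s]² : three ≈ 0# → ∀ r s → W r s ≈ (r - s) * (r - s)
  three≈0⇒W≈[r-s]² three≈0 r s = begin
    W r s
      ≈⟨ solve 2 (λ r s → r :* r :+ r :* s :+ s :* s := (r :- s) :* (r :- s) :+ (con (+ 1) :+ con (+ 1) :+ con (+ 1)) :* (r :* s)) refl r s ⟩
    (r - s) * (r - s) + three * (r * s)    ≈⟨ +-congˡ (trans (*-congʳ three≈0) (zeroˡ _)) ⟩
    (r - s) * (r - s) + 0#                 ≈⟨ +-identityʳ _ ⟩
    (r - s) * (r - s)                      ∎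

  module _ {c₃ c₂ c₁} (three≈0 : three ≈ 0#) (c₃≉0 : ¬ c₃ ≈ 0#) (𝔽c₃ : 𝔽 c₃) (𝔽c₂ : 𝔽 c₂) (𝔽c₁ : 𝔽 c₁) where
    private
      Q≈c₃[r-s]²+c₂[r+s]+c₁ : ∀ r s → Q c₃ c₂ c₁ r s ≈ c₃ * ((r - s) * (r - s)) + c₂ * (r + s) + c₁
      Q≈c₃[r-s]²+c₂[r+s]+c₁ r s = +-congʳ (+-congʳ (*-congˡ (three≈0⇒W≈[r-s]² three≈0 r s)))

      c₃d+c₁≈0⇒d≈-c₁/c₃ : ∀ {d} → c₃ * d + c₁ ≈ 0# → d ≈ - c₁ * c₃ ⁻¹
      c₃d+c₁≈0⇒d≈-c₁/c₃ {d} eq = begin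
        d                                    ≈⟨ *-identityˡ d ⟨
        1# * d                               ≈⟨ *-congʳ (⁻¹-inverseˡ c₃ c₃≉0) ⟨
        c₃ ⁻¹ * c₃ * d                       ≈⟨ solve 4 (λ i c d c₁ → i :* c :* d := i :* (c :* d :+ c₁) :+ :- c₁ :* i) refl (c₃ ⁻¹) c₃ d c₁ ⟩
        c₃ ⁻¹ * (c₃ * d + c₁) + - c₁ * c₃ ⁻¹ ≈⟨ +-congʳ (trans (*-congˡ eq) (zeroʳ _)) ⟩
        0# + - c₁ * c₃ ⁻¹                    ≈⟨ +-identityˡ _ ⟩
        - c₁ * c₃ ⁻¹                         ∎

      offDiagonalNonzero⇒c₂≈0 : OffDiagonalNonzero c₃ c₂ c₁ → c₂ ≈ 0#
      offDiagonalNonzero⇒c₂≈0 nonvanishing with c₂ ≟ 0#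
      ... | yes c₂≈0 = c₂≈0
      ... | no c₂≉0 = ⊥-elim (r≉s (nonvanishing 𝔽r 𝔽s Q≈0))
        where
        open SumAndDifference (difference-1-and-sum (𝔽-neg (𝔽-* (𝔽-+ 𝔽c₃ 𝔽c₁) (𝔽-⁻¹ 𝔽c₂ c₂≉0))))
        Q≈0 : Q c₃ c₂ c₁ r s ≈ 0#
        Q≈0 = begin
          Q c₃ c₂ c₁ r s                                   ≈⟨ Q≈c₃[r-s]²+c₂[r+s]+c₁ r s ⟩
          c₃ * ((r - s) * (r - s)) + c₂ * (r + s) + c₁     ≈⟨ +-congʳ (+-cong (*-congˡ (trans (*-cong r-s≈1 r-s≈1) (*-identityˡ 1#))) (*-congˡ r+s≈t)) ⟩
          c₃ * 1# + c₂ * - ((c₃ + c₁) * c₂ ⁻¹) + c₁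
            ≈⟨ solve 4 (λ c₃ c₂ c₁ i → c₃ :* con (+ 1) :+ c₂ :* (:- ((c₃ :+ c₁) :* i)) :+ c₁ := (c₃ :+ c₁) :- c₂ :* ((c₃ :+ c₁) :* i)) refl c₃ c₂ c₁ (c₂ ⁻¹) ⟩
          (c₃ + c₁) - c₂ * ((c₃ + c₁) * c₂ ⁻¹)             ≈⟨ +-congˡ (-‿cong (x*[y*x⁻¹]≈y c₂≉0 _)) ⟩
          (c₃ + c₁) - (c₃ + c₁)                            ≈⟨ -‿inverseʳ _ ⟩
          0#                                               ∎

      offDiagonalNonzero⇒¬nonzeroSquare : OffDiagonalNonzero c₃ c₂ c₁ → ¬ NonzeroSquare (- c₁ * c₃ ⁻¹)
      offDiagonalNonzero⇒¬nonzeroSquare nonvanishing (d , 𝔽d , d≉0 , d²≈-c₁/c₃) = d≉0 (nonvanishing 𝔽d 𝔽-0 (begin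
        Q c₃ c₂ c₁ d 0#                                  ≈⟨ Q≈c₃[r-s]²+c₂[r+s]+c₁ d 0# ⟩
        c₃ * ((d - 0#) * (d - 0#)) + c₂ * (d + 0#) + c₁
          ≈⟨ +-congʳ (+-cong (*-congˡ (trans (solve 1 (λ d → (d :- con (+ 0)) :* (d :- con (+ 0)) := d :* d) refl d) d²≈-c₁/c₃))
                                                                     (trans (*-congʳ (offDiagonalNonzero⇒c₂≈0 nonvanishing)) (zeroˡ _))) ⟩
        c₃ * (- c₁ * c₃ ⁻¹) + 0# + c₁                    ≈⟨ solve 3 (λ c₃ c₁ i → c₃ :* (:- c₁ :* i) :+ con (+ 0) :+ c₁ := c₁ :- c₃ :* (c₁ :* i)) refl c₃ c₁ (c₃ ⁻¹) ⟩
        c₁ - c₃ * (c₁ * c₃ ⁻¹)                           ≈⟨ +-congˡ (-‿cong (x*[y*x⁻¹]≈y c₃≉0 c₁)) ⟩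
        c₁ - c₁                                          ≈⟨ -‿inverseʳ c₁ ⟩
        0#                                               ∎))

      offDiagonalNonzero⇐ : c₂ ≈ 0# × ¬ NonzeroSquare (- c₁ * c₃ ⁻¹) → OffDiagonalNonzero c₃ c₂ c₁
      offDiagonalNonzero⇐ (c₂≈0 , no-root) {r} {s} 𝔽r 𝔽s Q≈0 with r - s ≟ 0#
      ... | yes r-s≈0 = x-y≈0⇒x≈y r-s≈0
      ... | no r-s≉0 = ⊥-elim (no-root (r - s , 𝔽-sub 𝔽r 𝔽s , r-s≉0 , c₃d+c₁≈0⇒d≈-c₁/c₃ (begin
        c₃ * ((r - s) * (r - s)) + c₁                    ≈⟨ +-congʳ (trans (+-congˡ (trans (*-congʳ c₂≈0) (zeroˡ _))) (+-identityʳ _)) ⟨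
        c₃ * ((r - s) * (r - s)) + c₂ * (r + s) + c₁     ≈⟨ Q≈c₃[r-s]²+c₂[r+s]+c₁ r s ⟨
        Q c₃ c₂ c₁ r s                                   ≈⟨ Q≈0 ⟩
        0#                                               ∎)))

      offDiagonalNonzero⇒ : OffDiagonalNonzero c₃ c₂ c₁ → c₂ ≈ 0# × ¬ NonzeroSquare (- c₁ * c₃ ⁻¹)
      offDiagonalNonzero⇒ nonvanishing = offDiagonalNonzero⇒c₂≈0 nonvanishing , offDiagonalNonzero⇒¬nonzeroSquare nonvanishing

    char3-criterion : OffDiagonalNonzero c₃ c₂ c₁ ⇔ (c₂ ≈ 0# × ¬ NonzeroSquare (- c₁ * c₃ ⁻¹))
    char3-criterion = mk⇔ offDiagonalNonzero⇒ offDiagonalNonzero⇐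

  module _ {c₃ c₂ c₁} (three≉0 : ¬ three ≈ 0#) (c₃≉0 : ¬ c₃ ≈ 0#) (𝔽c₃ : 𝔽 c₃) (𝔽c₂ : 𝔽 c₂) (𝔽c₁ : 𝔽 c₁) where
    private
      k A : Carrier
      k = c₂ * (three * c₃) ⁻¹
      A = c₁ * c₃ ⁻¹ - three * (k * k)

      𝔽k : 𝔽 k
      𝔽k = 𝔽-* 𝔽c₂ (𝔽-⁻¹ (𝔽-* 𝔽-three 𝔽c₃) (x≉0∧y≉0⇒x*y≉0 three≉0 c₃≉0))

      𝔽A : 𝔽 A
      𝔽A = 𝔽-sub (𝔽-* 𝔽c₁ (𝔽-⁻¹ 𝔽c₃ c₃≉0)) (𝔽-* 𝔽-three (𝔽-* 𝔽k 𝔽k))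

      c₃*three*k≈c₂ : c₃ * three * k ≈ c₂
      c₃*three*k≈c₂ = begin
        c₃ * three * k
          ≈⟨ solve 3 (λ c₃ c₂ j → c₃ :* (con (+ 1) :+ con (+ 1) :+ con (+ 1)) :* (c₂ :* j) := c₂ :* ((con (+ 1) :+ con (+ 1) :+ con (+ 1)) :* c₃ :* j)) refl c₃ c₂ ((three * c₃) ⁻¹) ⟩
        c₂ * (three * c₃ * (three * c₃) ⁻¹)    ≈⟨ *-congˡ (⁻¹-inverse (three * c₃) (x≉0∧y≉0⇒x*y≉0 three≉0 c₃≉0)) ⟩
        c₂ * 1#                                ≈⟨ *-identityʳ c₂ ⟩
        c₂                                     ∎

      -- Completing the cube: the substitution x ↦ x + k removes the quadratic term of c₃ x³ + c₂ x² + c₁ x.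
      Q≈c₃[W+A] : ∀ r s → Q c₃ c₂ c₁ r s ≈ c₃ * (W (r + k) (s + k) + A)
      Q≈c₃[W+A] r s = sym (begin
        c₃ * (W (r + k) (s + k) + A)                              ≈⟨ solve 6 (λ c₃ r s k c₁ i →
            c₃ :* (W′ (r :+ k) (s :+ k) :+ (c₁ :* i :- three′ :* (k :* k)))
            := c₃ :* W′ r s :+ (c₃ :* three′ :* k) :* (r :+ s) :+ c₁ :* (c₃ :* i)) refl c₃ r s k c₁ (c₃ ⁻¹) ⟩
        c₃ * W r s + (c₃ * three * k) * (r + s) + c₁ * (c₃ * c₃ ⁻¹) ≈⟨ +-cong (+-congˡ (*-congʳ c₃*three*k≈c₂)) (trans (*-congˡ (⁻¹-inverse c₃ c₃≉0)) (*-identityʳ c₁)) ⟩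
        c₃ * W r s + c₂ * (r + s) + c₁                            ∎)
        where
        three′ : ∀ {n} → Polynomial n
        three′ = con (+ 1) :+ con (+ 1) :+ con (+ 1)
        W′ : ∀ {n} → Polynomial n → Polynomial n → Polynomial n
        W′ a b = a :* a :+ a :* b :+ b :* b

      three*c₃*c₃*A≈three*c₃*c₁-c₂² : three * c₃ * c₃ * A ≈ three * c₃ * c₁ - c₂ * c₂
      three*c₃*c₃*A≈three*c₃*c₁-c₂² = begin
        three * c₃ * c₃ * A
          ≈⟨ solve 5 (λ c₃ c₁ i k t → t :* c₃ :* c₃ :* (c₁ :* i :- t :* (k :* k)) := t :* c₃ :* c₁ :* (c₃ :* i) :- (c₃ :* t :* k) :* (c₃ :* t :* k)) refl c₃ c₁ (c₃ ⁻¹) k three ⟩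
        three * c₃ * c₁ * (c₃ * c₃ ⁻¹) - (c₃ * three * k) * (c₃ * three * k) ≈⟨ +-cong (trans (*-congˡ (⁻¹-inverse c₃ c₃≉0)) (*-identityʳ _)) (-‿cong (*-cong c₃*three*k≈c₂ c₃*three*k≈c₂)) ⟩
        three * c₃ * c₁ - c₂ * c₂                                    ∎

      A≈0⇔three*c₃*c₁≈c₂² : A ≈ 0# ⇔ (three * c₃ * c₁ ≈ c₂ * c₂)
      A≈0⇔three*c₃*c₁≈c₂² = mk⇔
        (λ A≈0 → x-y≈0⇒x≈y (trans (sym three*c₃*c₃*A≈three*c₃*c₁-c₂²) (trans (*-congˡ A≈0) (zeroʳ _))))
        (λ eq → x*y≈0⇒y≈0 (x≉0∧y≉0⇒x*y≉0 (x≉0∧y≉0⇒x*y≉0 three≉0 c₃≉0) c₃≉0) (trans three*c₃*c₃*A≈three*c₃*c₁-c₂² (x≈y⇒x-y≈0 eq)))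

      ShiftedNonzero : Set (c ⊔ ℓ)
      ShiftedNonzero = ∀ {u v} → 𝔽 u → 𝔽 v → W u v + A ≈ 0# → u ≈ v

      offDiagonalNonzero⇔shiftedNonzero : OffDiagonalNonzero c₃ c₂ c₁ ⇔ ShiftedNonzero
      offDiagonalNonzero⇔shiftedNonzero = mk⇔ shift unshift
        where
        u-k+k≈u : ∀ u → (u - k) + k ≈ u
        u-k+k≈u u = solve 2 (λ u k → (u :- k) :+ k := u) refl u k
        shift : OffDiagonalNonzero c₃ c₂ c₁ → ShiftedNonzero
        shift nonvanishing {u} {v} 𝔽u 𝔽v W+A≈0 = begin
          u              ≈⟨ u-k+k≈u u ⟨
          (u - k) + k    ≈⟨ +-congʳ (nonvanishing (𝔽-sub 𝔽u 𝔽k) (𝔽-sub 𝔽v 𝔽k) Q≈0) ⟩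
          (v - k) + k    ≈⟨ u-k+k≈u v ⟩
          v              ∎
          where
          Q≈0 : Q c₃ c₂ c₁ (u - k) (v - k) ≈ 0#
          Q≈0 = trans (Q≈c₃[W+A] _ _) (trans (*-congˡ (trans (+-congʳ (W-cong (u-k+k≈u u) (u-k+k≈u v))) W+A≈0)) (zeroʳ c₃))
        unshift : ShiftedNonzero → OffDiagonalNonzero c₃ c₂ c₁
        unshift nonvanishing {r} {s} 𝔽r 𝔽s Q≈0 = +-cancelʳ k r s (nonvanishing (𝔽-+ 𝔽r 𝔽k) (𝔽-+ 𝔽s 𝔽k) (x*y≈0⇒y≈0 c₃≉0 (trans (sym (Q≈c₃[W+A] r s)) Q≈0)))

      -- Writing α² + 3β² = -4A (always possible) and u = (α - β)/2 gives W u β = -A, so u ≈ β;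
      -- then W β β = W β (-2β) = 3β² forces β ≈ -2β, i.e. β ≈ 0 and A ≈ 0.
      shiftedNonzero⇒A≈0 : ShiftedNonzero → A ≈ 0#
      shiftedNonzero⇒A≈0 nonvanishing = begin
          A                  ≈⟨ +-identityˡ A ⟨
          0# + A
            ≈⟨ +-congʳ (trans (W-cong β≈0 β≈0) (solve 0 (con (+ 0) :* con (+ 0) :+ con (+ 0) :* con (+ 0) :+ con (+ 0) :* con (+ 0) := con (+ 0)) refl)) ⟨
          W β β + A          ≈⟨ Wββ+A≈0 ⟩
          0#                 ∎
        where
        squares = sum-of-squares 𝔽-three (𝔽-neg (𝔽-* (𝔽-* 𝔽-two 𝔽-two) 𝔽A)) three≉0
        α = proj₁ squares
        𝔽α = proj₁ (proj₂ squares)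
        β = proj₁ (proj₂ (proj₂ squares))
        𝔽β = proj₁ (proj₂ (proj₂ (proj₂ squares)))
        α²+3β²≈-4A = proj₂ (proj₂ (proj₂ (proj₂ squares)))
        u = ½ * (α - β)
        Wuβ≈-A : W u β ≈ - A
        Wuβ≈-A = begin
          W u β                                    ≈⟨ ≈-by-½+½≈1 (- (½ * α * β + (1# + ½) * β * β)) (solve 3 (λ h a b →
                                                        (h :* (a :- b)) :* (h :* (a :- b)) :+ (h :* (a :- b)) :* b :+ b :* b
                                                        := h :* h :* (a :* a :+ (con (+ 1) :+ con (+ 1) :+ con (+ 1)) :* (b :* b))
                                                           :+ (h :+ h :- con (+ 1)) :* (:- (h :* a :* b :+ (con (+ 1) :+ h) :* b :* b))) refl ½ α β) ⟩
          ½ * ½ * (α * α + three * (β * β))        ≈⟨ *-congˡ α²+3β²≈-4A ⟩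
          ½ * ½ * - (two * two * A)                ≈⟨ solve 3 (λ h t A → h :* h :* (:- (t :* t :* A)) := :- ((t :* h) :* (t :* h) :* A)) refl ½ two A ⟩
          - ((two * ½) * (two * ½) * A)            ≈⟨ -‿cong (trans (*-congʳ (trans (*-cong two*½≈1 two*½≈1) (*-identityˡ 1#))) (*-identityˡ A)) ⟩
          - A                                      ∎
        Wββ+A≈0 : W β β + A ≈ 0#
        Wββ+A≈0 = trans (+-congʳ (W-cong (sym (nonvanishing (𝔽-* 𝔽-½ (𝔽-sub 𝔽α 𝔽β)) 𝔽β (trans (+-congʳ Wuβ≈-A) (-‿inverseˡ A)))) refl))
                        (trans (+-congʳ Wuβ≈-A) (-‿inverseˡ A))
        β≈-2β : β ≈ - (β + β)
        β≈-2β = nonvanishing 𝔽β (𝔽-neg (𝔽-+ 𝔽β 𝔽β)) (trans (+-congʳ (solve 1 (λ b → b :* b :+ b :* (:- (b :+ b)) :+ (:- (b :+ b)) :* (:- (b :+ b)) := b :* b :+ b :* b :+ b :* b) refl β)) Wββ+A≈0)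
        β≈0 : β ≈ 0#
        β≈0 = x*y≈0⇒y≈0 three≉0 (trans (solve 1 (λ b → (con (+ 1) :+ con (+ 1) :+ con (+ 1)) :* b := b :- (:- (b :+ b))) refl β) (x≈y⇒x-y≈0 β≈-2β))

      -- For q ≡ 1 (mod 3) a primitive cube root of unity ω gives W ω 1 = 0 with ω ≉ 1.
      shiftedNonzero⇒q%3≡2 : ShiftedNonzero → q % 3 ≡ 2
      shiftedNonzero⇒q%3≡2 nonvanishing = by-remainder (q % 3) ≡.refl (m%n<n q 3)
        where
        A≈0 = shiftedNonzero⇒A≈0 nonvanishing
        by-remainder : ∀ r → q % 3 ≡ r → r ℕ.< 3 → q % 3 ≡ 2
        by-remainder 0 q%3≡0 _ = contradiction (3∣q⇒three≈0 (ℕ.m%n≡0⇒n∣m q 3 q%3≡0)) three≉0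
        by-remainder 1 q%3≡1 _ = ⊥-elim (ω≉1 (nonvanishing 𝔽ω 𝔽-1 (begin
              W ω 1# + A                   ≈⟨ +-cong (solve 1 (λ w → w :* w :+ w :* con (+ 1) :+ con (+ 1) :* con (+ 1) := w :* w :+ w :+ con (+ 1)) refl ω) A≈0 ⟩
              ω * ω + ω + 1# + 0#          ≈⟨ +-identityʳ _ ⟩
              ω * ω + ω + 1#               ≈⟨ ω²+ω+1≈0 ⟩
              0#                           ∎)))
          where
          cube-root = primitive-cube-root q%3≡1
          ω = proj₁ cube-root
          𝔽ω = proj₁ (proj₂ cube-root)
          ω≉1 = proj₁ (proj₂ (proj₂ cube-root))
          ω²+ω+1≈0 = proj₂ (proj₂ (proj₂ cube-root))
        by-remainder 2 q%3≡2 _ = q%3≡2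
        by-remainder (suc (suc (suc _))) _ (s≤s (s≤s (s≤s ())))

      -- For q ≡ 2 (mod 3), W u v = 0 means u³ = v³, and cubing is injective on 𝔽.
      q%3≡2⇒shiftedNonzero : q % 3 ≡ 2 → A ≈ 0# → ShiftedNonzero
      q%3≡2⇒shiftedNonzero q%3≡2 A≈0 {u} {v} 𝔽u 𝔽v W+A≈0 = cube-injective q%3≡2 𝔽u 𝔽v (x-y≈0⇒x≈y (begin
        u * u * u - v * v * v        ≈⟨ solve 2 (λ u v → u :* u :* u :- v :* v :* v := (u :- v) :* (u :* u :+ u :* v :+ v :* v)) refl u v ⟩
        (u - v) * W u v              ≈⟨ *-congˡ (trans (sym (+-identityʳ _)) (trans (+-congˡ (sym A≈0)) W+A≈0)) ⟩
        (u - v) * 0#                 ≈⟨ zeroʳ _ ⟩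
        0#                           ∎))

    char≠3-criterion : OffDiagonalNonzero c₃ c₂ c₁ ⇔ (q % 3 ≡ 2 × three * c₃ * c₁ ≈ c₂ * c₂)
    char≠3-criterion = mk⇔ necessary sufficient
      where
      necessary : OffDiagonalNonzero c₃ c₂ c₁ → q % 3 ≡ 2 × three * c₃ * c₁ ≈ c₂ * c₂
      necessary nonvanishing = shiftedNonzero⇒q%3≡2 shifted , Equivalence.to A≈0⇔three*c₃*c₁≈c₂² (shiftedNonzero⇒A≈0 shifted)
        where shifted = Equivalence.to offDiagonalNonzero⇔shiftedNonzero nonvanishing
      sufficient : q % 3 ≡ 2 × three * c₃ * c₁ ≈ c₂ * c₂ → OffDiagonalNonzero c₃ c₂ c₁
      sufficient (q%3≡2 , eq) = Equivalence.from offDiagonalNonzero⇔shiftedNonzero (q%3≡2⇒shiftedNonzero q%3≡2 (Equivalence.from A≈0⇔three*c₃*c₁≈c₂² eq))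

module Reduction {c ℓ} (q : ℕ) (q-odd-prime-power : OddPrimePower q) (K : Field c ℓ) (size : FieldNotions.HasSize K (q ℕ.* q))
                 (γ δ : Field.Carrier K) (γ≉0 : ¬ Field._≈_ K γ (Field.0# K)) where
  open Field K
  open FieldNotions K
  open CubicCriteria q q-odd-prime-power K size public
  open IntegerCoefficientSolver commutativeRing
  open import Algebra.Properties.Ring ring using (-‿injective; -0#≈0#)
  open import Algebra.Properties.Group +-group using () renaming (∙-cancelˡ to +-cancelˡ)
  open import Algebra.Properties.Semiring.Exp semiring using (^-congˡ; ^-homo-*)
  open import Relation.Binary.Reasoning.Setoid setoid

  f : Carrier → Carrier
  f x = (x ^ q - x + δ) ^ (q ℕ.+ 2) + γ * x

  f-cong : ∀ {x y} → x ≈ y → f x ≈ f y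
  f-cong x≈y = +-cong (^-congˡ (q ℕ.+ 2) (+-congʳ (+-cong (σ-cong x≈y) (-‿cong x≈y)))) (*-congˡ x≈y)

  g₁ g₂ : Carrier
  g₁ = re γ
  g₂ = im γ

  γ≈g₁+εg₂ : γ ≈ g₁ + ε * g₂
  γ≈g₁+εg₂ = sym (re+ε*im≈x γ)

  a : Carrier
  a = ½ * Tr q δ

  𝔽-a : 𝔽 a
  𝔽-a = 𝔽-* 𝔽-½ (𝔽-Tr δ)

  -- Every x ∈ K is point r w for unique r, w ∈ 𝔽, and then x ^ q - x + δ = ε r + a.
  point : Carrier → Carrier → Carrier
  point r w = w - ½ * (ε * r + a - δ)

  point-cong : ∀ {r w r′ w′} → r ≈ r′ → w ≈ w′ → point r w ≈ point r′ w′
  point-cong r≈r′ w≈w′ = +-cong w≈w′ (-‿cong (*-congˡ (+-congʳ (+-congʳ (*-congˡ r≈r′)))))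

  σ[point]-point+δ≈εr+a : ∀ {r w} → 𝔽 r → 𝔽 w → σ (point r w) - point r w + δ ≈ ε * r + a
  σ[point]-point+δ≈εr+a {r} {w} 𝔽r 𝔽w = begin
    σ (point r w) - point r w + δ                      ≈⟨ +-congʳ (+-congʳ σ[point]) ⟩
    (w - ½ * (- (ε * r) + a - σ δ)) - point r w + δ    ≈⟨ ≈-by-½+½≈1 (ε * r - δ) (solve 6 (λ w h e r d dq →
        (w :- h :* (:- (e :* r) :+ h :* (d :+ dq) :- dq)) :- (w :- h :* (e :* r :+ h :* (d :+ dq) :- d)) :+ d
        := e :* r :+ h :* (d :+ dq) :+ (h :+ h :- con (+ 1)) :* (e :* r :- d)) refl w ½ ε r δ (σ δ)) ⟩
    ε * r + a                                          ∎
    where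
    σ[point] : σ (point r w) ≈ w - ½ * (- (ε * r) + a - σ δ)
    σ[point] = begin
      σ (w - ½ * (ε * r + a - δ))            ≈⟨ σ-homo-sub w _ ⟩
      σ w - σ (½ * (ε * r + a - δ))          ≈⟨ +-cong 𝔽w (-‿cong (σ-homo-* ½ _)) ⟩
      w - σ ½ * σ (ε * r + a - δ)            ≈⟨ +-congˡ (-‿cong (*-cong 𝔽-½ (σ-homo-sub _ δ))) ⟩
      w - ½ * (σ (ε * r + a) - σ δ)          ≈⟨ +-congˡ (-‿cong (*-congˡ (+-congʳ (trans (σ-cong (+-comm _ _)) (trans (σ[a+εb]≈a-εb 𝔽-a 𝔽r) (+-comm _ _)))))) ⟩
      w - ½ * (- (ε * r) + a - σ δ)          ∎

  U V : Carrier → Carrier → Carrier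
  U r w = a * a * a - a * ε² * (r * r) + g₁ * w - ½ * g₂ * ε² * r
  V r w = a * a * r - ε² * (r * r * r) + g₂ * w - ½ * g₁ * r

  𝔽-U : ∀ {r w} → 𝔽 r → 𝔽 w → 𝔽 (U r w)
  𝔽-U 𝔽r 𝔽w = 𝔽-sub (𝔽-+ (𝔽-sub (𝔽-* (𝔽-* 𝔽-a 𝔽-a) 𝔽-a) (𝔽-* (𝔽-* 𝔽-a 𝔽-ε²) (𝔽-* 𝔽r 𝔽r))) (𝔽-* (𝔽-re γ) 𝔽w)) (𝔽-* (𝔽-* (𝔽-* 𝔽-½ (𝔽-im γ)) 𝔽-ε²) 𝔽r)

  𝔽-V : ∀ {r w} → 𝔽 r → 𝔽 w → 𝔽 (V r w)
  𝔽-V 𝔽r 𝔽w = 𝔽-sub (𝔽-+ (𝔽-sub (𝔽-* (𝔽-* 𝔽-a 𝔽-a) 𝔽r) (𝔽-* 𝔽-ε² (𝔽-* (𝔽-* 𝔽r 𝔽r) 𝔽r))) (𝔽-* (𝔽-im γ) 𝔽w)) (𝔽-* (𝔽-* 𝔽-½ (𝔽-re γ)) 𝔽r)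

  U-cong : ∀ {r r′} w → r ≈ r′ → U r w ≈ U r′ w
  U-cong w r≈r′ = +-cong (+-congʳ (+-congˡ (-‿cong (*-congˡ (*-cong r≈r′ r≈r′))))) (-‿cong (*-congˡ r≈r′))

  V-cong : ∀ {r r′} w → r ≈ r′ → V r w ≈ V r′ w
  V-cong w r≈r′ = +-cong (+-congʳ (+-cong (*-congˡ r≈r′) (-‿cong (*-congˡ (*-cong (*-cong r≈r′ r≈r′) r≈r′))))) (-‿cong (*-congˡ r≈r′))

  U≈U₀+g₁w : ∀ r w → U r w ≈ U r 0# + g₁ * w
  U≈U₀+g₁w r w = solve 7 (λ g₁ g₂ a e r w h →
    a :* a :* a :- a :* (e :* e) :* (r :* r) :+ g₁ :* w :- h :* g₂ :* (e :* e) :* r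
    := (a :* a :* a :- a :* (e :* e) :* (r :* r) :+ g₁ :* con (+ 0) :- h :* g₂ :* (e :* e) :* r) :+ g₁ :* w) refl g₁ g₂ a ε r w ½

  V≈V₀+g₂w : ∀ r w → V r w ≈ V r 0# + g₂ * w
  V≈V₀+g₂w r w = solve 7 (λ g₁ g₂ a e r w h →
    a :* a :* r :- (e :* e) :* (r :* r :* r) :+ g₂ :* w :- h :* g₁ :* r
    := (a :* a :* r :- (e :* e) :* (r :* r :* r) :+ g₂ :* con (+ 0) :- h :* g₁ :* r) :+ g₂ :* w) refl g₁ g₂ a ε r w ½

  c₀ : Carrier
  c₀ = - (½ * γ * (a - δ))

  f[point]≈c₀+U+εV : ∀ {r w} → 𝔽 r → 𝔽 w → f (point r w) ≈ c₀ + (U r w + ε * V r w)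
  f[point]≈c₀+U+εV {r} {w} 𝔽r 𝔽w = begin
    f (point r w)                                                  ≈⟨ +-congʳ (^-congˡ (q ℕ.+ 2) (σ[point]-point+δ≈εr+a 𝔽r 𝔽w)) ⟩
    (ε * r + a) ^ (q ℕ.+ 2) + γ * point r w                        ≈⟨ +-congʳ (^-homo-* _ q 2) ⟩
    σ (ε * r + a) * ((ε * r + a) * ((ε * r + a) * 1#)) + γ * point r w ≈⟨ +-cong (*-cong σy (*-congˡ (*-identityʳ _))) (*-congʳ γ≈g₁+εg₂) ⟩
    (- (ε * r) + a) * ((ε * r + a) * (ε * r + a)) + (g₁ + ε * g₂) * point r w
      ≈⟨ solve 8 (λ e r a g₁ g₂ w h d →
           (:- (e :* r) :+ a) :* ((e :* r :+ a) :* (e :* r :+ a)) :+ (g₁ :+ e :* g₂) :* (w :- h :* (e :* r :+ a :- d))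
           := :- (h :* (g₁ :+ e :* g₂) :* (a :- d)) :+
              ((a :* a :* a :- a :* (e :* e) :* (r :* r) :+ g₁ :* w :- h :* g₂ :* (e :* e) :* r)
               :+ e :* (a :* a :* r :- (e :* e) :* (r :* r :* r) :+ g₂ :* w :- h :* g₁ :* r))) refl ε r a g₁ g₂ w ½ δ ⟩
    - (½ * (g₁ + ε * g₂) * (a - δ)) + (U r w + ε * V r w)          ≈⟨ +-congʳ (-‿cong (*-congʳ (*-congˡ (sym γ≈g₁+εg₂)))) ⟩
    c₀ + (U r w + ε * V r w)                                       ∎
    where
    σy : σ (ε * r + a) ≈ - (ε * r) + a
    σy = trans (σ-cong (+-comm _ _)) (trans (σ[a+εb]≈a-εb 𝔽-a 𝔽r) (+-comm _ _))

  re[x^q-x+δ]≈a : ∀ x → re (σ x - x + δ) ≈ a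
  re[x^q-x+δ]≈a x = *-congˡ (begin
    (σ x - x + δ) + σ (σ x - x + δ)            ≈⟨ +-congˡ (trans (σ-homo-+ _ δ) (+-congʳ (trans (σ-homo-sub (σ x) x) (+-congʳ (σ-involutive x))))) ⟩
    (σ x - x + δ) + (x - σ x + σ δ)            ≈⟨ solve 4 (λ x s d t → (s :- x :+ d) :+ (x :- s :+ t) := d :+ t) refl x (σ x) δ (σ δ) ⟩
    Tr q δ                                     ∎)

  point-re-im : ∀ x → point (im (σ x - x + δ)) (re x) ≈ x
  point-re-im x = begin
    re x - ½ * (ε * im y + a - δ)              ≈⟨ +-congˡ (-‿cong (*-congˡ (+-congʳ (+-congʳ εim[y]≈y-a)))) ⟩
    re x - ½ * ((y - a) + a - δ)
      ≈⟨ ≈-by-½+½≈1 x (solve 5 (λ h x s d a → h :* (x :+ s) :- h :* (((s :- x :+ d) :- a) :+ a :- d) := x :+ (h :+ h :- con (+ 1)) :* x) refl ½ x (σ x) δ a) ⟩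
    x                                          ∎
    where
    y = σ x - x + δ
    εim[y]≈y-a : ε * im y ≈ y - a
    εim[y]≈y-a = begin
      ε * im y                   ≈⟨ solve 2 (λ u v → v := (u :+ v) :- u) refl (re y) (ε * im y) ⟩
      (re y + ε * im y) - re y   ≈⟨ +-cong (re+ε*im≈x y) (-‿cong (re[x^q-x+δ]≈a x)) ⟩
      y - a                      ∎

  Nγ c₃ c₂ c₁ : Carrier
  Nγ = g₁ * g₁ - g₂ * g₂ * ε²
  c₃ = g₁ * ε²
  c₂ = - (g₂ * a * ε²)
  c₁ = ½ * Nγ - g₁ * (a * a)

  -- g₂ U - g₁ V does not depend on w; it is a cubic in r whose divided difference is Q c₃ c₂ c₁.
  H : Carrier → Carrier
  H r = g₂ * U r 0# - g₁ * V r 0#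

  g₂U-g₁V≈H : ∀ r w → g₂ * U r w - g₁ * V r w ≈ H r
  g₂U-g₁V≈H r w = solve 7 (λ g₁ g₂ a e r w h →
    g₂ :* (a :* a :* a :- a :* (e :* e) :* (r :* r) :+ g₁ :* w :- h :* g₂ :* (e :* e) :* r)
    :- g₁ :* (a :* a :* r :- (e :* e) :* (r :* r :* r) :+ g₂ :* w :- h :* g₁ :* r)
    := g₂ :* (a :* a :* a :- a :* (e :* e) :* (r :* r) :+ g₁ :* con (+ 0) :- h :* g₂ :* (e :* e) :* r)
    :- g₁ :* (a :* a :* r :- (e :* e) :* (r :* r :* r) :+ g₂ :* con (+ 0) :- h :* g₁ :* r)) refl g₁ g₂ a ε r w ½

  H-difference : ∀ r s → H r - H s ≈ (r - s) * Q c₃ c₂ c₁ r s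
  H-difference r s = solve 7 (λ g₁ g₂ a e r s h →
    (g₂ :* (a :* a :* a :- a :* (e :* e) :* (r :* r) :+ g₁ :* con (+ 0) :- h :* g₂ :* (e :* e) :* r)
    :- g₁ :* (a :* a :* r :- (e :* e) :* (r :* r :* r) :+ g₂ :* con (+ 0) :- h :* g₁ :* r))
    :- (g₂ :* (a :* a :* a :- a :* (e :* e) :* (s :* s) :+ g₁ :* con (+ 0) :- h :* g₂ :* (e :* e) :* s)
    :- g₁ :* (a :* a :* s :- (e :* e) :* (s :* s :* s) :+ g₂ :* con (+ 0) :- h :* g₁ :* s))
    := (r :- s) :* ((g₁ :* (e :* e)) :* (r :* r :+ r :* s :+ s :* s) :+ (:- (g₂ :* a :* (e :* e))) :* (r :+ s)
        :+ (h :* (g₁ :* g₁ :- g₂ :* g₂ :* (e :* e)) :- g₁ :* (a :* a)))) refl g₁ g₂ a ε r s ½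

  g₁≈0⇒g₂≉0 : g₁ ≈ 0# → ¬ g₂ ≈ 0#
  g₁≈0⇒g₂≉0 g₁≈0 g₂≈0 = γ≉0 (trans γ≈g₁+εg₂ (trans (+-cong g₁≈0 (trans (*-congˡ g₂≈0) (zeroʳ ε))) (+-identityˡ 0#)))

  point-injective : ∀ {r w r′ w′} → 𝔽 r → 𝔽 w → 𝔽 r′ → 𝔽 w′ → point r w ≈ point r′ w′ → r ≈ r′
  point-injective {r} {w} {r′} {w′} 𝔽r 𝔽w 𝔽r′ 𝔽w′ eq = *-cancelˡ ε≉0 (begin
    ε * r                                   ≈⟨ solve 2 (λ x a → x := (x :+ a) :- a) refl (ε * r) a ⟩
    (ε * r + a) - a                         ≈⟨ +-congʳ (σ[point]-point+δ≈εr+a 𝔽r 𝔽w) ⟨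
    (σ (point r w) - point r w + δ) - a     ≈⟨ +-congʳ (+-congʳ (+-cong (σ-cong eq) (-‿cong eq))) ⟩
    (σ (point r′ w′) - point r′ w′ + δ) - a ≈⟨ +-congʳ (σ[point]-point+δ≈εr+a 𝔽r′ 𝔽w′) ⟩
    (ε * r′ + a) - a                        ≈⟨ solve 2 (λ x a → (x :+ a) :- a := x) refl (ε * r′) a ⟩
    ε * r′                                  ∎)

  g₂ΔU-g₁ΔV≈ΔH : ∀ r s w → g₂ * (U r 0# - U s w) - g₁ * (V r 0# - V s w) ≈ H r - H s
  g₂ΔU-g₁ΔV≈ΔH r s w = begin
    g₂ * (U r 0# - U s w) - g₁ * (V r 0# - V s w)
      ≈⟨ solve 6 (λ g₁ g₂ u u′ v v′ → g₂ :* (u :- u′) :- g₁ :* (v :- v′) := (g₂ :* u :- g₁ :* v) :- (g₂ :* u′ :- g₁ :* v′))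
                                                                           refl g₁ g₂ (U r 0#) (U s w) (V r 0#) (V s w) ⟩
    (g₂ * U r 0# - g₁ * V r 0#) - (g₂ * U s w - g₁ * V s w)            ≈⟨ +-congˡ (-‿cong (g₂U-g₁V≈H s w)) ⟩
    H r - H s                                                         ∎

  -- When H r ≈ H s, one of U, V can be matched by choosing w, and then the other matches too.
  matching-w : ∀ {r s} → 𝔽 r → 𝔽 s → H r ≈ H s → ∃ λ w → 𝔽 w × U r 0# ≈ U s w × V r 0# ≈ V s w
  matching-w {r} {s} 𝔽r 𝔽s Hr≈Hs with g₂ ≟ 0#
  ... | no g₂≉0 = w , 𝔽-* (𝔽-sub (𝔽-V 𝔽r 𝔽-0) (𝔽-V 𝔽s 𝔽-0)) (𝔽-⁻¹ (𝔽-im γ) g₂≉0) , U≈ , V≈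
    where
    w = (V r 0# - V s 0#) * g₂ ⁻¹
    V≈ : V r 0# ≈ V s w
    V≈ = sym (trans (V≈V₀+g₂w s w) (trans (+-congˡ (x*[y*x⁻¹]≈y g₂≉0 _)) (solve 2 (λ x y → y :+ (x :- y) := x) refl (V r 0#) (V s 0#))))
    U≈ : U r 0# ≈ U s w
    U≈ = x-y≈0⇒x≈y (x*y≈0⇒y≈0 g₂≉0 (begin
      g₂ * (U r 0# - U s w)                                 ≈⟨ solve 3 (λ x y z → x := (x :- y :* z) :+ y :* z) refl (g₂ * (U r 0# - U s w)) g₁ (V r 0# - V s w) ⟩
      g₂ * (U r 0# - U s w) - g₁ * (V r 0# - V s w) + g₁ * (V r 0# - V s w) ≈⟨ +-cong (g₂ΔU-g₁ΔV≈ΔH r s w) (*-congˡ (x≈y⇒x-y≈0 V≈)) ⟩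
      (H r - H s) + g₁ * 0#                                 ≈⟨ +-cong (x≈y⇒x-y≈0 Hr≈Hs) (zeroʳ g₁) ⟩
      0# + 0#                                               ≈⟨ +-identityʳ 0# ⟩
      0#                                                    ∎))
  ... | yes g₂≈0 = w , 𝔽-* (𝔽-sub (𝔽-U 𝔽r 𝔽-0) (𝔽-U 𝔽s 𝔽-0)) (𝔽-⁻¹ (𝔽-re γ) g₁≉0) , U≈ , V≈
    where
    g₁≉0 : ¬ g₁ ≈ 0#
    g₁≉0 g₁≈0 = g₁≈0⇒g₂≉0 g₁≈0 g₂≈0
    w = (U r 0# - U s 0#) * g₁ ⁻¹
    U≈ : U r 0# ≈ U s w
    U≈ = sym (trans (U≈U₀+g₁w s w) (trans (+-congˡ (x*[y*x⁻¹]≈y g₁≉0 _)) (solve 2 (λ x y → y :+ (x :- y) := x) refl (U r 0#) (U s 0#))))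
    V≈ : V r 0# ≈ V s w
    V≈ = x-y≈0⇒x≈y (x*y≈0⇒y≈0 g₁≉0 (-‿injective (begin
      - (g₁ * (V r 0# - V s w))                             ≈⟨ solve 3 (λ x y z → :- z := (y :* x :- z) :- y :* x) refl (U r 0# - U s w) g₂ (g₁ * (V r 0# - V s w)) ⟩
      g₂ * (U r 0# - U s w) - g₁ * (V r 0# - V s w) - g₂ * (U r 0# - U s w) ≈⟨ +-cong (g₂ΔU-g₁ΔV≈ΔH r s w) (-‿cong (trans (*-congʳ g₂≈0) (zeroˡ _))) ⟩
      (H r - H s) - 0#                                      ≈⟨ +-cong (x≈y⇒x-y≈0 Hr≈Hs) -0#≈0# ⟩
      0# + 0#                                               ≈⟨ +-identityʳ 0# ⟩
      0#                                                    ≈⟨ -0#≈0# ⟨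
      - 0#                                                  ∎)))

  injective⇒offDiagonalNonzero : Injective _≈_ _≈_ f → OffDiagonalNonzero c₃ c₂ c₁
  injective⇒offDiagonalNonzero f-injective {r} {s} 𝔽r 𝔽s Q≈0 = point-injective 𝔽r 𝔽-0 𝔽s 𝔽w′ (f-injective (begin
      f (point r 0#)                     ≈⟨ f[point]≈c₀+U+εV 𝔽r 𝔽-0 ⟩
      c₀ + (U r 0# + ε * V r 0#)         ≈⟨ +-congˡ (+-cong Ur≈Usw′ (*-congˡ Vr≈Vsw′)) ⟩
      c₀ + (U s w′ + ε * V s w′)         ≈⟨ f[point]≈c₀+U+εV 𝔽s 𝔽w′ ⟨
      f (point s w′)                     ∎))
    where
    Hr≈Hs : H r ≈ H s
    Hr≈Hs = x-y≈0⇒x≈y (trans (H-difference r s) (trans (*-congˡ Q≈0) (zeroʳ _)))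
    matched = matching-w 𝔽r 𝔽s Hr≈Hs
    w′ = proj₁ matched
    𝔽w′ = proj₁ (proj₂ matched)
    Ur≈Usw′ = proj₁ (proj₂ (proj₂ matched))
    Vr≈Vsw′ = proj₂ (proj₂ (proj₂ matched))

  w-determined : ∀ {r r′ w w′} → r ≈ r′ → U r w ≈ U r′ w′ → V r w ≈ V r′ w′ → w ≈ w′
  w-determined {r} {r′} {w} {w′} r≈r′ U≈ V≈ with g₁ ≟ 0#
  ... | no g₁≉0 = *-cancelˡ g₁≉0 (+-cancelˡ (U r′ 0#) _ _ (begin
    U r′ 0# + g₁ * w    ≈⟨ +-congʳ (U-cong 0# r≈r′) ⟨
    U r 0# + g₁ * w     ≈⟨ U≈U₀+g₁w r w ⟨
    U r w               ≈⟨ U≈ ⟩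
    U r′ w′             ≈⟨ U≈U₀+g₁w r′ w′ ⟩
    U r′ 0# + g₁ * w′   ∎))
  ... | yes g₁≈0 = *-cancelˡ (g₁≈0⇒g₂≉0 g₁≈0) (+-cancelˡ (V r′ 0#) _ _ (begin
    V r′ 0# + g₂ * w    ≈⟨ +-congʳ (V-cong 0# r≈r′) ⟨
    V r 0# + g₂ * w     ≈⟨ V≈V₀+g₂w r w ⟨
    V r w               ≈⟨ V≈ ⟩
    V r′ w′             ≈⟨ V≈V₀+g₂w r′ w′ ⟩
    V r′ 0# + g₂ * w′   ∎))

  offDiagonalNonzero⇒injective : OffDiagonalNonzero c₃ c₂ c₁ → Injective _≈_ _≈_ f
  offDiagonalNonzero⇒injective nonvanishing {x} {y} fx≈fy = begin
      x                        ≈⟨ point-re-im x ⟨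
      point rx (re x)          ≈⟨ point-cong rx≈ry wx≈wy ⟩
      point ry (re y)          ≈⟨ point-re-im y ⟩
      y                        ∎
    where
    rx = im (σ x - x + δ)
    ry = im (σ y - y + δ)
    𝔽rx = 𝔽-im (σ x - x + δ)
    𝔽ry = 𝔽-im (σ y - y + δ)
    U+εV≈ : U rx (re x) + ε * V rx (re x) ≈ U ry (re y) + ε * V ry (re y)
    U+εV≈ = +-cancelˡ c₀ _ _ (begin
      c₀ + (U rx (re x) + ε * V rx (re x))   ≈⟨ f[point]≈c₀+U+εV 𝔽rx (𝔽-re x) ⟨
      f (point rx (re x))                    ≈⟨ f-cong (point-re-im x) ⟩
      f x                                    ≈⟨ fx≈fy ⟩
      f y                                    ≈⟨ f-cong (point-re-im y) ⟨
      f (point ry (re y))                    ≈⟨ f[point]≈c₀+U+εV 𝔽ry (𝔽-re y) ⟩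
      c₀ + (U ry (re y) + ε * V ry (re y))   ∎)
    U≈ = proj₁ (coordinates-unique (𝔽-U 𝔽rx (𝔽-re x)) (𝔽-V 𝔽rx (𝔽-re x)) (𝔽-U 𝔽ry (𝔽-re y)) (𝔽-V 𝔽ry (𝔽-re y)) U+εV≈)
    V≈ = proj₂ (coordinates-unique (𝔽-U 𝔽rx (𝔽-re x)) (𝔽-V 𝔽rx (𝔽-re x)) (𝔽-U 𝔽ry (𝔽-re y)) (𝔽-V 𝔽ry (𝔽-re y)) U+εV≈)
    rx≈ry : rx ≈ ry
    rx≈ry = [ x-y≈0⇒x≈y , nonvanishing 𝔽rx 𝔽ry ]′ (x*y≈0⇒x≈0⊎y≈0 (begin
      (rx - ry) * Q c₃ c₂ c₁ rx ry    ≈⟨ H-difference rx ry ⟨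
      H rx - H ry                     ≈⟨ +-cong (g₂U-g₁V≈H rx (re x)) (-‿cong (g₂U-g₁V≈H ry (re y))) ⟨
      (g₂ * U rx (re x) - g₁ * V rx (re x)) - (g₂ * U ry (re y) - g₁ * V ry (re y))
                                      ≈⟨ x≈y⇒x-y≈0 (+-cong (*-congˡ U≈) (-‿cong (*-congˡ V≈))) ⟩
      0#                              ∎))
    wx≈wy : re x ≈ re y
    wx≈wy = w-determined rx≈ry U≈ V≈

  permutation⇔offDiagonalNonzero : IsPermutation f ⇔ OffDiagonalNonzero c₃ c₂ c₁
  permutation⇔offDiagonalNonzero = mk⇔ necessary sufficient
    where
    necessary : IsPermutation f → OffDiagonalNonzero c₃ c₂ c₁
    necessary (f-injective , _) = injective⇒offDiagonalNonzero f-injective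
    sufficient : OffDiagonalNonzero c₃ c₂ c₁ → IsPermutation f
    sufficient nonvanishing = f-injective , injective⇒surjective f f-cong f-injective
      where f-injective = offDiagonalNonzero⇒injective nonvanishing

module CaseAnalysis {c ℓ} (q : ℕ) (q-odd-prime-power : OddPrimePower q) (K : Field c ℓ) (size : FieldNotions.HasSize K (q ℕ.* q))
                  (γ δ : Field.Carrier K) (γ≉0 : ¬ Field._≈_ K γ (Field.0# K)) where
  open Field K
  open FieldNotions K
  open Reduction q q-odd-prime-power K size γ δ γ≉0 public
  open IntegerCoefficientSolver commutativeRing
  open import Algebra.Properties.Ring ring using (-0#≈0#; -‿involutive)
  open import Algebra.Properties.Semiring.Exp semiring using (^-homo-*)
  open import Relation.Binary.Reasoning.Setoid setoid
  open Equivalence using (to; from)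

  Conditions : Set (c ⊔ ℓ)
  Conditions =
       (InSubfield q γ × 3 ∣ q
           × IsSquareIn q (Tr q δ * Tr q δ - Tr q γ))
       ⊎ (InSubfield q γ × q % 3 ≡ 2
           × Tr q δ * Tr q δ ≈ Tr q γ)
       ⊎ (¬ InSubfield q γ × Tr q δ ≈ 0# × Tr q γ ≈ 0#)
       ⊎ (¬ InSubfield q γ × Tr q δ ≈ 0# × ¬ (Tr q γ ≈ 0#) × 3 ∣ q
           × IsSquareIn q (- (Nm q γ) * (Tr q γ) ⁻¹))
       ⊎ (¬ InSubfield q γ × ¬ (Tr q δ ≈ 0#) × ¬ (Tr q γ ≈ 0#) × q % 3 ≡ 2
           × (Tr q δ * Tr q γ) * (Tr q δ * Tr q γ)
               ≈ Nm q γ * (Tr q δ * Tr q δ + three * Tr q γ))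

  Tr≈two*re : ∀ x → Tr q x ≈ two * re x
  Tr≈two*re x = begin
    x + σ x                ≈⟨ *-identityˡ _ ⟨
    1# * (x + σ x)         ≈⟨ *-congʳ two*½≈1 ⟨
    (two * ½) * (x + σ x)  ≈⟨ *-assoc two ½ _ ⟩
    two * re x             ∎

  Trδ≈two*a : Tr q δ ≈ two * a
  Trδ≈two*a = trans (Tr≈two*re δ) (*-congˡ refl)

  Trγ≈0⇔g₁≈0 : Tr q γ ≈ 0# ⇔ g₁ ≈ 0#
  Trγ≈0⇔g₁≈0 = mk⇔ (λ Trγ≈0 → x*y≈0⇒y≈0 two≉0 (trans (sym (Tr≈two*re γ)) Trγ≈0))
                   (λ g₁≈0 → trans (Tr≈two*re γ) (trans (*-congˡ g₁≈0) (zeroʳ two)))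

  Trδ≈0⇔a≈0 : Tr q δ ≈ 0# ⇔ a ≈ 0#
  Trδ≈0⇔a≈0 = mk⇔ (λ Trδ≈0 → x*y≈0⇒y≈0 two≉0 (trans (sym Trδ≈two*a) Trδ≈0))
                   (λ a≈0 → trans Trδ≈two*a (trans (*-congˡ a≈0) (zeroʳ two)))

  γ∈𝔽⇔g₂≈0 : InSubfield q γ ⇔ g₂ ≈ 0#
  γ∈𝔽⇔g₂≈0 = mk⇔ γ∈𝔽⇒g₂≈0 g₂≈0⇒γ∈𝔽
    where
    γ∈𝔽⇒g₂≈0 : InSubfield q γ → g₂ ≈ 0#
    γ∈𝔽⇒g₂≈0 σγ≈γ = begin
      ½ * (γ - σ γ) * ε * ε⁻²     ≈⟨ *-congʳ (*-congʳ (*-congˡ (x≈y⇒x-y≈0 (sym σγ≈γ)))) ⟩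
      ½ * 0# * ε * ε⁻²            ≈⟨ solve 3 (λ h e m → h :* con (+ 0) :* e :* m := con (+ 0)) refl ½ ε ε⁻² ⟩
      0#                          ∎
    g₂≈0⇒γ∈𝔽 : g₂ ≈ 0# → InSubfield q γ
    g₂≈0⇒γ∈𝔽 g₂≈0 = 𝔽-resp-≈ (sym (trans γ≈g₁+εg₂ (trans (+-congˡ (trans (*-congˡ g₂≈0) (zeroʳ ε))) (+-identityʳ g₁)))) (𝔽-re γ)

  Nmγ≈Nγ : Nm q γ ≈ Nγ
  Nmγ≈Nγ = begin
    γ ^ (q ℕ.+ 1)                        ≈⟨ ^-homo-* γ q 1 ⟩
    σ γ * (γ * 1#)                       ≈⟨ *-cong (trans (σ-cong γ≈g₁+εg₂) (σ[a+εb]≈a-εb (𝔽-re γ) (𝔽-im γ))) (trans (*-identityʳ γ) γ≈g₁+εg₂) ⟩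
    (g₁ - ε * g₂) * (g₁ + ε * g₂)        ≈⟨ solve 3 (λ g₁ g₂ e → (g₁ :- e :* g₂) :* (g₁ :+ e :* g₂) := g₁ :* g₁ :- g₂ :* g₂ :* (e :* e)) refl g₁ g₂ ε ⟩
    Nγ                                   ∎

  Nγ≉0 : ¬ Nγ ≈ 0#
  Nγ≉0 Nγ≈0 = x^n≉0 (q ℕ.+ 1) γ≉0 (trans Nmγ≈Nγ Nγ≈0)

  𝔽-Nγ : 𝔽 Nγ
  𝔽-Nγ = 𝔽-sub (𝔽-* (𝔽-re γ) (𝔽-re γ)) (𝔽-* (𝔽-* (𝔽-im γ) (𝔽-im γ)) 𝔽-ε²)

  𝔽-c₃ : 𝔽 c₃
  𝔽-c₃ = 𝔽-* (𝔽-re γ) 𝔽-ε²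

  𝔽-c₂ : 𝔽 c₂
  𝔽-c₂ = 𝔽-neg (𝔽-* (𝔽-* (𝔽-im γ) 𝔽-a) 𝔽-ε²)

  𝔽-c₁ : 𝔽 c₁
  𝔽-c₁ = 𝔽-sub (𝔽-* 𝔽-½ 𝔽-Nγ) (𝔽-* (𝔽-re γ) (𝔽-* 𝔽-a 𝔽-a))

  c₃≈0⇔g₁≈0 : c₃ ≈ 0# ⇔ g₁ ≈ 0#
  c₃≈0⇔g₁≈0 = mk⇔ (x*y≈0⇒x≈0 ε²≉0) (λ g₁≈0 → trans (*-congʳ g₁≈0) (zeroˡ ε²))

  c₃≉0 : ¬ g₁ ≈ 0# → ¬ c₃ ≈ 0#
  c₃≉0 g₁≉0 c₃≈0 = g₁≉0 (to c₃≈0⇔g₁≈0 c₃≈0)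

  c₂≈0⇔g₂≈0⊎a≈0 : c₂ ≈ 0# ⇔ (g₂ ≈ 0# ⊎ a ≈ 0#)
  c₂≈0⇔g₂≈0⊎a≈0 = mk⇔ c₂≈0⇒ ⇒c₂≈0
    where
    c₂≈0⇒ : c₂ ≈ 0# → g₂ ≈ 0# ⊎ a ≈ 0#
    c₂≈0⇒ c₂≈0 = x*y≈0⇒x≈0⊎y≈0 (x*y≈0⇒x≈0 ε²≉0 (trans (sym (-‿involutive _)) (trans (-‿cong c₂≈0) -0#≈0#)))
    ⇒c₂≈0 : g₂ ≈ 0# ⊎ a ≈ 0# → c₂ ≈ 0#
    ⇒c₂≈0 (inj₁ g₂≈0) = trans (-‿cong (trans (*-congʳ (trans (*-congʳ g₂≈0) (zeroˡ a))) (zeroˡ ε²))) -0#≈0#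
    ⇒c₂≈0 (inj₂ a≈0) = trans (-‿cong (trans (*-congʳ (trans (*-congˡ a≈0) (zeroʳ g₂))) (zeroˡ ε²))) -0#≈0#


  -- Here c₃ ≈ 0 and c₁ = N(γ) / 2 ≉ 0.
  case-Trγ≈0 : g₁ ≈ 0# → OffDiagonalNonzero c₃ c₂ c₁ ⇔ Conditions
  case-Trγ≈0 g₁≈0 = mk⇔ necessary sufficient
    where
    g₂≉0 = g₁≈0⇒g₂≉0 g₁≈0
    γ∉𝔽 : ¬ InSubfield q γ
    γ∉𝔽 γ∈𝔽 = g₂≉0 (to γ∈𝔽⇔g₂≈0 γ∈𝔽)
    Trγ≈0 = from Trγ≈0⇔g₁≈0 g₁≈0
    criterion = degenerate-criterion (from c₃≈0⇔g₁≈0 g₁≈0) 𝔽-c₂ 𝔽-c₁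
    c₁≉0 : ¬ c₁ ≈ 0#
    c₁≉0 c₁≈0 = x≉0∧y≉0⇒x*y≉0 ½≉0 Nγ≉0 (begin
      ½ * Nγ                  ≈⟨ trans (+-congˡ -0#≈0#) (+-identityʳ _) ⟨
      ½ * Nγ - 0#             ≈⟨ +-congˡ (-‿cong (trans (*-congʳ g₁≈0) (zeroˡ _))) ⟨
      c₁                      ≈⟨ c₁≈0 ⟩
      0#                      ∎)
    necessary : OffDiagonalNonzero c₃ c₂ c₁ → Conditions
    necessary nonvanishing = inj₂ (inj₂ (inj₁ (γ∉𝔽 , from Trδ≈0⇔a≈0 a≈0 , Trγ≈0)))
      where a≈0 = [ (λ g₂≈0 → contradiction g₂≈0 g₂≉0) , (λ a≈0 → a≈0) ]′ (to c₂≈0⇔g₂≈0⊎a≈0 (proj₁ (to criterion nonvanishing)))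
    sufficient : Conditions → OffDiagonalNonzero c₃ c₂ c₁
    sufficient (inj₁ (γ∈𝔽 , _)) = contradiction γ∈𝔽 γ∉𝔽
    sufficient (inj₂ (inj₁ (γ∈𝔽 , _))) = contradiction γ∈𝔽 γ∉𝔽
    sufficient (inj₂ (inj₂ (inj₁ (_ , Trδ≈0 , _)))) = from criterion (from c₂≈0⇔g₂≈0⊎a≈0 (inj₂ (to Trδ≈0⇔a≈0 Trδ≈0)) , c₁≉0)
    sufficient (inj₂ (inj₂ (inj₂ (inj₁ (_ , _ , Trγ≉0 , _))))) = contradiction Trγ≈0 Trγ≉0
    sufficient (inj₂ (inj₂ (inj₂ (inj₂ (_ , _ , Trγ≉0 , _))))) = contradiction Trγ≈0 Trγ≉0

  z₀ : Carrier
  z₀ = a * a - ½ * g₁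

  𝔽-z₀ : 𝔽 z₀
  𝔽-z₀ = 𝔽-sub (𝔽-* 𝔽-a 𝔽-a) (𝔽-* 𝔽-½ (𝔽-re γ))

  Trδ²-Trγ≈4z₀ : Tr q δ * Tr q δ - Tr q γ ≈ two * two * z₀
  Trδ²-Trγ≈4z₀ = begin
    Tr q δ * Tr q δ - Tr q γ                       ≈⟨ +-cong (*-cong Trδ≈two*a Trδ≈two*a) (-‿cong (Tr≈two*re γ)) ⟩
    (two * a) * (two * a) - two * g₁               ≈⟨ +-congˡ (-‿cong (*-congˡ (trans (*-congʳ two*½≈1) (*-identityˡ g₁)))) ⟨
    (two * a) * (two * a) - two * ((two * ½) * g₁) ≈⟨ solve 4 (λ t a h g → (t :* a) :* (t :* a) :- t :* ((t :* h) :* g) := t :* t :* (a :* a :- h :* g)) refl two a ½ g₁ ⟩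
    two * two * z₀                                 ∎

  IsSquareIn-cong : ∀ {x y} → x ≈ y → IsSquareIn q x ⇔ IsSquareIn q y
  IsSquareIn-cong x≈y = mk⇔ (λ (r , 𝔽r , r²≈x) → r , 𝔽r , trans r²≈x x≈y) (λ (r , 𝔽r , r²≈y) → r , 𝔽r , trans r²≈y (sym x≈y))

  ¬NonzeroSquare-cong : ∀ {x y} → x ≈ y → (¬ NonzeroSquare x) ⇔ (¬ NonzeroSquare y)
  ¬NonzeroSquare-cong x≈y = mk⇔ (λ ¬x (d , 𝔽d , d≉0 , d²≈y) → ¬x (d , 𝔽d , d≉0 , trans d²≈y (sym x≈y)))
                                (λ ¬y (d , 𝔽d , d≉0 , d²≈x) → ¬y (d , 𝔽d , d≉0 , trans d²≈x x≈y))

  square[4z]⇔square[z] : ∀ {z} → IsSquareIn q (two * two * z) ⇔ IsSquareIn q z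
  square[4z]⇔square[z] {z} = mk⇔
    (λ (y , 𝔽y , y²≈4z) → ½ * y , 𝔽-* 𝔽-½ 𝔽y , (begin
      (½ * y) * (½ * y)                  ≈⟨ solve 2 (λ h y → (h :* y) :* (h :* y) := (h :* h) :* (y :* y)) refl ½ y ⟩
      (½ * ½) * (y * y)                  ≈⟨ *-congˡ y²≈4z ⟩
      (½ * ½) * (two * two * z)          ≈⟨ solve 3 (λ h t z → (h :* h) :* (t :* t :* z) := (t :* h) :* (t :* h) :* z) refl ½ two z ⟩
      (two * ½) * (two * ½) * z          ≈⟨ *-congʳ (trans (*-cong two*½≈1 two*½≈1) (*-identityˡ 1#)) ⟩
      1# * z                             ≈⟨ *-identityˡ z ⟩
      z                                  ∎))
    (λ (y , 𝔽y , y²≈z) → two * y , 𝔽-* 𝔽-two 𝔽y ,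
      trans (solve 2 (λ t y → (t :* y) :* (t :* y) := t :* t :* (y :* y)) refl two y) (*-congˡ y²≈z))

  g₂≈0⇒Nγ≈g₁² : g₂ ≈ 0# → Nγ ≈ g₁ * g₁
  g₂≈0⇒Nγ≈g₁² g₂≈0 = trans (+-congˡ (-‿cong (trans (*-congʳ (trans (*-congʳ g₂≈0) (zeroˡ g₂))) (zeroˡ ε²)))) (trans (+-congˡ -0#≈0#) (+-identityʳ _))

  c₃⁻¹≈g₁⁻¹ε⁻² : ¬ g₁ ≈ 0# → c₃ ⁻¹ ≈ g₁ ⁻¹ * ε⁻²
  c₃⁻¹≈g₁⁻¹ε⁻² g₁≉0 = ⁻¹-distrib-* g₁≉0 ε²≉0

  case-char3-γ∈𝔽 : ¬ g₁ ≈ 0# → three ≈ 0# → g₂ ≈ 0# → OffDiagonalNonzero c₃ c₂ c₁ ⇔ Conditions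
  case-char3-γ∈𝔽 g₁≉0 three≈0 g₂≈0 = mk⇔ necessary sufficient
    where
    γ∈𝔽 = from γ∈𝔽⇔g₂≈0 g₂≈0
    3∣q = three≈0⇒3∣q three≈0
    criterion = char3-criterion three≈0 (c₃≉0 g₁≉0) 𝔽-c₃ 𝔽-c₂ 𝔽-c₁
    -c₁/c₃≈z₀ε⁻² : - c₁ * c₃ ⁻¹ ≈ z₀ * ε⁻²
    -c₁/c₃≈z₀ε⁻² = begin
      - c₁ * c₃ ⁻¹                                       ≈⟨ *-cong (-‿cong (+-congʳ (*-congˡ (g₂≈0⇒Nγ≈g₁² g₂≈0)))) (c₃⁻¹≈g₁⁻¹ε⁻² g₁≉0) ⟩
      - (½ * (g₁ * g₁) - g₁ * (a * a)) * (g₁ ⁻¹ * ε⁻²)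
        ≈⟨ solve 5 (λ h g a i m → (:- (h :* (g :* g) :- g :* (a :* a))) :* (i :* m) := (a :* a :- h :* g) :* m :* (g :* i)) refl ½ g₁ a (g₁ ⁻¹) ε⁻² ⟩
      z₀ * ε⁻² * (g₁ * g₁ ⁻¹)                            ≈⟨ *-congˡ (⁻¹-inverse g₁ g₁≉0) ⟩
      z₀ * ε⁻² * 1#                                      ≈⟨ *-identityʳ _ ⟩
      z₀ * ε⁻²                                           ∎
    square⇔ : IsSquareIn q (Tr q δ * Tr q δ - Tr q γ) ⇔ (¬ NonzeroSquare (- c₁ * c₃ ⁻¹))
    square⇔ = ⇔.trans (IsSquareIn-cong Trδ²-Trγ≈4z₀) (⇔.trans square[4z]⇔square[z]
                (⇔.trans (square⇔¬nonzeroSquare[z*ε⁻²] 𝔽-z₀) (¬NonzeroSquare-cong (sym -c₁/c₃≈z₀ε⁻²))))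
    necessary : OffDiagonalNonzero c₃ c₂ c₁ → Conditions
    necessary nonvanishing = inj₁ (γ∈𝔽 , 3∣q , from square⇔ (proj₂ (to criterion nonvanishing)))
    sufficient : Conditions → OffDiagonalNonzero c₃ c₂ c₁
    sufficient (inj₁ (_ , _ , square)) = from criterion (from c₂≈0⇔g₂≈0⊎a≈0 (inj₁ g₂≈0) , to square⇔ square)
    sufficient (inj₂ (inj₁ (_ , q%3≡2 , _))) = contradiction 3∣q (q%3≡2⇒3∤q q%3≡2)
    sufficient (inj₂ (inj₂ (inj₁ (γ∉𝔽 , _)))) = contradiction γ∈𝔽 γ∉𝔽
    sufficient (inj₂ (inj₂ (inj₂ (inj₁ (γ∉𝔽 , _))))) = contradiction γ∈𝔽 γ∉𝔽
    sufficient (inj₂ (inj₂ (inj₂ (inj₂ (γ∉𝔽 , _))))) = contradiction γ∈𝔽 γ∉𝔽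

  γ∉𝔽 : ¬ g₂ ≈ 0# → ¬ InSubfield q γ
  γ∉𝔽 g₂≉0 γ∈𝔽 = g₂≉0 (to γ∈𝔽⇔g₂≈0 γ∈𝔽)

  Trγ≉0 : ¬ g₁ ≈ 0# → ¬ Tr q γ ≈ 0#
  Trγ≉0 g₁≉0 Trγ≈0 = g₁≉0 (to Trγ≈0⇔g₁≈0 Trγ≈0)

  case-char3-γ∉𝔽 : ¬ g₁ ≈ 0# → three ≈ 0# → ¬ g₂ ≈ 0# → OffDiagonalNonzero c₃ c₂ c₁ ⇔ Conditions
  case-char3-γ∉𝔽 g₁≉0 three≈0 g₂≉0 = mk⇔ necessary sufficient
    where
    3∣q = three≈0⇒3∣q three≈0
    criterion = char3-criterion three≈0 (c₃≉0 g₁≉0) 𝔽-c₃ 𝔽-c₂ 𝔽-c₁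
    z′ : Carrier
    z′ = - (½ * Nγ) * g₁ ⁻¹
    𝔽-z′ : 𝔽 z′
    𝔽-z′ = 𝔽-* (𝔽-neg (𝔽-* 𝔽-½ 𝔽-Nγ)) (𝔽-⁻¹ (𝔽-re γ) g₁≉0)
    -Nmγ/Trγ≈z′ : - (Nm q γ) * (Tr q γ) ⁻¹ ≈ z′
    -Nmγ/Trγ≈z′ = begin
      - (Nm q γ) * (Tr q γ) ⁻¹     ≈⟨ *-cong (-‿cong Nmγ≈Nγ) (trans (⁻¹-cong (Trγ≉0 g₁≉0) (Tr≈two*re γ)) (⁻¹-distrib-* two≉0 g₁≉0)) ⟩
      - Nγ * (½ * g₁ ⁻¹)           ≈⟨ solve 3 (λ N h i → :- N :* (h :* i) := :- (h :* N) :* i) refl Nγ ½ (g₁ ⁻¹) ⟩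
      z′                           ∎
    -c₁/c₃≈z′ε⁻² : a ≈ 0# → - c₁ * c₃ ⁻¹ ≈ z′ * ε⁻²
    -c₁/c₃≈z′ε⁻² a≈0 = begin
      - c₁ * c₃ ⁻¹                            ≈⟨ *-cong (-‿cong (+-congˡ (-‿cong (*-congˡ (trans (*-congʳ a≈0) (zeroˡ a)))))) (c₃⁻¹≈g₁⁻¹ε⁻² g₁≉0) ⟩
      - (½ * Nγ - g₁ * 0#) * (g₁ ⁻¹ * ε⁻²)    ≈⟨ solve 5 (λ h N g i m → (:- (h :* N :- g :* con (+ 0))) :* (i :* m) := (:- (h :* N) :* i) :* m) refl ½ Nγ g₁ (g₁ ⁻¹) ε⁻² ⟩
      z′ * ε⁻²                                ∎
    square⇔ : a ≈ 0# → IsSquareIn q (- (Nm q γ) * (Tr q γ) ⁻¹) ⇔ (¬ NonzeroSquare (- c₁ * c₃ ⁻¹))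
    square⇔ a≈0 = ⇔.trans (IsSquareIn-cong -Nmγ/Trγ≈z′) (⇔.trans (square⇔¬nonzeroSquare[z*ε⁻²] 𝔽-z′) (¬NonzeroSquare-cong (sym (-c₁/c₃≈z′ε⁻² a≈0))))
    c₂≈0⇒a≈0 : c₂ ≈ 0# → a ≈ 0#
    c₂≈0⇒a≈0 c₂≈0 = [ (λ g₂≈0 → contradiction g₂≈0 g₂≉0) , (λ a≈0 → a≈0) ]′ (to c₂≈0⇔g₂≈0⊎a≈0 c₂≈0)
    necessary : OffDiagonalNonzero c₃ c₂ c₁ → Conditions
    necessary nonvanishing = inj₂ (inj₂ (inj₂ (inj₁ (γ∉𝔽 g₂≉0 , from Trδ≈0⇔a≈0 a≈0 , Trγ≉0 g₁≉0 , 3∣q , from (square⇔ a≈0) ¬nonzeroSquare))))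
      where
      c₂≈0 = proj₁ (to criterion nonvanishing)
      ¬nonzeroSquare = proj₂ (to criterion nonvanishing)
      a≈0 = c₂≈0⇒a≈0 c₂≈0
    sufficient : Conditions → OffDiagonalNonzero c₃ c₂ c₁
    sufficient (inj₁ (γ∈𝔽 , _)) = contradiction γ∈𝔽 (γ∉𝔽 g₂≉0)
    sufficient (inj₂ (inj₁ (γ∈𝔽 , _))) = contradiction γ∈𝔽 (γ∉𝔽 g₂≉0)
    sufficient (inj₂ (inj₂ (inj₁ (_ , _ , Trγ≈0)))) = contradiction Trγ≈0 (Trγ≉0 g₁≉0)
    sufficient (inj₂ (inj₂ (inj₂ (inj₁ (_ , Trδ≈0 , _ , _ , square))))) =
      from criterion (from c₂≈0⇔g₂≈0⊎a≈0 (inj₂ a≈0) , to (square⇔ a≈0) square)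
      where a≈0 = to Trδ≈0⇔a≈0 Trδ≈0
    sufficient (inj₂ (inj₂ (inj₂ (inj₂ (_ , _ , _ , q%3≡2 , _))))) = contradiction 3∣q (q%3≡2⇒3∤q q%3≡2)

  case-char≠3-γ∈𝔽 : ¬ g₁ ≈ 0# → ¬ three ≈ 0# → g₂ ≈ 0# → OffDiagonalNonzero c₃ c₂ c₁ ⇔ Conditions
  case-char≠3-γ∈𝔽 g₁≉0 three≉0 g₂≈0 = mk⇔ necessary sufficient
    where
    γ∈𝔽 = from γ∈𝔽⇔g₂≈0 g₂≈0
    criterion = char≠3-criterion three≉0 (c₃≉0 g₁≉0) 𝔽-c₃ 𝔽-c₂ 𝔽-c₁
    c₂²≈0 : c₂ * c₂ ≈ 0#
    c₂²≈0 = trans (*-congˡ (from c₂≈0⇔g₂≈0⊎a≈0 (inj₁ g₂≈0))) (zeroʳ c₂)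
    three*g₁*ε²*g₁≉0 : ¬ three * g₁ * ε² * g₁ ≈ 0#
    three*g₁*ε²*g₁≉0 = x≉0∧y≉0⇒x*y≉0 (x≉0∧y≉0⇒x*y≉0 (x≉0∧y≉0⇒x*y≉0 three≉0 g₁≉0) ε²≉0) g₁≉0
    three*c₃*c₁≈ : three * c₃ * c₁ ≈ - (three * g₁ * ε² * g₁ * z₀)
    three*c₃*c₁≈ = begin
      three * c₃ * c₁                                       ≈⟨ *-congˡ (+-congʳ (*-congˡ (g₂≈0⇒Nγ≈g₁² g₂≈0))) ⟩
      three * c₃ * (½ * (g₁ * g₁) - g₁ * (a * a))
        ≈⟨ solve 5 (λ t g e h a → t :* (g :* (e :* e)) :* (h :* (g :* g) :- g :* (a :* a)) := :- (t :* g :* (e :* e) :* g :* (a :* a :- h :* g))) refl three g₁ ε ½ a ⟩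
      - (three * g₁ * ε² * g₁ * z₀)                         ∎
    z₀≈0⇔Trδ²≈Trγ : z₀ ≈ 0# ⇔ (Tr q δ * Tr q δ ≈ Tr q γ)
    z₀≈0⇔Trδ²≈Trγ = mk⇔
      (λ z₀≈0 → x-y≈0⇒x≈y (trans Trδ²-Trγ≈4z₀ (trans (*-congˡ z₀≈0) (zeroʳ _))))
      (λ Trδ²≈Trγ → x*y≈0⇒y≈0 two≉0 (x*y≈0⇒y≈0 two≉0 (trans (sym (*-assoc two two z₀)) (trans (sym Trδ²-Trγ≈4z₀) (x≈y⇒x-y≈0 Trδ²≈Trγ)))))
    z₀≈0⇔three*c₃*c₁≈c₂² : z₀ ≈ 0# ⇔ (three * c₃ * c₁ ≈ c₂ * c₂)
    z₀≈0⇔three*c₃*c₁≈c₂² = mk⇔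
      (λ z₀≈0 → trans three*c₃*c₁≈ (trans (-‿cong (trans (*-congˡ z₀≈0) (zeroʳ _))) (trans -0#≈0# (sym c₂²≈0))))
      (λ eq → x*y≈0⇒y≈0 three*g₁*ε²*g₁≉0 (trans (sym (-‿involutive _)) (trans (-‿cong (trans (sym three*c₃*c₁≈) (trans eq c₂²≈0))) -0#≈0#)))
    necessary : OffDiagonalNonzero c₃ c₂ c₁ → Conditions
    necessary nonvanishing = inj₂ (inj₁ (γ∈𝔽 , proj₁ (to criterion nonvanishing) , to z₀≈0⇔Trδ²≈Trγ (from z₀≈0⇔three*c₃*c₁≈c₂² (proj₂ (to criterion nonvanishing)))))
    sufficient : Conditions → OffDiagonalNonzero c₃ c₂ c₁
    sufficient (inj₁ (_ , 3∣q , _)) = contradiction (3∣q⇒three≈0 3∣q) three≉0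
    sufficient (inj₂ (inj₁ (_ , q%3≡2 , Trδ²≈Trγ))) = from criterion (q%3≡2 , to z₀≈0⇔three*c₃*c₁≈c₂² (from z₀≈0⇔Trδ²≈Trγ Trδ²≈Trγ))
    sufficient (inj₂ (inj₂ (inj₁ (γ∉𝔽 , _)))) = contradiction γ∈𝔽 γ∉𝔽
    sufficient (inj₂ (inj₂ (inj₂ (inj₁ (γ∉𝔽 , _))))) = contradiction γ∈𝔽 γ∉𝔽
    sufficient (inj₂ (inj₂ (inj₂ (inj₂ (γ∉𝔽 , _))))) = contradiction γ∈𝔽 γ∉𝔽

  D : Carrier
  D = three * g₁ * (½ * Nγ) - three * g₁ * g₁ * (a * a) - g₂ * g₂ * (a * a) * ε²

  three*c₃*c₁-c₂²≈ε²D : three * c₃ * c₁ - c₂ * c₂ ≈ ε² * D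
  three*c₃*c₁-c₂²≈ε²D = solve 7 (λ t g₁ g₂ e h N a →
    t :* (g₁ :* (e :* e)) :* (h :* N :- g₁ :* (a :* a)) :- (:- (g₂ :* a :* (e :* e))) :* (:- (g₂ :* a :* (e :* e)))
    := (e :* e) :* (t :* g₁ :* (h :* N) :- t :* g₁ :* g₁ :* (a :* a) :- g₂ :* g₂ :* (a :* a) :* (e :* e))) refl three g₁ g₂ ε ½ Nγ a

  Δ≈-4D : (Tr q δ * Tr q γ) * (Tr q δ * Tr q γ) - Nm q γ * (Tr q δ * Tr q δ + three * Tr q γ) ≈ - (two * two * D)
  Δ≈-4D = begin
    (Tr q δ * Tr q γ) * (Tr q δ * Tr q γ) - Nm q γ * (Tr q δ * Tr q δ + three * Tr q γ)
       ≈⟨ +-cong (*-cong (*-cong Trδ≈two*a (Tr≈two*re γ)) (*-cong Trδ≈two*a (Tr≈two*re γ)))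
                 (-‿cong (*-cong Nmγ≈Nγ (+-cong (*-cong Trδ≈two*a Trδ≈two*a) (*-congˡ (Tr≈two*re γ))))) ⟩
    ((two * a) * (two * g₁)) * ((two * a) * (two * g₁)) - Nγ * ((two * a) * (two * a) + three * (two * g₁))
       ≈⟨ ≈-by-½+½≈1 (three * two * (g₁ * Nγ)) (solve 5 (λ g₁ g₂ e a h →
            ((tw :* a) :* (tw :* g₁)) :* ((tw :* a) :* (tw :* g₁)) :- N g₁ g₂ e :* ((tw :* a) :* (tw :* a) :+ th :* (tw :* g₁))
            := :- (tw :* tw :* (th :* g₁ :* (h :* N g₁ g₂ e) :- th :* g₁ :* g₁ :* (a :* a) :- g₂ :* g₂ :* (a :* a) :* (e :* e)))
               :+ (h :+ h :- con (+ 1)) :* (th :* tw :* (g₁ :* N g₁ g₂ e))) refl g₁ g₂ ε a ½) ⟩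
    - (two * two * D)  ∎
    where
    tw th : ∀ {n} → Polynomial n
    tw = con (+ 1) :+ con (+ 1)
    th = con (+ 1) :+ con (+ 1) :+ con (+ 1)
    N : ∀ {n} → Polynomial n → Polynomial n → Polynomial n → Polynomial n
    N g₁ g₂ e = g₁ :* g₁ :- g₂ :* g₂ :* (e :* e)

  D≈0⇔three*c₃*c₁≈c₂² : D ≈ 0# ⇔ (three * c₃ * c₁ ≈ c₂ * c₂)
  D≈0⇔three*c₃*c₁≈c₂² = mk⇔
    (λ D≈0 → x-y≈0⇒x≈y (trans three*c₃*c₁-c₂²≈ε²D (trans (*-congˡ D≈0) (zeroʳ ε²))))
    (λ eq → x*y≈0⇒y≈0 ε²≉0 (trans (sym three*c₃*c₁-c₂²≈ε²D) (x≈y⇒x-y≈0 eq)))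

  D≈0⇔Δ≈0 : D ≈ 0# ⇔ ((Tr q δ * Tr q γ) * (Tr q δ * Tr q γ) ≈ Nm q γ * (Tr q δ * Tr q δ + three * Tr q γ))
  D≈0⇔Δ≈0 = mk⇔
    (λ D≈0 → x-y≈0⇒x≈y (trans Δ≈-4D (trans (-‿cong (trans (*-congˡ D≈0) (zeroʳ _))) -0#≈0#)))
    (λ eq → x*y≈0⇒y≈0 two≉0 (x*y≈0⇒y≈0 two≉0 (trans (sym (*-assoc two two D))
              (trans (sym (-‿involutive _)) (trans (-‿cong (trans (sym Δ≈-4D) (x≈y⇒x-y≈0 eq))) -0#≈0#)))))

  D≈0⇒Trδ≉0 : ¬ three ≈ 0# → ¬ g₁ ≈ 0# → D ≈ 0# → ¬ Tr q δ ≈ 0#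
  D≈0⇒Trδ≉0 three≉0 g₁≉0 D≈0 Trδ≈0 = x≉0∧y≉0⇒x*y≉0 (x≉0∧y≉0⇒x*y≉0 three≉0 g₁≉0) (x≉0∧y≉0⇒x*y≉0 ½≉0 Nγ≉0) (begin
    three * g₁ * (½ * Nγ)
      ≈⟨ solve 4 (λ T x y n → T := T :- x :* con (+ 0) :- y :* con (+ 0) :* n) refl (three * g₁ * (½ * Nγ)) (three * g₁ * g₁) (g₂ * g₂) ε² ⟩
    three * g₁ * (½ * Nγ) - three * g₁ * g₁ * 0# - g₂ * g₂ * 0# * ε²
                                                   ≈⟨ +-cong (+-congˡ (-‿cong (*-congˡ a²≈0))) (-‿cong (*-congʳ (*-congˡ a²≈0))) ⟨
    D                                              ≈⟨ D≈0 ⟩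
    0#                                             ∎)
    where
    a²≈0 : a * a ≈ 0#
    a²≈0 = trans (*-congʳ (to Trδ≈0⇔a≈0 Trδ≈0)) (zeroˡ a)

  case-char≠3-γ∉𝔽 : ¬ g₁ ≈ 0# → ¬ three ≈ 0# → ¬ g₂ ≈ 0# → OffDiagonalNonzero c₃ c₂ c₁ ⇔ Conditions
  case-char≠3-γ∉𝔽 g₁≉0 three≉0 g₂≉0 = mk⇔ necessary sufficient
    where
    criterion = char≠3-criterion three≉0 (c₃≉0 g₁≉0) 𝔽-c₃ 𝔽-c₂ 𝔽-c₁
    necessary : OffDiagonalNonzero c₃ c₂ c₁ → Conditions
    necessary nonvanishing = inj₂ (inj₂ (inj₂ (inj₂ (γ∉𝔽 g₂≉0 , D≈0⇒Trδ≉0 three≉0 g₁≉0 D≈0 , Trγ≉0 g₁≉0 , proj₁ (to criterion nonvanishing) , to D≈0⇔Δ≈0 D≈0))))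
      where D≈0 = from D≈0⇔three*c₃*c₁≈c₂² (proj₂ (to criterion nonvanishing))
    sufficient : Conditions → OffDiagonalNonzero c₃ c₂ c₁
    sufficient (inj₁ (γ∈𝔽 , _)) = contradiction γ∈𝔽 (γ∉𝔽 g₂≉0)
    sufficient (inj₂ (inj₁ (γ∈𝔽 , _))) = contradiction γ∈𝔽 (γ∉𝔽 g₂≉0)
    sufficient (inj₂ (inj₂ (inj₁ (_ , _ , Trγ≈0)))) = contradiction Trγ≈0 (Trγ≉0 g₁≉0)
    sufficient (inj₂ (inj₂ (inj₂ (inj₁ (_ , _ , _ , 3∣q , _))))) = contradiction (3∣q⇒three≈0 3∣q) three≉0
    sufficient (inj₂ (inj₂ (inj₂ (inj₂ (_ , _ , _ , q%3≡2 , eq))))) = from criterion (q%3≡2 , to D≈0⇔three*c₃*c₁≈c₂² (from D≈0⇔Δ≈0 eq))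

  offDiagonalNonzero⇔conditions : OffDiagonalNonzero c₃ c₂ c₁ ⇔ Conditions
  offDiagonalNonzero⇔conditions with g₁ ≟ 0# | three ≟ 0# | g₂ ≟ 0#
  ... | yes g₁≈0 | _ | _ = case-Trγ≈0 g₁≈0
  ... | no g₁≉0 | yes three≈0 | yes g₂≈0 = case-char3-γ∈𝔽 g₁≉0 three≈0 g₂≈0
  ... | no g₁≉0 | yes three≈0 | no g₂≉0 = case-char3-γ∉𝔽 g₁≉0 three≈0 g₂≉0
  ... | no g₁≉0 | no three≉0 | yes g₂≈0 = case-char≠3-γ∈𝔽 g₁≉0 three≉0 g₂≈0
  ... | no g₁≉0 | no three≉0 | no g₂≉0 = case-char≠3-γ∉𝔽 g₁≉0 three≉0 g₂≉0

theorem3p1 : ∀ {c ℓ : Level} (q : ℕ) → OddPrimePower q →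
    (K : Field c ℓ) → FieldNotions.HasSize K (q ℕ.* q) →
    let open Field K
        open FieldNotions K
    in (γ δ : Carrier) → ¬ (γ ≈ 0#) →
       IsPermutation (λ x → (x ^ q - x + δ) ^ (q ℕ.+ 2) + γ * x)
       ⇔
       ((InSubfield q γ × 3 ∣ q
           × IsSquareIn q (Tr q δ * Tr q δ - Tr q γ))
       ⊎ (InSubfield q γ × q % 3 ≡ 2
           × Tr q δ * Tr q δ ≈ Tr q γ)
       ⊎ (¬ InSubfield q γ × Tr q δ ≈ 0# × Tr q γ ≈ 0#)
       ⊎ (¬ InSubfield q γ × Tr q δ ≈ 0# × ¬ (Tr q γ ≈ 0#) × 3 ∣ q
           × IsSquareIn q (- (Nm q γ) * (Tr q γ) ⁻¹))
       ⊎ (¬ InSubfield q γ × ¬ (Tr q δ ≈ 0#) × ¬ (Tr q γ ≈ 0#) × q % 3 ≡ 2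
           × (Tr q δ * Tr q γ) * (Tr q δ * Tr q γ)
               ≈ Nm q γ * (Tr q δ * Tr q δ + three * Tr q γ)))
theorem3p1 q q-odd-prime-power K size γ δ γ≉0 = ⇔.trans permutation⇔offDiagonalNonzero offDiagonalNonzero⇔conditions
  where open CaseAnalysis q q-odd-prime-power K size γ δ γ≉0
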